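{- Let $k$ be an even positive integer, $d\ge1$ and $\ell\ge1$ integers, and let $\Phi$ be a random $k$-XOR instance with probability $p$ on $n$ variables. Then $$\mathbb{E}\,\mathrm{tr}\big((R^{\Phi,d})^{2\ell}\big)\le\frac{1}{|\mathbb{S}_{kd/2}|^{2\ell}}\sum_{\mathcal{Q}\text{ even}}\left[\big(p\,(kd/2)^{k/2}\big)^{|\mathcal{Q}|}\cdot\sum_{\substack{(I_1,\dots,I_{2\ell}):\\ \mathcal{Q}\text{ -valid}}}\ \prod_{j=1}^{2\ell}\mathrm{hist}(I_j)!\right],$$ where the outer sum is over all even partitions $\mathcal{Q}$ of the index set $\mathcal{I}=\{(j,s):j\in[2\ell],s\in[d]\}$, $|\mathcal{Q}|$ is the number of blocks of $\mathcal{Q}$, and the inner sum is over all $\mathcal{Q}$-valid tuples $(I_1,\dots,I_{2\ell})\in([n]^{kd/2})^{2\ell}$.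
   Context: A random $k$-XOR instance with probability $p$ on variables $x\in\{\pm1\}^n$: each of the $n^k$ tuples $S=(s_1,\dots,s_k)\in[n]^k$ is included independently with probability $p$, and for each included $S$ a constraint $\prod_{i=1}^k x_{s_i}=\eta_S$ is added, with $\eta_S$ independent Rademacher signs. Constraint tensor: $T_S=\eta_S$ if $S$ is included and $T_S=0$ otherwise. Let $M^\Phi$ be the $n^{k/2}\times n^{k/2}$ matrix indexed by $[n]^{k/2}$ with $M^\Phi_{U,V}=T_{(U,V)}$ (concatenation), and $S^\Phi=\frac12(M^\Phi+(M^\Phi)^\top)$. Let $S^{\Phi,d}$ be its $d$-th Kronecker power: indices in $[n]^{kd/2}$ are written as concatenations $(U_1,\dots,U_d)$ of $k/2$-tuples and $S^{\Phi,d}_{(U_1,\dots,U_d),(V_1,\dots,V_d)}=\prod_{s=1}^dS^\Phi_{U_s,V_s}$. $\mathbb{S}_q$ denotes the permutations of $[q]$. For $I=(i_1,\dots,i_q)$ and $\pi\in\mathbb{S}_q$, $\pi(I)=(i_{\pi(1)},\dots,i_{\pi(q)})$, and for a subtuple $U=(i_{j_1},\dots,i_{j_r})$ of $I$ (at positions $j_1,\dots,j_r$), $\pi(U)=(i_{\pi(j_1)},\dots,i_{\pi(j_r)})$. Define $R^{\Phi,d}_{I,J}=\frac{1}{|\mathbb{S}_{kd/2}|^2}\sum_{\pi,\sigma\in\mathbb{S}_{kd/2}}S^{\Phi,d}_{\pi(I),\sigma(J)}$ for $I,J\in[n]^{kd/2}$. For $I\in[n]^q$, $\mathrm{hist}(I)=(\alpha_1,\dots,\alpha_n)$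 with $\alpha_i$ the number of occurrences of $i$ in $I$, and $\mathrm{hist}(I)!=\prod_i\alpha_i!$. Partitions: given $I_1,\dots,I_{2\ell}\in[n]^{kd/2}$, write $I_j=(U_{j,1},\dots,U_{j,d})$ with $k/2$-tuples $U_{j,s}$, indices $j$ read modulo $2\ell$ (so $I_{2\ell+1}=I_1$). Given also permutations $\pi_j,\sigma_j\in\mathbb{S}_{kd/2}$, $\mathsf{Par}(\{I_j\},\{\pi_j\},\{\sigma_j\})$ is the partition of $\mathcal{I}=\{(j,s):j\in[2\ell],s\in[d]\}$ under the equivalence $(j,s)\sim(j',s')$ iff the ordered pair $(\pi_j(U_{j,s}),\sigma_j(U_{j+1,s}))$ equals either $(\pi_{j'}(U_{j',s'}),\sigma_{j'}(U_{j'+1,s'}))$ or $(\sigma_{j'}(U_{j'+1,s'}),\pi_{j'}(U_{j',s'}))$. A partition is even if every block has even size. A tuple $(I_1,\dots,I_{2\ell})$ is $\mathcal{Q}$-valid if there exist $\sigma_1,\dots,\sigma_{2\ell}\in\mathbb{S}_{kd/2}$ with $\mathsf{Par}(\{I_j\},\{\mathrm{id}\},\{\sigma_j\})=\mathcal{Q}$, where $\mathrm{id}$ is the identity permutation.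
   Formalization: The probability $p$ of the random $k$-XOR instance takes values in the rationals between 0 and 1. -}

module Defs where

open import Data.Bool using (Bool; true; false; _∧_; _∨_; not; if_then_else_)
open import Data.Nat as ℕ using (ℕ; zero; suc; _!; _≡ᵇ_; _<ᵇ_; _%_)
open import Data.Nat.Properties using (_!≢0)
open import Data.Nat.DivMod using (m%n<n)
open import Data.Fin as Fin using (Fin; toℕ; fromℕ<; combine)
open import Data.Fin.Properties using (all?; _≟_)
open import Data.List as List using (List; []; _∷_; map; concatMap; filterᵇ; allFin; length)
open import Data.Vec.Functional as VF using (Vector; _++_)
open import Data.Nat.ListAction
open import Data.Bool.ListAction
open import Data.Integer using (+_; -[1+_])
open import Data.Rational as ℚ using (ℚ; 0ℚ; 1ℚ; ½; _+_; _*_; _-_; -_)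
open import Relation.Nullary using (does)
open import Data.Product using (_×_; _,_)

allFuns : ∀ {B : Set} (a : ℕ) → List B → List (Fin a → B)
allFuns zero    bs = (λ ()) ∷ []
allFuns (suc a) bs = concatMap (λ b → map (λ f → b VF.∷ f) (allFuns a bs)) bs

funsOn : ∀ {A B : Set} → (A → A → Bool) → List A → List B → B → List (A → B)
funsOn eq []       bs d = (λ _ → d) ∷ []
funsOn eq (a ∷ as) bs d =
  concatMap (λ b → map (λ f → λ x → if eq x a then b else f x) (funsOn eq as bs d)) bs

sumL : ∀ {A : Set} → List A → (A → ℚ) → ℚ
sumL xs f = List.foldr (λ x r → f x + r) 0ℚ xs

prodL : ∀ {A : Set} → List A → (A → ℚ) → ℚ
prodL xs f = List.foldr (λ x r → f x * r) 1ℚ xs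

powℚ : ℚ → ℕ → ℚ
powℚ x zero    = 1ℚ
powℚ x (suc r) = x * powℚ x r

fromℕ : ℕ → ℚ
fromℕ n = + n ℚ./ 1

allB : ∀ {N} → (Fin N → Bool) → Bool
allB f = VF.foldr _∧_ true f

anyB : ∀ {N} → (Fin N → Bool) → Bool
anyB f = VF.foldr _∨_ false f

countB : ∀ {N} → (Fin N → Bool) → ℕ
countB f = VF.foldr (λ b r → if b then suc r else r) 0 f

Tup : ℕ → ℕ → Set
Tup n q = Fin q → Fin n

tuples : (n q : ℕ) → List (Tup n q)
tuples n q = allFuns q (allFin n)

eqT : ∀ {n q} → Tup n q → Tup n q → Bool
eqT u v = does (all? (λ i → u i ≟ v i))

isInjective : ∀ {q} → (Fin q → Fin q) → Bool
isInjective f = allB (λ i → allB (λ j → not (does (f i ≟ f j)) ∨ does (i ≟ j)))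

perms : (q : ℕ) → List (Fin q → Fin q)
perms q = filterᵇ isInjective (allFuns q (allFin q))

act : ∀ {n q} → (Fin q → Fin q) → Tup n q → Tup n q
act π I = λ t → I (π t)

-- I = (U_1,...,U_d) with U_s a tuple of length m:  U_s = block s I
block : ∀ {n d m} → Fin d → Tup n (d ℕ.* m) → Tup n m
block s I = λ j → I (combine s j)

histFact : ∀ {n q} → Tup n q → ℕ
histFact {n} I = Data.Nat.ListAction.product (map (λ i → (countB (λ t → does (I t ≟ i))) !) (allFin n))

-- Random k-XOR instance, k = m + m

-- the state of a tuple S: not included, included with η_S = +1, or η_S = -1
data Out : Set where
  absent plus minus : Out

val : Out → ℚ
val absent = 0ℚ
val plus   = 1ℚ
val minus  = - 1ℚ

prob : ℚ → Out → ℚ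
prob p absent = 1ℚ - p
prob p plus   = p * ½
prob p minus  = p * ½

Instance : ℕ → ℕ → Set
Instance n m = Tup n (m ℕ.+ m) → Out

instances : (n m : ℕ) → List (Instance n m)
instances n m = funsOn eqT (tuples n (m ℕ.+ m)) (absent ∷ plus ∷ minus ∷ []) absent

weight : ∀ {n m} → ℚ → Instance n m → ℚ
weight {n} {m} p ω = prodL (tuples n (m ℕ.+ m)) (λ S → prob p (ω S))

𝔼 : (n m : ℕ) → ℚ → (Instance n m → ℚ) → ℚ
𝔼 n m p F = sumL (instances n m) (λ ω → weight {n} {m} p ω * F ω)

Mat : ℕ → ℕ → Set
Mat n q = Tup n q → Tup n q → ℚ

idMat : ∀ {n q} → Mat n q
idMat I J = if eqT I J then 1ℚ else 0ℚ

mulMat : ∀ {n q} → Mat n q → Mat n q → Mat n q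
mulMat {n} {q} A B I J = sumL (tuples n q) (λ K → A I K * B K J)

powMat : ∀ {n q} → Mat n q → ℕ → Mat n q
powMat A zero    = idMat
powMat A (suc r) = mulMat A (powMat A r)

trace : ∀ {n q} → Mat n q → ℚ
trace {n} {q} A = sumL (tuples n q) (λ I → A I I)

Tens : ∀ {n m} → Instance n m → Tup n (m ℕ.+ m) → ℚ
Tens ω S = val (ω S)

MΦ : ∀ {n m} → Instance n m → Mat n m
MΦ {n} {m} ω U V = Tens {n} {m} ω (U ++ V)

SΦ : ∀ {n m} → Instance n m → Mat n m
SΦ ω U V = ½ * (MΦ ω U V + MΦ ω V U)

SΦd : ∀ {n m} (d : ℕ) → Instance n m → Mat n (d ℕ.* m)
SΦd {n} {m} d ω I J = prodL (allFin d) (λ s → SΦ ω (block s I) (block s J))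

inv! : ℕ → ℚ
inv! q = (+ 1 ℚ./ (q !)) {{q !≢0}}

RΦd : ∀ {n m} (d : ℕ) → Instance n m → Mat n (d ℕ.* m)
RΦd {n} {m} d ω I J =
  (inv! (d ℕ.* m) * inv! (d ℕ.* m)) *
  sumL (perms (d ℕ.* m)) (λ π → sumL (perms (d ℕ.* m)) (λ σ →
    SΦd d ω (act π I) (act σ J)))

next : ∀ {N} → Fin N → Fin N
next {suc N} j = fromℕ< (m%n<n (suc (toℕ j)) (suc N))

Rel : ℕ → ℕ → Set
Rel N d = Fin N → Fin d → Fin N → Fin d → Bool

allRels : (N d : ℕ) → List (Rel N d)
allRels N d = allFuns N (allFuns d (allFuns N (allFuns d (true ∷ false ∷ []))))

allP : ∀ {N d} → (Fin N → Fin d → Bool) → Bool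
allP f = allB (λ j → allB (λ s → f j s))

anyP : ∀ {N d} → (Fin N → Fin d → Bool) → Bool
anyP f = anyB (λ j → anyB (λ s → f j s))

_⇒ᵇ_ : Bool → Bool → Bool
a ⇒ᵇ b = not a ∨ b

_⇔ᵇ_ : Bool → Bool → Bool
a ⇔ᵇ b = (a ⇒ᵇ b) ∧ (b ⇒ᵇ a)

-- partitions are represented by their equivalence relations
isEquivalence : ∀ {N d} → Rel N d → Bool
isEquivalence Q =
  allP (λ j s → Q j s j s) ∧
  allP (λ j s → allP (λ j' s' → Q j s j' s' ⇒ᵇ Q j' s' j s)) ∧
  allP (λ j s → allP (λ j' s' → allP (λ j'' s'' →
    (Q j s j' s' ∧ Q j' s' j'' s'') ⇒ᵇ Q j s j'' s'')))

partitions : (N d : ℕ) → List (Rel N d)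
partitions N d = filterᵇ isEquivalence (allRels N d)

isEvenℕ : ℕ → Bool
isEvenℕ n = (n % 2) ≡ᵇ 0

countP : ∀ {N d} → (Fin N → Fin d → Bool) → ℕ
countP f = VF.foldr ℕ._+_ 0 (λ j → countB (λ s → f j s))

isEvenPartition : ∀ {N d} → Rel N d → Bool
isEvenPartition Q = allP (λ j s → isEvenℕ (countP (λ j' s' → Q j s j' s')))

evenPartitions : (N d : ℕ) → List (Rel N d)
evenPartitions N d = filterᵇ isEvenPartition (partitions N d)

-- |Q| = number of blocks = number of elements that are the first of their
-- block (w.r.t. the ordering of (j,s) by the position j·d + s)
pos : ∀ {N d} → Fin N → Fin d → ℕ
pos j s = toℕ (combine j s)

numBlocks : ∀ {N d} → Rel N d → ℕ
numBlocks Q = countP (λ j s → not (anyP (λ j' s' → (pos j' s' <ᵇ pos j s) ∧ Q j' s' j s)))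

edge : ∀ {n N d m} → (Fin N → Tup n (d ℕ.* m)) →
       (Fin N → Fin (d ℕ.* m) → Fin (d ℕ.* m)) →
       (Fin N → Fin (d ℕ.* m) → Fin (d ℕ.* m)) →
       Fin N → Fin d → Tup n m × Tup n m
edge Is πs σs j s = block s (act (πs j) (Is j)) , block s (act (σs j) (Is (next j)))

Par : ∀ {n N d m} → (Fin N → Tup n (d ℕ.* m)) →
      (Fin N → Fin (d ℕ.* m) → Fin (d ℕ.* m)) →
      (Fin N → Fin (d ℕ.* m) → Fin (d ℕ.* m)) → Rel N d
Par Is πs σs j s j' s' with edge Is πs σs j s | edge Is πs σs j' s'
... | (a , b) | (a' , b') = (eqT a a' ∧ eqT b b') ∨ (eqT a b' ∧ eqT b a')

samePartition : ∀ {N d} → Rel N d → Rel N d → Bool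
samePartition P Q = allP (λ j s → allP (λ j' s' → P j s j' s' ⇔ᵇ Q j s j' s'))

isValid : ∀ {n N d m} → Rel N d → (Fin N → Tup n (d ℕ.* m)) → Bool
isValid {n} {N} {d} {m} Q Is =
  Data.Bool.ListAction.any (λ σs → samePartition (Par Is (λ _ t → t) σs) Q) (allFuns N (perms (d ℕ.* m)))

validTuples : (n N d m : ℕ) → Rel N d → List (Fin N → Tup n (d ℕ.* m))
validTuples n N d m Q = filterᵇ (isValid Q) (allFuns N (tuples n (d ℕ.* m)))

-- Write k = 2m and q = kd/2 = dm.  Expanding the trace and both symmetrisations, the expected
-- trace is |S_q|^{-4ℓ} times a sum, over tuples I_1, …, I_{2ℓ} and permutations π_j, σ_j, of the
-- expectation of a product of entries S^Φ_{U,V}, one for each index (j,s), whose edges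
-- {U,V} = {π_j(U_{j,s}), σ_j(U_{j+1,s})} induce the partition Par({I_j},{π_j},{σ_j}).
-- Entries on different edges read disjoint constraints, hence are independent; a block of odd size
-- has expectation 0, since flipping the two signs of its edge negates the product; and as
-- |S^Φ_{U,V}| ≤ 1, a block of even size contributes at most 𝔼|S^Φ_{U,V}| ≤ p.  So a term is at
-- most p^|Q| when Par = Q is even and vanishes otherwise.
-- Substituting I_j ↦ π_j(I_j) and σ_j ↦ π_{j+1}⁻¹ σ_j removes the π_j, which then contribute a
-- factor |S_q|^{2ℓ}.  For fixed I, some σ with Par({I_j},{id},{σ_j}) = Q exists only if I is
-- Q-valid; σ is determined by the targets J_j = σ_j(I_{j+1}) up to ∏_j hist(I_j)! choices, and J
-- by its m-blocks at the first index of every block of Q, whose entries lie among the at most q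
-- entries of I_{j+1}; this leaves at most q^{m|Q|} targets.

module Submission where

open import Defs
open import Data.Nat as ℕ using (ℕ; _≥_; _!)
open import Data.Rational using (ℚ; 0ℚ; 1ℚ; _≤_; _*_)
open import Data.List using (List)

open import Algebra.Bundles using (CommutativeMonoid)
import Algebra.Properties.CommutativeSemigroup as CommSemigroupProperties
import Algebra.Properties.Group as GroupProperties
open import Data.Bool using (Bool; true; false; _∧_; _∨_; not; if_then_else_)
import Data.Bool.ListAction as BoolList
import Data.Bool.Properties as BoolP
open import Data.Empty using (⊥; ⊥-elim)
open import Data.Fin as Fin using (Fin; zero; suc; toℕ; combine)
open import Data.Fin.Properties as FinP using (_≟_)
import Data.Integer as ℤ
import Data.Integer.Properties as ℤP
open import Data.List as List using ([]; _∷_; map; concatMap; filterᵇ; allFin; _++_)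
import Data.List.Membership.Propositional as Membership
import Data.List.Membership.Propositional.Properties as MembershipP
import Data.List.Properties as ListP
open import Data.List.Relation.Unary.All as All using (All; []; _∷_)
import Data.List.Relation.Unary.All.Properties as AllP
import Data.List.Relation.Unary.AllPairs as AllPairs
import Data.List.Relation.Unary.AllPairs.Properties as AllPairsP
open import Data.List.Relation.Unary.Any as Any using (Any)
open import Data.Nat using (zero; suc)
import Data.Nat.Coprimality as Coprimality
import Data.Nat.DivMod as ℕDivMod
import Data.Nat.ListAction as ℕList
import Data.Nat.Properties as ℕP
open import Data.Product using (Σ; _×_; _,_; proj₁; proj₂)
open import Data.Rational as ℚ using (½; _+_; _-_; -_; ∣_∣)
import Data.Rational.Properties as ℚP
open import Data.Sum using (_⊎_; inj₁; inj₂)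
import Data.Vec.Functional as Vector
import Data.Vec.Functional.Properties as VectorP
open import Function using (_∘_; id)
open import Function.Bundles using (Equivalence)
open import Relation.Binary using (tri<; tri≈; tri>)
open import Relation.Binary.PropositionalEquality using (_≡_; _≢_; refl; sym; trans; cong; cong₂; module ≡-Reasoning)
open import Relation.Nullary using (Dec; does; yes; no; ¬_)
open import Relation.Nullary.Decidable using (dec-true; dec-false)

open CommSemigroupProperties (CommutativeMonoid.commutativeSemigroup ℚP.+-0-commutativeMonoid)
  using () renaming (interchange to +-interchange; x∙yz≈y∙xz to x+[y+z]≡y+[x+z])
open CommSemigroupProperties (CommutativeMonoid.commutativeSemigroup ℚP.*-1-commutativeMonoid)
  using () renaming (interchange to *-interchange; x∙yz≈y∙xz to x*[y*z]≡y*[x*z])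
open GroupProperties ℚP.+-0-group using () renaming (∙-cancelˡ to +-cancelˡ)

module _ {A : Set} where
  sumL-cong : (xs : List A) {f g : A → ℚ} → (∀ x → f x ≡ g x) → sumL xs f ≡ sumL xs g
  sumL-cong []       e = refl
  sumL-cong (x ∷ xs) e = cong₂ _+_ (e x) (sumL-cong xs e)

  sumL-cong-All : (xs : List A) {f g : A → ℚ} → All (λ x → f x ≡ g x) xs → sumL xs f ≡ sumL xs g
  sumL-cong-All []       []       = refl
  sumL-cong-All (x ∷ xs) (e ∷ es) = cong₂ _+_ e (sumL-cong-All xs es)

  prodL-cong : (xs : List A) {f g : A → ℚ} → (∀ x → f x ≡ g x) → prodL xs f ≡ prodL xs g
  prodL-cong []       e = refl
  prodL-cong (x ∷ xs) e = cong₂ _*_ (e x) (prodL-cong xs e)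

  prodL-cong-All : (xs : List A) {f g : A → ℚ} → All (λ x → f x ≡ g x) xs → prodL xs f ≡ prodL xs g
  prodL-cong-All []       []       = refl
  prodL-cong-All (x ∷ xs) (e ∷ es) = cong₂ _*_ e (prodL-cong-All xs es)

  sumL-++ : (xs ys : List A) (f : A → ℚ) → sumL (xs ++ ys) f ≡ sumL xs f + sumL ys f
  sumL-++ []       ys f = sym (ℚP.+-identityˡ _)
  sumL-++ (x ∷ xs) ys f = trans (cong (f x +_) (sumL-++ xs ys f)) (sym (ℚP.+-assoc (f x) _ _))

  sumL-0 : (xs : List A) → sumL xs (λ _ → 0ℚ) ≡ 0ℚ
  sumL-0 []       = refl
  sumL-0 (x ∷ xs) = trans (ℚP.+-identityˡ _) (sumL-0 xs)

  prodL-1 : (xs : List A) → prodL xs (λ _ → 1ℚ) ≡ 1ℚ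
  prodL-1 []       = refl
  prodL-1 (x ∷ xs) = trans (ℚP.*-identityˡ _) (prodL-1 xs)

  sumL-+ : (xs : List A) (f g : A → ℚ) → sumL xs (λ x → f x + g x) ≡ sumL xs f + sumL xs g
  sumL-+ []       f g = sym (ℚP.+-identityˡ _)
  sumL-+ (x ∷ xs) f g =
    trans (cong (f x + g x +_) (sumL-+ xs f g)) (+-interchange (f x) (g x) _ _)

  prodL-* : (xs : List A) (f g : A → ℚ) → prodL xs (λ x → f x * g x) ≡ prodL xs f * prodL xs g
  prodL-* []       f g = sym (ℚP.*-identityˡ _)
  prodL-* (x ∷ xs) f g =
    trans (cong (f x * g x *_) (prodL-* xs f g)) (*-interchange (f x) (g x) _ _)

  sumL-*ˡ : (xs : List A) (c : ℚ) (f : A → ℚ) → sumL xs (λ x → c * f x) ≡ c * sumL xs f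
  sumL-*ˡ []       c f = sym (ℚP.*-zeroʳ c)
  sumL-*ˡ (x ∷ xs) c f =
    trans (cong (c * f x +_) (sumL-*ˡ xs c f)) (sym (ℚP.*-distribˡ-+ c (f x) _))

  sumL-*ʳ : (xs : List A) (c : ℚ) (f : A → ℚ) → sumL xs (λ x → f x * c) ≡ sumL xs f * c
  sumL-*ʳ xs c f =
    trans (sumL-cong xs (λ x → ℚP.*-comm (f x) c)) (trans (sumL-*ˡ xs c f) (ℚP.*-comm c _))

  sumL-neg : (xs : List A) (f : A → ℚ) → sumL xs (λ x → - f x) ≡ - sumL xs f
  sumL-neg []       f = refl
  sumL-neg (x ∷ xs) f = trans (cong (- f x +_) (sumL-neg xs f)) (sym (ℚP.neg-distrib-+ (f x) _))

  sumL-map : {B : Set} (g : B → A) (ys : List B) (f : A → ℚ) → sumL (map g ys) f ≡ sumL ys (f ∘ g)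
  sumL-map g []       f = refl
  sumL-map g (y ∷ ys) f = cong (f (g y) +_) (sumL-map g ys f)

  prodL-map : {B : Set} (g : B → A) (ys : List B) (f : A → ℚ) → prodL (map g ys) f ≡ prodL ys (f ∘ g)
  prodL-map g []       f = refl
  prodL-map g (y ∷ ys) f = cong (f (g y) *_) (prodL-map g ys f)

  sumL-concatMap : {B : Set} (g : B → List A) (ys : List B) (f : A → ℚ) →
    sumL (concatMap g ys) f ≡ sumL ys (λ y → sumL (g y) f)
  sumL-concatMap g []       f = refl
  sumL-concatMap g (y ∷ ys) f =
    trans (sumL-++ (g y) (concatMap g ys) f) (cong (sumL (g y) f +_) (sumL-concatMap g ys f))

  sumL-filter : (P : A → Bool) (xs : List A) (f : A → ℚ) →
    sumL (filterᵇ P xs) f ≡ sumL xs (λ x → if P x then f x else 0ℚ)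
  sumL-filter P []       f = refl
  sumL-filter P (x ∷ xs) f with P x
  ... | true  = cong (f x +_) (sumL-filter P xs f)
  ... | false = trans (sumL-filter P xs f) (sym (ℚP.+-identityˡ _))

  sumL-mono : (xs : List A) {f g : A → ℚ} → (∀ x → f x ≤ g x) → sumL xs f ≤ sumL xs g
  sumL-mono []       h = ℚP.≤-refl
  sumL-mono (x ∷ xs) h = ℚP.+-mono-≤ (h x) (sumL-mono xs h)

  sumL-mono-All : (xs : List A) {f g : A → ℚ} → All (λ x → f x ≤ g x) xs → sumL xs f ≤ sumL xs g
  sumL-mono-All []       []       = ℚP.≤-refl
  sumL-mono-All (x ∷ xs) (h ∷ hs) = ℚP.+-mono-≤ h (sumL-mono-All xs hs)

sumL-swap : {A B : Set} (xs : List A) (ys : List B) (f : A → B → ℚ) →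
  sumL xs (λ x → sumL ys (f x)) ≡ sumL ys (λ y → sumL xs (λ x → f x y))
sumL-swap []       ys f = sym (sumL-0 ys)
sumL-swap (x ∷ xs) ys f =
  trans (cong (sumL ys (f x) +_) (sumL-swap xs ys f)) (sym (sumL-+ ys (f x) _))

0≤1 : 0ℚ ≤ 1ℚ
0≤1 = ℚP.nonNegative⁻¹ 1ℚ

0≤½ : 0ℚ ≤ ½
0≤½ = ℚP.nonNegative⁻¹ ½

*-mono-≤-nonNeg : ∀ {a b c d} → 0ℚ ≤ a → 0ℚ ≤ c → a ≤ b → c ≤ d → a * c ≤ b * d
*-mono-≤-nonNeg {a} {b} {c} {d} 0≤a 0≤c a≤b c≤d =
  ℚP.≤-trans (ℚP.*-monoʳ-≤-nonNeg c {{ℚ.nonNegative 0≤c}} a≤b)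
             (ℚP.*-monoˡ-≤-nonNeg b {{ℚ.nonNegative (ℚP.≤-trans 0≤a a≤b)}} c≤d)

*-monoˡ-≤-0≤ : ∀ {a b} c → 0ℚ ≤ c → a ≤ b → c * a ≤ c * b
*-monoˡ-≤-0≤ c 0≤c = ℚP.*-monoˡ-≤-nonNeg c {{ℚ.nonNegative 0≤c}}

*-monoʳ-≤-0≤ : ∀ {a b} c → 0ℚ ≤ c → a ≤ b → a * c ≤ b * c
*-monoʳ-≤-0≤ c 0≤c = ℚP.*-monoʳ-≤-nonNeg c {{ℚ.nonNegative 0≤c}}

0≤* : ∀ {a b} → 0ℚ ≤ a → 0ℚ ≤ b → 0ℚ ≤ a * b
0≤* {a} {b} 0≤a 0≤b =
  ℚP.≤-trans (ℚP.≤-reflexive (sym (ℚP.*-zeroˡ b))) (*-monoʳ-≤-0≤ b 0≤b 0≤a)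

1+p≰0 : ∀ p → 0ℚ ≤ p → ¬ (1ℚ + p ≤ 0ℚ)
1+p≰0 p 0≤p 1+p≤0 = ℚP.<-irrefl refl (ℚP.<-≤-trans (ℚP.positive⁻¹ 1ℚ)
  (ℚP.≤-trans (ℚP.≤-reflexive (sym (ℚP.+-identityʳ 1ℚ))) (ℚP.≤-trans (ℚP.+-monoʳ-≤ 1ℚ 0≤p) 1+p≤0)))

1+p≢0 : ∀ p → 0ℚ ≤ p → 1ℚ + p ≢ 0ℚ
1+p≢0 p 0≤p e = 1+p≰0 p 0≤p (ℚP.≤-reflexive e)

+-cancelˡ-≤ : ∀ a {c d} → a + c ≤ a + d → c ≤ d
+-cancelˡ-≤ a {c} {d} h = ℚP.≤-trans (ℚP.≤-reflexive (sym (-a+[a+x] c)))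
  (ℚP.≤-trans (ℚP.+-monoʳ-≤ (- a) h) (ℚP.≤-reflexive (-a+[a+x] d)))
  where
  -a+[a+x] : ∀ x → - a + (a + x) ≡ x
  -a+[a+x] x = trans (sym (ℚP.+-assoc (- a) a x)) (trans (cong (_+ x) (ℚP.+-inverseˡ a)) (ℚP.+-identityˡ x))

p≤∣p∣ : ∀ p → p ≤ ∣ p ∣
p≤∣p∣ p with ℚP.≤-total 0ℚ p
... | inj₁ 0≤p = ℚP.≤-reflexive (sym (ℚP.0≤p⇒∣p∣≡p 0≤p))
... | inj₂ p≤0 = ℚP.≤-trans p≤0 (ℚP.0≤∣p∣ p)

p≡-p⇒p≡0 : ∀ p → p ≡ - p → p ≡ 0ℚ
p≡-p⇒p≡0 p e = begin
  p                 ≡⟨ sym (ℚP.*-identityˡ p) ⟩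
  (½ + ½) * p       ≡⟨ ℚP.*-distribʳ-+ p ½ ½ ⟩
  ½ * p + ½ * p     ≡⟨ sym (ℚP.*-distribˡ-+ ½ p p) ⟩
  ½ * (p + p)       ≡⟨ cong (λ z → ½ * (p + z)) e ⟩
  ½ * (p + - p)     ≡⟨ cong (½ *_) (ℚP.+-inverseʳ p) ⟩
  ½ * 0ℚ            ≡⟨ ℚP.*-zeroʳ ½ ⟩
  0ℚ                ∎
  where open ≡-Reasoning

½*[p+p]≡p : ∀ p → ½ * (p + p) ≡ p
½*[p+p]≡p p = trans (ℚP.*-distribˡ-+ ½ p p) (trans (sym (ℚP.*-distribʳ-+ p ½ ½)) (ℚP.*-identityˡ p))

module _ {A : Set} where
  sumL-nonNeg : (xs : List A) {f : A → ℚ} → (∀ x → 0ℚ ≤ f x) → 0ℚ ≤ sumL xs f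
  sumL-nonNeg xs h = ℚP.≤-trans (ℚP.≤-reflexive (sym (sumL-0 xs))) (sumL-mono xs h)

  prodL-nonNeg : (xs : List A) {f : A → ℚ} → (∀ x → 0ℚ ≤ f x) → 0ℚ ≤ prodL xs f
  prodL-nonNeg []       h = 0≤1
  prodL-nonNeg (x ∷ xs) h = 0≤* (h x) (prodL-nonNeg xs h)

  prodL-mono : (xs : List A) {f g : A → ℚ} → (∀ x → 0ℚ ≤ f x) → (∀ x → f x ≤ g x) →
    prodL xs f ≤ prodL xs g
  prodL-mono []       h0 h = ℚP.≤-refl
  prodL-mono (x ∷ xs) h0 h = *-mono-≤-nonNeg (h0 x) (prodL-nonNeg xs h0) (h x) (prodL-mono xs h0 h)

  1≤prodL : (xs : List A) {f : A → ℚ} → (∀ x → 1ℚ ≤ f x) → 1ℚ ≤ prodL xs f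
  1≤prodL []       h = ℚP.≤-refl
  1≤prodL (x ∷ xs) h = ℚP.≤-trans (ℚP.≤-reflexive (sym (ℚP.*-identityˡ 1ℚ)))
    (*-mono-≤-nonNeg 0≤1 0≤1 (h x) (1≤prodL xs h))

  ∣prodL∣≤ : (xs : List A) {f g : A → ℚ} → (∀ x → ∣ f x ∣ ≤ g x) → ∣ prodL xs f ∣ ≤ prodL xs g
  ∣prodL∣≤ []       h = ℚP.≤-refl
  ∣prodL∣≤ (x ∷ xs) {f} h = ℚP.≤-trans (ℚP.≤-reflexive (ℚP.∣p*q∣≡∣p∣*∣q∣ (f x) (prodL xs f)))
    (*-mono-≤-nonNeg (ℚP.0≤∣p∣ (f x)) (ℚP.0≤∣p∣ (prodL xs f)) (h x) (∣prodL∣≤ xs h))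

  prodL-const : (xs : List A) (c : ℚ) → prodL xs (λ _ → c) ≡ powℚ c (List.length xs)
  prodL-const []       c = refl
  prodL-const (x ∷ xs) c = cong (c *_) (prodL-const xs c)

powℚ-+ : ∀ x a b → powℚ x (a ℕ.+ b) ≡ powℚ x a * powℚ x b
powℚ-+ x zero    b = sym (ℚP.*-identityˡ _)
powℚ-+ x (suc a) b = trans (cong (x *_) (powℚ-+ x a b)) (sym (ℚP.*-assoc x (powℚ x a) (powℚ x b)))

powℚ-* : ∀ a b k → powℚ (a * b) k ≡ powℚ a k * powℚ b k
powℚ-* a b zero    = sym (ℚP.*-identityˡ 1ℚ)
powℚ-* a b (suc k) = trans (cong (a * b *_) (powℚ-* a b k)) (*-interchange a b _ _)

powℚ-nonNeg : ∀ x → 0ℚ ≤ x → ∀ k → 0ℚ ≤ powℚ x k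
powℚ-nonNeg x 0≤x zero    = 0≤1
powℚ-nonNeg x 0≤x (suc k) = 0≤* 0≤x (powℚ-nonNeg x 0≤x k)

powℚ-1 : ∀ k → powℚ 1ℚ k ≡ 1ℚ
powℚ-1 zero    = refl
powℚ-1 (suc k) = trans (ℚP.*-identityˡ _) (powℚ-1 k)

𝟙 : Bool → ℚ
𝟙 true  = 1ℚ
𝟙 false = 0ℚ

𝟙-nonNeg : ∀ b → 0ℚ ≤ 𝟙 b
𝟙-nonNeg true  = 0≤1
𝟙-nonNeg false = ℚP.≤-refl

𝟙≤1 : ∀ b → 𝟙 b ≤ 1ℚ
𝟙≤1 true  = ℚP.≤-refl
𝟙≤1 false = 0≤1

𝟙-∧ : ∀ a b → 𝟙 (a ∧ b) ≡ 𝟙 a * 𝟙 b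
𝟙-∧ true  b = sym (ℚP.*-identityˡ (𝟙 b))
𝟙-∧ false b = sym (ℚP.*-zeroˡ (𝟙 b))

if-then-else-0 : ∀ b (x : ℚ) → (if b then x else 0ℚ) ≡ 𝟙 b * x
if-then-else-0 true  x = sym (ℚP.*-identityˡ x)
if-then-else-0 false x = sym (ℚP.*-zeroˡ x)

count : {A : Set} → List A → (A → Bool) → ℚ
count xs P = sumL xs (λ x → 𝟙 (P x))

count-nonNeg : {A : Set} (xs : List A) (P : A → Bool) → 0ℚ ≤ count xs P
count-nonNeg xs P = sumL-nonNeg xs (λ x → 𝟙-nonNeg (P x))

count-filter : {A : Set} (P Q : A → Bool) (xs : List A) →
  count (filterᵇ P xs) Q ≡ count xs (λ x → P x ∧ Q x)
count-filter P Q xs = trans (sumL-filter P xs (𝟙 ∘ Q)) (sumL-cong xs (λ x → lemma (P x) (Q x)))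
  where
  lemma : ∀ a b → (if a then 𝟙 b else 0ℚ) ≡ 𝟙 (a ∧ b)
  lemma true  b = refl
  lemma false b = refl

count≢0⇒Any : {A : Set} (xs : List A) (P : A → Bool) → count xs P ≢ 0ℚ → Any (λ x → P x ≡ true) xs
count≢0⇒Any []       P ne = ⊥-elim (ne refl)
count≢0⇒Any (x ∷ xs) P ne with P x in e
... | true  = Any.here e
... | false = Any.there (count≢0⇒Any xs P (λ z → ne (trans (ℚP.+-identityˡ _) z)))

count≡𝟙any*count : {A : Set} (P : A → Bool) (xs : List A) →
  count xs P ≡ 𝟙 (BoolList.any P xs) * count xs P
count≡𝟙any*count P xs with BoolList.any P xs in e
... | true  = sym (ℚP.*-identityˡ (count xs P))
... | false = trans (none xs e) (sym (ℚP.*-zeroˡ (count xs P)))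
  where
  none : (ys : List _) → BoolList.any P ys ≡ false → count ys P ≡ 0ℚ
  none []       e = refl
  none (y ∷ ys) e with P y
  ... | false = trans (ℚP.+-identityˡ (count ys P)) (none ys e)


false≢true : false ≢ true
false≢true ()

∧-true⁻ˡ : ∀ {a b} → a ∧ b ≡ true → a ≡ true
∧-true⁻ˡ {true} e = refl

∧-true⁻ʳ : ∀ {a b} → a ∧ b ≡ true → b ≡ true
∧-true⁻ʳ {true} e = e

∧-true⁺ : ∀ {a b} → a ≡ true → b ≡ true → a ∧ b ≡ true
∧-true⁺ refl refl = refl

∨-true⁻ : ∀ {a b} → a ∨ b ≡ true → (a ≡ true) ⊎ (b ≡ true)
∨-true⁻ {true}  e = inj₁ refl
∨-true⁻ {false} e = inj₂ e

∨-true⁺ˡ : ∀ {a b} → a ≡ true → a ∨ b ≡ true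
∨-true⁺ˡ refl = refl

∨-true⁺ʳ : ∀ {a b} → b ≡ true → a ∨ b ≡ true
∨-true⁺ʳ {true}  e = refl
∨-true⁺ʳ {false} e = e

⇒ᵇ-true⁺ : ∀ a b → (a ≡ true → b ≡ true) → (a ⇒ᵇ b) ≡ true
⇒ᵇ-true⁺ true  b h = h refl
⇒ᵇ-true⁺ false b h = refl

⇔ᵇ-true⁻ : ∀ a b → (a ⇔ᵇ b) ≡ true → a ≡ b
⇔ᵇ-true⁻ true  true  e = refl
⇔ᵇ-true⁻ false false e = refl

⇔ᵇ-comm : ∀ a b → (a ⇔ᵇ b) ≡ (b ⇔ᵇ a)
⇔ᵇ-comm true  true  = refl
⇔ᵇ-comm true  false = refl
⇔ᵇ-comm false true  = refl
⇔ᵇ-comm false false = refl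

Bool-ext : ∀ {a b : Bool} → (a ≡ true → b ≡ true) → (b ≡ true → a ≡ true) → a ≡ b
Bool-ext {true}  h _ = sym (h refl)
Bool-ext {false} {true}  _ h = h refl
Bool-ext {false} {false} _ _ = refl

dec-true⁻ : {P : Set} (p? : Dec P) → does p? ≡ true → P
dec-true⁻ (yes p) e = p

≟-comm : ∀ {n} (a b : Fin n) → does (a ≟ b) ≡ does (b ≟ a)
≟-comm a b = Bool-ext (λ e → dec-true (b ≟ a) (sym (dec-true⁻ (a ≟ b) e)))
                      (λ e → dec-true (a ≟ b) (sym (dec-true⁻ (b ≟ a) e)))

allB⁻ : ∀ {N} (f : Fin N → Bool) → allB f ≡ true → ∀ i → f i ≡ true
allB⁻ f e zero    = ∧-true⁻ˡ e
allB⁻ f e (suc i) = allB⁻ (f ∘ suc) (∧-true⁻ʳ {f zero} e) i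

allB⁺ : ∀ {N} (f : Fin N → Bool) → (∀ i → f i ≡ true) → allB f ≡ true
allB⁺ {zero}  f h = refl
allB⁺ {suc N} f h = ∧-true⁺ (h zero) (allB⁺ (f ∘ suc) (h ∘ suc))

allB-false⁻ : ∀ {N} (f : Fin N → Bool) → allB f ≡ false → Σ (Fin N) λ i → f i ≡ false
allB-false⁻ {suc N} f e with f zero in e0
... | false = zero , e0
... | true with allB-false⁻ (f ∘ suc) e
... | i , ei = suc i , ei

anyB⁻ : ∀ {N} (f : Fin N → Bool) → anyB f ≡ true → Σ (Fin N) λ i → f i ≡ true
anyB⁻ {suc N} f e with f zero in e0
... | true  = zero , e0
... | false with anyB⁻ (f ∘ suc) e
... | i , ei = suc i , ei

anyB⁺ : ∀ {N} (f : Fin N → Bool) (i : Fin N) → f i ≡ true → anyB f ≡ true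
anyB⁺ f zero    e = ∨-true⁺ˡ e
anyB⁺ f (suc i) e = ∨-true⁺ʳ {f zero} (anyB⁺ (f ∘ suc) i e)

allB-cong : ∀ {N} {f g : Fin N → Bool} → (∀ i → f i ≡ g i) → allB f ≡ allB g
allB-cong {zero}  h = refl
allB-cong {suc N} h = cong₂ _∧_ (h zero) (allB-cong (h ∘ suc))

anyB-cong : ∀ {N} {f g : Fin N → Bool} → (∀ i → f i ≡ g i) → anyB f ≡ anyB g
anyB-cong {zero}  h = refl
anyB-cong {suc N} h = cong₂ _∨_ (h zero) (anyB-cong (h ∘ suc))

countB-cong : ∀ {N} {f g : Fin N → Bool} → (∀ i → f i ≡ g i) → countB f ≡ countB g
countB-cong {zero}  h = refl
countB-cong {suc N} {f} {g} h rewrite h zero | countB-cong {f = f ∘ suc} {g ∘ suc} (h ∘ suc) = refl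

countB-true : ∀ q → countB {q} (λ _ → true) ≡ q
countB-true zero    = refl
countB-true (suc q) = cong suc (countB-true q)

allP⁻ : ∀ {N d} (f : Fin N → Fin d → Bool) → allP f ≡ true → ∀ j s → f j s ≡ true
allP⁻ f e j s = allB⁻ _ (allB⁻ _ e j) s

allP⁺ : ∀ {N d} (f : Fin N → Fin d → Bool) → (∀ j s → f j s ≡ true) → allP f ≡ true
allP⁺ f h = allB⁺ _ (λ j → allB⁺ _ (h j))

allP-false⁻ : ∀ {N d} (f : Fin N → Fin d → Bool) → allP f ≡ false →
  Σ (Fin N) λ j → Σ (Fin d) λ s → f j s ≡ false
allP-false⁻ f e with allB-false⁻ _ e
... | j , ej with allB-false⁻ _ ej
... | s , es = j , s , es

anyP⁻ : ∀ {N d} (f : Fin N → Fin d → Bool) → anyP f ≡ true →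
  Σ (Fin N) λ j → Σ (Fin d) λ s → f j s ≡ true
anyP⁻ f e with anyB⁻ _ e
... | j , ej with anyB⁻ _ ej
... | s , es = j , s , es

anyP⁺ : ∀ {N d} (f : Fin N → Fin d → Bool) j s → f j s ≡ true → anyP f ≡ true
anyP⁺ f j s e = anyB⁺ _ j (anyB⁺ _ s e)

allP-cong : ∀ {N d} {f g : Fin N → Fin d → Bool} → (∀ j s → f j s ≡ g j s) → allP f ≡ allP g
allP-cong h = allB-cong (λ j → allB-cong (h j))

anyP-cong : ∀ {N d} {f g : Fin N → Fin d → Bool} → (∀ j s → f j s ≡ g j s) → anyP f ≡ anyP g
anyP-cong h = anyB-cong (λ j → anyB-cong (h j))

countP-cong : ∀ {N d} {f g : Fin N → Fin d → Bool} → (∀ j s → f j s ≡ g j s) → countP f ≡ countP g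
countP-cong {zero}  h = refl
countP-cong {suc N} h = cong₂ ℕ._+_ (countB-cong (h zero)) (countP-cong (h ∘ suc))

eqT⁻ : ∀ {n q} (u v : Tup n q) → eqT u v ≡ true → ∀ i → u i ≡ v i
eqT⁻ u v = dec-true⁻ (FinP.all? (λ i → u i ≟ v i))

eqT⁺ : ∀ {n q} (u v : Tup n q) → (∀ i → u i ≡ v i) → eqT u v ≡ true
eqT⁺ u v = dec-true (FinP.all? (λ i → u i ≟ v i))

eqT-refl : ∀ {n q} (u : Tup n q) → eqT u u ≡ true
eqT-refl u = eqT⁺ u u (λ i → refl)

eqT-ext : ∀ {n q} {u u′ v v′ : Tup n q} → (∀ i → u i ≡ u′ i) → (∀ i → v i ≡ v′ i) →
  eqT u v ≡ eqT u′ v′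
eqT-ext {u = u} {u′} {v} {v′} hu hv =
  Bool-ext (λ e → eqT⁺ u′ v′ (λ i → trans (sym (hu i)) (trans (eqT⁻ u v e i) (hv i))))
           (λ e → eqT⁺ u v (λ i → trans (hu i) (trans (eqT⁻ u′ v′ e i) (sym (hv i)))))

eqT-sym : ∀ {n q} (u v : Tup n q) → eqT u v ≡ true → eqT v u ≡ true
eqT-sym u v e = eqT⁺ v u (λ i → sym (eqT⁻ u v e i))

eqT-trans : ∀ {n q} (u v w : Tup n q) → eqT u v ≡ true → eqT v w ≡ true → eqT u w ≡ true
eqT-trans u v w e₁ e₂ = eqT⁺ u w (λ i → trans (eqT⁻ u v e₁ i) (eqT⁻ v w e₂ i))

eqT-through : ∀ {n q} (t u v : Tup n q) → eqT t u ≡ true → eqT t v ≡ true → eqT u v ≡ true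
eqT-through t u v tu tv = eqT-trans u t v (eqT-sym t u tu) tv

eqT-comm : ∀ {n q} (u v : Tup n q) → eqT u v ≡ eqT v u
eqT-comm u v = Bool-ext (eqT-sym u v) (eqT-sym v u)

record BoolSetoid (A : Set) : Set where
  infix 4 _≈_
  field
    _≈_     : A → A → Bool
    ≈-refl  : ∀ x → (x ≈ x) ≡ true
    ≈-sym   : ∀ x y → (x ≈ y) ≡ true → (y ≈ x) ≡ true
    ≈-trans : ∀ x y z → (x ≈ y) ≡ true → (y ≈ z) ≡ true → (x ≈ z) ≡ true

  ≈-resp : ∀ x y c → (x ≈ y) ≡ true → (x ≈ c) ≡ (y ≈ c)
  ≈-resp x y c e = Bool-ext (≈-trans y x c (≈-sym x y e)) (≈-trans x y c e)

  Respects : {B : Set} → (A → B) → Set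
  Respects f = ∀ x y → (x ≈ y) ≡ true → f x ≡ f y

open BoolSetoid using (≈-refl; ≈-sym; ≈-trans; ≈-resp; Respects)

infix 4 _≈[_]_
_≈[_]_ : {A : Set} → A → BoolSetoid A → A → Bool
x ≈[ S ] y = BoolSetoid._≈_ S x y

finSetoid : ∀ n → BoolSetoid (Fin n)
finSetoid n = record
  { _≈_     = λ a b → does (a ≟ b)
  ; ≈-refl  = λ a → dec-true (a ≟ a) refl
  ; ≈-sym   = λ a b e → dec-true (b ≟ a) (sym (dec-true⁻ (a ≟ b) e))
  ; ≈-trans = λ a b c e₁ e₂ → dec-true (a ≟ c) (trans (dec-true⁻ (a ≟ b) e₁) (dec-true⁻ (b ≟ c) e₂))
  }

tupleSetoid : (n q : ℕ) → BoolSetoid (Tup n q)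
tupleSetoid n q = record
  { _≈_     = eqT
  ; ≈-refl  = eqT-refl
  ; ≈-sym   = eqT-sym
  ; ≈-trans = eqT-trans
  }

pointwiseSetoid : {A : Set} (a : ℕ) → BoolSetoid A → BoolSetoid (Fin a → A)
pointwiseSetoid a S = record
  { _≈_     = λ f g → allB (λ x → f x ≈[ S ] g x)
  ; ≈-refl  = λ f → allB⁺ _ (λ x → ≈-refl S (f x))
  ; ≈-sym   = λ f g e → allB⁺ _ (λ x → ≈-sym S (f x) (g x) (allB⁻ _ e x))
  ; ≈-trans = λ f g h e₁ e₂ → allB⁺ _ (λ x → ≈-trans S (f x) (g x) (h x) (allB⁻ _ e₁ x) (allB⁻ _ e₂ x))
  }

iffSetoid : BoolSetoid Bool
iffSetoid = record
  { _≈_     = _⇔ᵇ_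
  ; ≈-refl  = λ { true → refl ; false → refl }
  ; ≈-sym   = λ a b e → trans (⇔ᵇ-comm b a) e
  ; ≈-trans = λ a b c e₁ e₂ → trans (cong (a ⇔ᵇ_) (sym (⇔ᵇ-true⁻ b c e₂))) e₁
  }

module _ {A : Set} (S : BoolSetoid A) where
  open BoolSetoid S using (_≈_)

  private
    sumL-extract : (ys₁ ys₂ : List A) (y : A) (f : A → ℚ) →
      sumL (ys₁ ++ y ∷ ys₂) f ≡ f y + sumL (ys₁ ++ ys₂) f
    sumL-extract []        ys₂ y f = refl
    sumL-extract (x ∷ ys₁) ys₂ y f =
      trans (cong (f x +_) (sumL-extract ys₁ ys₂ y f)) (x+[y+z]≡y+[x+z] (f x) (f y) _)

    locate : (ys : List A) (P : A → Bool) → count ys P ≢ 0ℚ →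
      Σ (List A) λ ys₁ → Σ A λ y → Σ (List A) λ ys₂ → (ys ≡ ys₁ ++ y ∷ ys₂) × (P y ≡ true)
    locate ys P ne with Membership.find (count≢0⇒Any ys P ne)
    ... | y , y∈ys , Py with MembershipP.∈-∃++ y∈ys
    ... | ys₁ , ys₂ , split = ys₁ , y , ys₂ , split , Py

    head-counted : ∀ c zs → count (c ∷ zs) (_≈ c) ≢ 0ℚ
    head-counted c zs e = 1+p≢0 (count zs (_≈ c)) (count-nonNeg zs (_≈ c))
      (trans (cong (λ b → 𝟙 b + count zs (_≈ c)) (sym (≈-refl S c))) e)

  sumL-cong-counts : (xs ys : List A) → (∀ c → count xs (_≈ c) ≡ count ys (_≈ c)) →
    (f : A → ℚ) → Respects S f → sumL xs f ≡ sumL ys f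
  sumL-cong-counts []       []       h f rf = refl
  sumL-cong-counts []       (y ∷ ys) h f rf = ⊥-elim (head-counted y ys (sym (h y)))
  sumL-cong-counts (x ∷ xs) ys       h f rf
    with locate ys (_≈ x) (λ e → head-counted x xs (trans (h x) e))
  ... | ys₁ , y , ys₂ , refl , y≈x =
    trans (cong₂ _+_ (rf x y (≈-sym S y x y≈x)) (sumL-cong-counts xs (ys₁ ++ ys₂) h′ f rf))
          (sym (sumL-extract ys₁ ys₂ y f))
    where
    h′ : ∀ c → count xs (_≈ c) ≡ count (ys₁ ++ ys₂) (_≈ c)
    h′ c = +-cancelˡ (𝟙 (x ≈ c)) _ _ (trans (h c) (trans (sumL-extract ys₁ ys₂ y (λ z → 𝟙 (z ≈ c)))
             (cong (λ b → 𝟙 b + count (ys₁ ++ ys₂) (_≈ c)) (≈-resp S y x c y≈x))))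

  sumL-reindex : (xs : List A) (φ : A → A) → (∀ c → count xs (λ x → φ x ≈ c) ≡ count xs (_≈ c)) →
    (f : A → ℚ) → Respects S f → sumL xs (f ∘ φ) ≡ sumL xs f
  sumL-reindex xs φ h f rf = trans (sym (sumL-map φ xs f))
    (sumL-cong-counts (map φ xs) xs (λ c → trans (sumL-map φ xs (λ z → 𝟙 (z ≈ c))) (h c)) f rf)

module _ {A : Set} where
  sumL-tabulate : ∀ {n} (g : Fin n → A) (f : A → ℚ) → sumL (List.tabulate g) f ≡ sumL (allFin n) (f ∘ g)
  sumL-tabulate g f = trans (cong (λ xs → sumL xs f) (sym (ListP.map-tabulate id g))) (sumL-map g (allFin _) f)

  prodL-tabulate : ∀ {n} (g : Fin n → A) (f : A → ℚ) → prodL (List.tabulate g) f ≡ prodL (allFin n) (f ∘ g)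
  prodL-tabulate g f = trans (cong (λ xs → prodL xs f) (sym (ListP.map-tabulate id g))) (prodL-map g (allFin _) f)

sumL-allFin-suc : ∀ n (h : Fin (suc n) → ℚ) → sumL (allFin (suc n)) h ≡ h zero + sumL (allFin n) (h ∘ suc)
sumL-allFin-suc n h = cong (h zero +_) (sumL-tabulate suc h)

prodL-allFin-suc : ∀ n (h : Fin (suc n) → ℚ) → prodL (allFin (suc n)) h ≡ h zero * prodL (allFin n) (h ∘ suc)
prodL-allFin-suc n h = cong (h zero *_) (prodL-tabulate suc h)

module _ {B : Set} where
  sumL-allFuns-suc : (a : ℕ) (bs : List B) (F : (Fin (suc a) → B) → ℚ) →
    sumL (allFuns (suc a) bs) F ≡ sumL bs (λ b → sumL (allFuns a bs) (λ g → F (b Vector.∷ g)))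
  sumL-allFuns-suc a bs F = trans (sumL-concatMap _ bs F) (sumL-cong bs (λ b → sumL-map _ (allFuns a bs) F))

  prodL-sumL : (a : ℕ) (bs : List B) (h : Fin a → B → ℚ) →
    prodL (allFin a) (λ j → sumL bs (h j)) ≡ sumL (allFuns a bs) (λ f → prodL (allFin a) (λ j → h j (f j)))
  prodL-sumL zero    bs h = sym (ℚP.+-identityʳ 1ℚ)
  prodL-sumL (suc a) bs h = begin
    prodL (allFin (suc a)) (λ j → sumL bs (h j))
      ≡⟨ prodL-allFin-suc a (λ j → sumL bs (h j)) ⟩
    sumL bs (h zero) * prodL (allFin a) (λ j → sumL bs (h (suc j)))
      ≡⟨ cong (sumL bs (h zero) *_) (prodL-sumL a bs (h ∘ suc)) ⟩
    sumL bs (h zero) * sumL (allFuns a bs) tail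
      ≡⟨ sym (sumL-*ʳ bs (sumL (allFuns a bs) tail) (h zero)) ⟩
    sumL bs (λ b → h zero b * sumL (allFuns a bs) tail)
      ≡⟨ sumL-cong bs (λ b → sym (sumL-*ˡ (allFuns a bs) (h zero b) tail)) ⟩
    sumL bs (λ b → sumL (allFuns a bs) (λ g → h zero b * tail g))
      ≡⟨ sumL-cong bs (λ b → sumL-cong (allFuns a bs) (λ g →
           sym (prodL-allFin-suc a (λ j → h j ((b Vector.∷ g) j))))) ⟩
    sumL bs (λ b → sumL (allFuns a bs) (λ g → prodL (allFin (suc a)) (λ j → h j ((b Vector.∷ g) j))))
      ≡⟨ sym (sumL-allFuns-suc a bs (λ f → prodL (allFin (suc a)) (λ j → h j (f j)))) ⟩
    sumL (allFuns (suc a) bs) (λ f → prodL (allFin (suc a)) (λ j → h j (f j))) ∎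
    where
    open ≡-Reasoning
    tail : (Fin a → B) → ℚ
    tail g = prodL (allFin a) (λ j → h (suc j) (g j))

𝟙-allB : ∀ {a} (g : Fin a → Bool) → 𝟙 (allB g) ≡ prodL (allFin a) (λ x → 𝟙 (g x))
𝟙-allB {zero}  g = refl
𝟙-allB {suc a} g = trans (𝟙-∧ (g zero) (allB (g ∘ suc)))
  (trans (cong (𝟙 (g zero) *_) (𝟙-allB (g ∘ suc))) (sym (prodL-allFin-suc a (𝟙 ∘ g))))

count-allFuns : {B : Set} (a : ℕ) (bs : List B) (P : Fin a → B → Bool) →
  count (allFuns a bs) (λ f → allB (λ x → P x (f x))) ≡ prodL (allFin a) (λ x → count bs (P x))
count-allFuns a bs P = trans (sumL-cong (allFuns a bs) (λ f → 𝟙-allB (λ x → P x (f x))))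
  (sym (prodL-sumL a bs (λ x b → 𝟙 (P x b))))

count-allFin-≟ : ∀ n (c : Fin n) → count (allFin n) (λ b → does (b ≟ c)) ≡ 1ℚ
count-allFin-≟ (suc n) zero    = trans (sumL-allFin-suc n (λ b → 𝟙 (does (b ≟ zero))))
  (trans (cong (1ℚ +_) (sumL-0 (allFin n))) (ℚP.+-identityʳ 1ℚ))
count-allFin-≟ (suc n) (suc c) = trans (sumL-allFin-suc n (λ b → 𝟙 (does (b ≟ suc c))))
  (trans (ℚP.+-identityˡ _) (count-allFin-≟ n c))

count-pointwise-≈ : {B : Set} (S : BoolSetoid B) (a : ℕ) (bs : List B) →
  (∀ c → count bs (_≈[ S ] c) ≡ 1ℚ) → ∀ g → count (allFuns a bs) (_≈[ pointwiseSetoid a S ] g) ≡ 1ℚ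
count-pointwise-≈ S a bs h g =
  trans (count-allFuns a bs (λ x b → b ≈[ S ] g x)) (trans (prodL-cong (allFin a) (h ∘ g)) (prodL-1 (allFin a)))

eqT≡allB : ∀ {n q} (u v : Tup n q) → eqT u v ≡ allB (λ i → does (u i ≟ v i))
eqT≡allB u v = Bool-ext (λ e → allB⁺ _ (λ i → dec-true (u i ≟ v i) (eqT⁻ u v e i)))
                        (λ e → eqT⁺ u v (λ i → dec-true⁻ (u i ≟ v i) (allB⁻ _ e i)))

count-tuples-eqT : ∀ n q (c : Tup n q) → count (tuples n q) (λ u → eqT u c) ≡ 1ℚ
count-tuples-eqT n q c = trans (sumL-cong (tuples n q) (λ u → cong 𝟙 (eqT≡allB u c)))
  (count-pointwise-≈ (finSetoid n) q (allFin n) (count-allFin-≟ n) c)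

module _ {A : Set} (S : BoolSetoid A) where
  open BoolSetoid S using (_≈_)

  sumL-𝟙≈-* : (xs : List A) (r : A) (f : A → ℚ) → Respects S f →
    sumL xs (λ x → 𝟙 (x ≈ r) * f x) ≡ count xs (_≈ r) * f r
  sumL-𝟙≈-* xs r f f-resp = trans (sumL-cong xs pointwise) (sumL-*ʳ xs (f r) (λ x → 𝟙 (x ≈ r)))
    where
    pointwise : ∀ x → 𝟙 (x ≈ r) * f x ≡ 𝟙 (x ≈ r) * f r
    pointwise x with x ≈ r in e
    ... | true  = cong (1ℚ *_) (f-resp x r e)
    ... | false = trans (ℚP.*-zeroˡ (f x)) (sym (ℚP.*-zeroˡ (f r)))

  count-filter-≈ : (P : A → Bool) → Respects S P → (xs : List A) (r : A) →
    count (filterᵇ P xs) (_≈ r) ≡ 𝟙 (P r) * count xs (_≈ r)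
  count-filter-≈ P P-resp xs r =
    trans (count-filter P (_≈ r) xs) (trans (sumL-cong xs pointwise) (sumL-*ˡ xs (𝟙 (P r)) (λ x → 𝟙 (x ≈ r))))
    where
    pointwise : ∀ x → 𝟙 (P x ∧ (x ≈ r)) ≡ 𝟙 (P r) * 𝟙 (x ≈ r)
    pointwise x with x ≈ r in e
    ... | true  = trans (cong 𝟙 (trans (BoolP.∧-identityʳ (P x)) (P-resp x r e))) (sym (ℚP.*-identityʳ (𝟙 (P r))))
    ... | false = trans (cong 𝟙 (BoolP.∧-zeroʳ (P x))) (sym (ℚP.*-zeroʳ (𝟙 (P r))))

-- The product measure on sign patterns

outcomes : List Out
outcomes = absent ∷ plus ∷ minus ∷ []

flipSign : Out → Out
flipSign absent = absent
flipSign plus   = minus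
flipSign minus  = plus

flipIf : Bool → Out → Out
flipIf c o = if c then flipSign o else o

val-flipSign : ∀ o → val (flipSign o) ≡ - val o
val-flipSign absent = refl
val-flipSign plus   = refl
val-flipSign minus  = refl

∣val∣≤1 : ∀ o → ∣ val o ∣ ≤ 1ℚ
∣val∣≤1 absent = 0≤1
∣val∣≤1 plus   = ℚP.≤-refl
∣val∣≤1 minus  = ℚP.≤-refl

prob-nonNeg : ∀ {p} → 0ℚ ≤ p → p ≤ 1ℚ → ∀ o → 0ℚ ≤ prob p o
prob-nonNeg {p} 0≤p p≤1 absent =
  ℚP.≤-trans (ℚP.≤-reflexive (sym (ℚP.+-inverseʳ p))) (ℚP.+-monoˡ-≤ (- p) p≤1)
prob-nonNeg 0≤p p≤1 plus  = 0≤* 0≤p 0≤½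
prob-nonNeg 0≤p p≤1 minus = 0≤* 0≤p 0≤½

sumL-prob : ∀ p → sumL outcomes (prob p) ≡ 1ℚ
sumL-prob p = begin
  (1ℚ - p) + (p * ½ + (p * ½ + 0ℚ)) ≡⟨ cong (λ z → (1ℚ - p) + (p * ½ + z)) (ℚP.+-identityʳ (p * ½)) ⟩
  (1ℚ - p) + (p * ½ + p * ½)        ≡⟨ cong ((1ℚ - p) +_) (sym (ℚP.*-distribˡ-+ p ½ ½)) ⟩
  (1ℚ - p) + p * 1ℚ                 ≡⟨ cong ((1ℚ - p) +_) (ℚP.*-identityʳ p) ⟩
  (1ℚ - p) + p                      ≡⟨ ℚP.+-assoc 1ℚ (- p) p ⟩
  1ℚ + (- p + p)                    ≡⟨ cong (1ℚ +_) (ℚP.+-inverseˡ p) ⟩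
  1ℚ + 0ℚ                           ≡⟨ ℚP.+-identityʳ 1ℚ ⟩
  1ℚ                                ∎
  where open ≡-Reasoning

sumL-prob-* : ∀ p c → sumL outcomes (λ o → prob p o * c) ≡ c
sumL-prob-* p c = trans (sumL-*ʳ outcomes c (prob p)) (trans (cong (_* c) (sumL-prob p)) (ℚP.*-identityˡ c))

sumL-prob-∣val∣ : ∀ p → sumL outcomes (λ o → prob p o * ∣ val o ∣) ≡ p
sumL-prob-∣val∣ p = begin
  (1ℚ - p) * 0ℚ + (p * ½ * 1ℚ + (p * ½ * 1ℚ + 0ℚ))
    ≡⟨ cong₂ _+_ (ℚP.*-zeroʳ (1ℚ - p))
                 (cong₂ _+_ (ℚP.*-identityʳ (p * ½)) (trans (ℚP.+-identityʳ _) (ℚP.*-identityʳ (p * ½)))) ⟩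
  0ℚ + (p * ½ + p * ½) ≡⟨ ℚP.+-identityˡ _ ⟩
  p * ½ + p * ½        ≡⟨ sym (ℚP.*-distribˡ-+ p ½ ½) ⟩
  p * 1ℚ               ≡⟨ ℚP.*-identityʳ p ⟩
  p                    ∎
  where open ≡-Reasoning

-- Both non-zero outcomes have probability p/2, so flipping signs preserves the distribution.
sumL-prob-flipIf : ∀ p c (g : Out → ℚ) →
  sumL outcomes (λ o → prob p o * g (flipIf c o)) ≡ sumL outcomes (λ o → prob p o * g o)
sumL-prob-flipIf p false g = refl
sumL-prob-flipIf p true  g = cong (prob p absent * g absent +_)
  (trans (cong (a +_) (ℚP.+-identityʳ b)) (trans (ℚP.+-comm a b) (cong (b +_) (sym (ℚP.+-identityʳ a)))))
  where
  a b : ℚ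
  a = prob p minus * g minus
  b = prob p plus * g plus

any-true⁻ : {I : Set} (P : I → Bool) (xs : List I) → BoolList.any P xs ≡ true → Any (λ i → P i ≡ true) xs
any-true⁻ P (i ∷ xs) e with P i in e₁
... | true  = Any.here e₁
... | false = Any.there (any-true⁻ P xs e)

module _ {X : Set} (S : BoolSetoid X) where
  open BoolSetoid S using (_≈_)

  Fresh : X → List X → Set
  Fresh a L = All (λ t → (t ≈ a) ≡ false) L

  Distinct : List X → Set
  Distinct = AllPairs.AllPairs (λ a t → (t ≈ a) ≡ false)

  count≤0⇒All-false : (L : List X) (P : X → Bool) → count L P ≤ 0ℚ → All (λ t → P t ≡ false) L
  count≤0⇒All-false []      P h = []
  count≤0⇒All-false (t ∷ L) P h with P t in e
  ... | true  = ⊥-elim (1+p≰0 _ (count-nonNeg L P) h)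
  ... | false = e ∷ count≤0⇒All-false L P (ℚP.≤-trans (ℚP.≤-reflexive (sym (ℚP.+-identityˡ _))) h)

  count≤1⇒Distinct : (L : List X) → (∀ c → count L (_≈ c) ≤ 1ℚ) → Distinct L
  count≤1⇒Distinct []      h = AllPairs.[]
  count≤1⇒Distinct (a ∷ L) h = fresh AllPairs.∷ count≤1⇒Distinct L (λ c → ℚP.≤-trans (tail≤ c) (h c))
    where
    fresh : Fresh a L
    fresh = count≤0⇒All-false L (_≈ a) (+-cancelˡ-≤ 1ℚ (begin
      1ℚ + count L (_≈ a)      ≡⟨ cong (λ b → 𝟙 b + count L (_≈ a)) (sym (≈-refl S a)) ⟩
      count (a ∷ L) (_≈ a)     ≤⟨ h a ⟩
      1ℚ                       ≡⟨ sym (ℚP.+-identityʳ 1ℚ) ⟩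
      1ℚ + 0ℚ                  ∎))
      where open ℚP.≤-Reasoning
    tail≤ : ∀ c → count L (_≈ c) ≤ count (a ∷ L) (_≈ c)
    tail≤ c = ℚP.≤-trans (ℚP.≤-reflexive (sym (ℚP.+-identityˡ _))) (ℚP.+-monoˡ-≤ _ (𝟙-nonNeg (a ≈ c)))

module ProductMeasure {X : Set} (S : BoolSetoid X) (p : ℚ) where
  open BoolSetoid S using (_≈_)

  Config : Set
  Config = X → Out

  weightᴸ : List X → Config → ℚ
  weightᴸ L ω = prodL L (λ t → prob p (ω t))

  configs : List X → List Config
  configs L = funsOn _≈_ L outcomes absent

  -- 𝔼 n m p is 𝔼ᴸ (tuples n (m + m)) for S = tupleSetoid n (m + m), by definition.
  𝔼ᴸ : List X → (Config → ℚ) → ℚ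
  𝔼ᴸ L F = sumL (configs L) (λ ω → weightᴸ L ω * F ω)

  update : Config → X → Out → Config
  update ω a b x = if x ≈ a then b else ω x

  DependsOnly : (X → Bool) → (Config → ℚ) → Set
  DependsOnly D G = ∀ ω ω′ → (∀ x → D x ≡ true → ω x ≡ ω′ x) → G ω ≡ G ω′

  Extensional : (Config → ℚ) → Set
  Extensional F = ∀ ω ω′ → (∀ x → ω x ≡ ω′ x) → F ω ≡ F ω′

  𝔼ᴸ-[] : (F : Config → ℚ) → 𝔼ᴸ [] F ≡ F (λ _ → absent)
  𝔼ᴸ-[] F = trans (ℚP.+-identityʳ _) (ℚP.*-identityˡ _)

  𝔼ᴸ-∷ : (a : X) (L : List X) → Fresh S a L → (F : Config → ℚ) →
    𝔼ᴸ (a ∷ L) F ≡ sumL outcomes (λ b → prob p b * 𝔼ᴸ L (λ ω → F (update ω a b)))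
  𝔼ᴸ-∷ a L fresh F = trans (sumL-concatMap (λ b → map (λ ω → update ω a b) (configs L)) outcomes wF)
    (sumL-cong outcomes (λ b → trans (sumL-map (λ ω → update ω a b) (configs L) wF)
      (trans (sumL-cong (configs L) (λ ω → factor-out b ω))
             (sumL-*ˡ (configs L) (prob p b) (λ ω → weightᴸ L ω * F (update ω a b))))))
    where
    wF : Config → ℚ
    wF ω = weightᴸ (a ∷ L) ω * F ω
    others : ∀ b ω → weightᴸ L (update ω a b) ≡ weightᴸ L ω
    others b ω = prodL-cong-All L (All.map (λ {t} t≉a → cong (λ z → prob p (if z then b else ω t)) t≉a) fresh)
    factor-out : ∀ b ω → weightᴸ (a ∷ L) (update ω a b) * F (update ω a b)
                         ≡ prob p b * (weightᴸ L ω * F (update ω a b))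
    factor-out b ω rewrite ≈-refl S a =
      trans (cong (λ z → prob p b * z * F (update ω a b)) (others b ω)) (ℚP.*-assoc (prob p b) _ _)

  𝔼ᴸ-cong : (L : List X) {F G : Config → ℚ} → (∀ ω → F ω ≡ G ω) → 𝔼ᴸ L F ≡ 𝔼ᴸ L G
  𝔼ᴸ-cong L e = sumL-cong (configs L) (λ ω → cong (weightᴸ L ω *_) (e ω))

  𝔼ᴸ-*ˡ : (L : List X) (c : ℚ) (F : Config → ℚ) → 𝔼ᴸ L (λ ω → c * F ω) ≡ c * 𝔼ᴸ L F
  𝔼ᴸ-*ˡ L c F = trans (sumL-cong (configs L) (λ ω → x*[y*z]≡y*[x*z] (weightᴸ L ω) c (F ω)))
                      (sumL-*ˡ (configs L) c (λ ω → weightᴸ L ω * F ω))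

  𝔼ᴸ-+ : (L : List X) (F G : Config → ℚ) → 𝔼ᴸ L (λ ω → F ω + G ω) ≡ 𝔼ᴸ L F + 𝔼ᴸ L G
  𝔼ᴸ-+ L F G = trans (sumL-cong (configs L) (λ ω → ℚP.*-distribˡ-+ (weightᴸ L ω) (F ω) (G ω)))
                     (sumL-+ (configs L) (λ ω → weightᴸ L ω * F ω) (λ ω → weightᴸ L ω * G ω))

  𝔼ᴸ-neg : (L : List X) (F : Config → ℚ) → 𝔼ᴸ L (λ ω → - F ω) ≡ - 𝔼ᴸ L F
  𝔼ᴸ-neg L F = trans (sumL-cong (configs L) (λ ω → sym (ℚP.neg-distribʳ-* (weightᴸ L ω) (F ω))))
                     (sumL-neg (configs L) (λ ω → weightᴸ L ω * F ω))

  𝔼ᴸ-sumL : {A : Set} (L : List X) (xs : List A) (F : A → Config → ℚ) →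
    𝔼ᴸ L (λ ω → sumL xs (λ x → F x ω)) ≡ sumL xs (λ x → 𝔼ᴸ L (F x))
  𝔼ᴸ-sumL L []       F = trans (sumL-cong (configs L) (λ ω → ℚP.*-zeroʳ (weightᴸ L ω))) (sumL-0 (configs L))
  𝔼ᴸ-sumL L (x ∷ xs) F = trans (𝔼ᴸ-+ L (F x) _) (cong (𝔼ᴸ L (F x) +_) (𝔼ᴸ-sumL L xs F))

  𝔼ᴸ-mono : 0ℚ ≤ p → p ≤ 1ℚ → (L : List X) {F G : Config → ℚ} → (∀ ω → F ω ≤ G ω) → 𝔼ᴸ L F ≤ 𝔼ᴸ L G
  𝔼ᴸ-mono 0≤p p≤1 L h = sumL-mono (configs L)
    (λ ω → *-monoˡ-≤-0≤ (weightᴸ L ω) (prodL-nonNeg L (λ t → prob-nonNeg 0≤p p≤1 (ω t))) (h ω))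

  𝔼ᴸ-const : (L : List X) → Distinct S L → (c : ℚ) → 𝔼ᴸ L (λ _ → c) ≡ c
  𝔼ᴸ-const []      _                c = 𝔼ᴸ-[] (λ _ → c)
  𝔼ᴸ-const (a ∷ L) (fresh AllPairs.∷ d) c = trans (𝔼ᴸ-∷ a L fresh _)
    (trans (sumL-cong outcomes (λ b → cong (prob p b *_) (𝔼ᴸ-const L d c))) (sumL-prob-* p c))

  𝔼ᴸ-coordinate : (L : List X) → Distinct S L → (x : X) → Any (λ t → (x ≈ t) ≡ true) L → (h : Out → ℚ) →
    𝔼ᴸ L (λ ω → h (ω x)) ≡ sumL outcomes (λ b → prob p b * h b)
  𝔼ᴸ-coordinate (a ∷ L) (fresh AllPairs.∷ d) x x∈L h with x ≈ a in e
  ... | true  = trans (𝔼ᴸ-∷ a L fresh _) (sumL-cong outcomes (λ b → cong (prob p b *_)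
       (trans (𝔼ᴸ-cong L (λ ω → cong (λ z → h (if z then b else ω x)) e)) (𝔼ᴸ-const L d (h b)))))
  ... | false = trans (𝔼ᴸ-∷ a L fresh _) (trans (sumL-cong outcomes (λ b → cong (prob p b *_)
       (trans (𝔼ᴸ-cong L (λ ω → cong (λ z → h (if z then b else ω x)) e))
              (𝔼ᴸ-coordinate L d x (in-tail x∈L) h))))
       (sumL-prob-* p _))
    where
    in-tail : Any (λ t → (x ≈ t) ≡ true) (a ∷ L) → Any (λ t → (x ≈ t) ≡ true) L
    in-tail (Any.here x≈a)  = ⊥-elim (false≢true (trans (sym e) x≈a))
    in-tail (Any.there x∈L) = x∈L

  update-outside : (D : X → Bool) → Respects S D → (G : Config → ℚ) → DependsOnly D G →
    (a : X) → D a ≡ false → ∀ b ω → G (update ω a b) ≡ G ω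
  update-outside D D-resp G G-dep a Da≡false b ω = G-dep (update ω a b) ω unchanged
    where
    unchanged : ∀ x → D x ≡ true → update ω a b x ≡ ω x
    unchanged x Dx with x ≈ a in e
    ... | true  = ⊥-elim (false≢true (trans (sym Da≡false) (trans (sym (D-resp x a e)) Dx)))
    ... | false = refl

  DependsOnly-update : (D : X → Bool) (G : Config → ℚ) → DependsOnly D G →
    ∀ a b → DependsOnly D (λ ω → G (update ω a b))
  DependsOnly-update D G G-dep a b ω ω′ h = G-dep _ _ (λ x Dx → cong (if x ≈ a then b else_) (h x Dx))

  𝔼ᴸ-∷-outside : (a : X) (L : List X) → Fresh S a L → (D : X → Bool) → Respects S D →
    (G : Config → ℚ) → DependsOnly D G → D a ≡ false → 𝔼ᴸ (a ∷ L) G ≡ 𝔼ᴸ L G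
  𝔼ᴸ-∷-outside a L fresh D D-resp G G-dep Da≡false = trans (𝔼ᴸ-∷ a L fresh G)
    (trans (sumL-cong outcomes (λ b → cong (prob p b *_)
             (𝔼ᴸ-cong L (update-outside D D-resp G G-dep a Da≡false b))))
           (sumL-prob-* p _))

  private
    𝔼ᴸ-*-∷ : (a : X) (L : List X) → Fresh S a L → (D E : X → Bool) → Respects S E →
      (G H : Config → ℚ) → DependsOnly D G → DependsOnly E H → E a ≡ false →
      (∀ G′ → DependsOnly D G′ → 𝔼ᴸ L (λ ω → G′ ω * H ω) ≡ 𝔼ᴸ L G′ * 𝔼ᴸ L H) →
      𝔼ᴸ (a ∷ L) (λ ω → G ω * H ω) ≡ 𝔼ᴸ (a ∷ L) G * 𝔼ᴸ (a ∷ L) H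
    𝔼ᴸ-*-∷ a L fresh D E E-resp G H G-dep H-dep Ea≡false IH = begin
      𝔼ᴸ (a ∷ L) (λ ω → G ω * H ω)
        ≡⟨ 𝔼ᴸ-∷ a L fresh _ ⟩
      sumL outcomes (λ b → prob p b * 𝔼ᴸ L (λ ω → G (update ω a b) * H (update ω a b)))
        ≡⟨ sumL-cong outcomes (λ b → cong (prob p b *_) (trans
             (𝔼ᴸ-cong L (λ ω → cong (G (update ω a b) *_) (update-outside E E-resp H H-dep a Ea≡false b ω)))
             (IH (G ∘ (λ ω → update ω a b)) (DependsOnly-update D G G-dep a b)))) ⟩
      sumL outcomes (λ b → prob p b * (𝔼ᴸ L (G ∘ (λ ω → update ω a b)) * 𝔼ᴸ L H))
        ≡⟨ sumL-cong outcomes (λ b → sym (ℚP.*-assoc (prob p b) (𝔼ᴸ L (G ∘ (λ ω → update ω a b))) (𝔼ᴸ L H))) ⟩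
      sumL outcomes (λ b → prob p b * 𝔼ᴸ L (G ∘ (λ ω → update ω a b)) * 𝔼ᴸ L H)
        ≡⟨ sumL-*ʳ outcomes (𝔼ᴸ L H) (λ b → prob p b * 𝔼ᴸ L (G ∘ (λ ω → update ω a b))) ⟩
      sumL outcomes (λ b → prob p b * 𝔼ᴸ L (G ∘ (λ ω → update ω a b))) * 𝔼ᴸ L H
        ≡⟨ cong₂ _*_ (sym (𝔼ᴸ-∷ a L fresh G)) (sym (𝔼ᴸ-∷-outside a L fresh E E-resp H H-dep Ea≡false)) ⟩
      𝔼ᴸ (a ∷ L) G * 𝔼ᴸ (a ∷ L) H ∎
      where open ≡-Reasoning

  𝔼ᴸ-*-independent : (L : List X) → Distinct S L → (D E : X → Bool) → Respects S D → Respects S E →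
    (∀ x → D x ≡ true → E x ≡ true → ⊥) →
    (G H : Config → ℚ) → DependsOnly D G → DependsOnly E H →
    𝔼ᴸ L (λ ω → G ω * H ω) ≡ 𝔼ᴸ L G * 𝔼ᴸ L H
  𝔼ᴸ-*-independent [] _ D E _ _ _ G H _ _ =
    trans (𝔼ᴸ-[] (λ ω → G ω * H ω)) (sym (cong₂ _*_ (𝔼ᴸ-[] G) (𝔼ᴸ-[] H)))
  𝔼ᴸ-*-independent (a ∷ L) (fresh AllPairs.∷ d) D E D-resp E-resp disjoint G H G-dep H-dep
    with E a in Ea | D a in Da
  ... | false | _ = 𝔼ᴸ-*-∷ a L fresh D E E-resp G H G-dep H-dep Ea
        (λ G′ G′-dep → 𝔼ᴸ-*-independent L d D E D-resp E-resp disjoint G′ H G′-dep H-dep)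
  ... | true | false = begin
      𝔼ᴸ (a ∷ L) (λ ω → G ω * H ω)     ≡⟨ 𝔼ᴸ-cong (a ∷ L) (λ ω → ℚP.*-comm (G ω) (H ω)) ⟩
      𝔼ᴸ (a ∷ L) (λ ω → H ω * G ω)     ≡⟨ 𝔼ᴸ-*-∷ a L fresh E D D-resp H G H-dep G-dep Da
           (λ H′ H′-dep → 𝔼ᴸ-*-independent L d E D E-resp D-resp (λ x Ex Dx → disjoint x Dx Ex) H′ G H′-dep G-dep) ⟩
      𝔼ᴸ (a ∷ L) H * 𝔼ᴸ (a ∷ L) G      ≡⟨ ℚP.*-comm (𝔼ᴸ (a ∷ L) H) (𝔼ᴸ (a ∷ L) G) ⟩
      𝔼ᴸ (a ∷ L) G * 𝔼ᴸ (a ∷ L) H      ∎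
    where open ≡-Reasoning
  ... | true | true = ⊥-elim (disjoint a Da Ea)

  DependsOnly-prodL : {I : Set} (is : List I) (D : I → X → Bool) (G : I → Config → ℚ) →
    (∀ i → DependsOnly (D i) (G i)) →
    DependsOnly (λ x → BoolList.any (λ i → D i x) is) (λ ω → prodL is (λ i → G i ω))
  DependsOnly-prodL []       D G G-dep ω ω′ h = refl
  DependsOnly-prodL (i ∷ is) D G G-dep ω ω′ h =
    cong₂ _*_ (G-dep i ω ω′ (λ x Dix → h x (∨-true⁺ˡ Dix)))
              (DependsOnly-prodL is D G G-dep ω ω′ (λ x Dx → h x (∨-true⁺ʳ {D i x} Dx)))

  𝔼ᴸ-prodL-independent : (L : List X) → Distinct S L → {I : Set} (is : List I) (D : I → X → Bool)
    (G : I → Config → ℚ) → (∀ i → Respects S (D i)) → (∀ i → DependsOnly (D i) (G i)) →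
    AllPairs.AllPairs (λ i j → ∀ x → D i x ≡ true → D j x ≡ true → ⊥) is →
    𝔼ᴸ L (λ ω → prodL is (λ i → G i ω)) ≡ prodL is (λ i → 𝔼ᴸ L (G i))
  𝔼ᴸ-prodL-independent L d []       D G D-resp G-dep _ = 𝔼ᴸ-const L d 1ℚ
  𝔼ᴸ-prodL-independent L d (i ∷ is) D G D-resp G-dep (disj AllPairs.∷ disjs) =
    trans (𝔼ᴸ-*-independent L d (D i) Drest (D-resp i) Drest-resp disjoint-rest (G i) _ (G-dep i)
             (DependsOnly-prodL is D G G-dep))
          (cong (𝔼ᴸ L (G i) *_) (𝔼ᴸ-prodL-independent L d is D G D-resp G-dep disjs))
    where
    Drest : X → Bool
    Drest x = BoolList.any (λ j → D j x) is
    Drest-resp : Respects S Drest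
    Drest-resp x y e = cong BoolList.or (ListP.map-cong (λ j → D-resp j x y e) is)
    disjoint-rest : ∀ x → D i x ≡ true → Drest x ≡ true → ⊥
    disjoint-rest x Dix any =
      All.lookupWith (λ disj-ij Djx → disj-ij x Dix Djx) disj (any-true⁻ (λ j → D j x) is any)

  flipWhere : (X → Bool) → Config → Config
  flipWhere D ω x = flipIf (D x) (ω x)

  𝔼ᴸ-flipWhere : (L : List X) → Distinct S L → (D : X → Bool) → Respects S D →
    (F : Config → ℚ) → Extensional F → 𝔼ᴸ L (F ∘ flipWhere D) ≡ 𝔼ᴸ L F
  𝔼ᴸ-flipWhere [] _ D D-resp F F-ext =
    trans (𝔼ᴸ-[] (F ∘ flipWhere D)) (trans (F-ext _ _ flip-absent) (sym (𝔼ᴸ-[] F)))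
    where
    flip-absent : ∀ x → flipIf (D x) absent ≡ absent
    flip-absent x with D x
    ... | true  = refl
    ... | false = refl
  𝔼ᴸ-flipWhere (a ∷ L) (fresh AllPairs.∷ d) D D-resp F F-ext = begin
    𝔼ᴸ (a ∷ L) (F ∘ flipWhere D)
      ≡⟨ 𝔼ᴸ-∷ a L fresh (F ∘ flipWhere D) ⟩
    sumL outcomes (λ b → prob p b * 𝔼ᴸ L (λ ω → F (flipWhere D (update ω a b))))
      ≡⟨ sumL-cong outcomes (λ b → cong (prob p b *_) (trans
           (𝔼ᴸ-cong L (λ ω → F-ext _ _ (flip-update b ω)))
           (𝔼ᴸ-flipWhere L d D D-resp (F-update (flipIf (D a) b)) (F-update-ext (flipIf (D a) b))))) ⟩
    sumL outcomes (λ b → prob p b * 𝔼ᴸ L (F-update (flipIf (D a) b)))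
      ≡⟨ sumL-prob-flipIf p (D a) (λ b → 𝔼ᴸ L (F-update b)) ⟩
    sumL outcomes (λ b → prob p b * 𝔼ᴸ L (F-update b))
      ≡⟨ sym (𝔼ᴸ-∷ a L fresh F) ⟩
    𝔼ᴸ (a ∷ L) F ∎
    where
    open ≡-Reasoning
    F-update : Out → Config → ℚ
    F-update b ω = F (update ω a b)
    F-update-ext : ∀ b → Extensional (F-update b)
    F-update-ext b ω ω′ h = F-ext _ _ (λ x → cong (if x ≈ a then b else_) (h x))
    flip-update : ∀ b ω x → flipWhere D (update ω a b) x ≡ update (flipWhere D ω) a (flipIf (D a) b) x
    flip-update b ω x with x ≈ a in e
    ... | true  = cong (λ c → flipIf c b) (D-resp x a e)
    ... | false = refl

  configs-Respects : (L : List X) → All (Respects S) (configs L)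
  configs-Respects []      = (λ x y e → refl) ∷ []
  configs-Respects (a ∷ L) = AllP.concat⁺ (AllP.map⁺ {xs = outcomes} (All.tabulate (λ {b} _ →
    AllP.map⁺ (All.map (update-Respects b) (configs-Respects L)))))
    where
    update-Respects : ∀ b {ω} → Respects S ω → Respects S (update ω a b)
    update-Respects b {ω} ω-resp x y e rewrite ≈-resp S x y a e = cong (if y ≈ a then b else_) (ω-resp x y e)

  𝔼ᴸ-cong-Respects : (L : List X) {F G : Config → ℚ} → (∀ ω → Respects S ω → F ω ≡ G ω) → 𝔼ᴸ L F ≡ 𝔼ᴸ L G
  𝔼ᴸ-cong-Respects L h = sumL-cong-All (configs L)
    (All.map (λ {ω} ω-resp → cong (weightᴸ L ω *_) (h ω ω-resp)) (configs-Respects L))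

prodP : ∀ {N d} → (Fin N → Fin d → ℚ) → ℚ
prodP {N} {d} f = prodL (allFin N) (λ j → prodL (allFin d) (f j))

prodP-cong : ∀ {N d} {f g : Fin N → Fin d → ℚ} → (∀ j s → f j s ≡ g j s) → prodP f ≡ prodP g
prodP-cong {N} {d} h = prodL-cong (allFin N) (λ j → prodL-cong (allFin d) (h j))

∣prodP∣≤ : ∀ {N d} {f g : Fin N → Fin d → ℚ} → (∀ j s → ∣ f j s ∣ ≤ g j s) → ∣ prodP f ∣ ≤ prodP g
∣prodP∣≤ {N} {d} h = ∣prodL∣≤ (allFin N) (λ j → ∣prodL∣≤ (allFin d) (h j))

prodL-if-* : ∀ {d} (g : Fin d → Bool) (x : ℚ) (f : Fin d → ℚ) →
  prodL (allFin d) (λ s → if g s then x * f s else f s) ≡ powℚ x (countB g) * prodL (allFin d) f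
prodL-if-* {zero}  g x f = sym (ℚP.*-identityˡ 1ℚ)
prodL-if-* {suc d} g x f = begin
  prodL (allFin (suc d)) (λ s → if g s then x * f s else f s)
    ≡⟨ prodL-allFin-suc d (λ s → if g s then x * f s else f s) ⟩
  (if g zero then x * f zero else f zero) * prodL (allFin d) (λ s → if g (suc s) then x * f (suc s) else f (suc s))
    ≡⟨ cong ((if g zero then x * f zero else f zero) *_) (prodL-if-* (g ∘ suc) x (f ∘ suc)) ⟩
  (if g zero then x * f zero else f zero) * (powℚ x (countB (g ∘ suc)) * prodL (allFin d) (f ∘ suc))
    ≡⟨ head (g zero) ⟩
  powℚ x (countB g) * (f zero * prodL (allFin d) (f ∘ suc))
    ≡⟨ cong (powℚ x (countB g) *_) (sym (prodL-allFin-suc d f)) ⟩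
  powℚ x (countB g) * prodL (allFin (suc d)) f ∎
  where
  open ≡-Reasoning
  rest : ℚ
  rest = prodL (allFin d) (f ∘ suc)
  k : ℕ
  k = countB (g ∘ suc)
  head : ∀ b → (if b then x * f zero else f zero) * (powℚ x k * rest)
               ≡ powℚ x (if b then suc k else k) * (f zero * rest)
  head true  = *-interchange x (f zero) (powℚ x k) rest
  head false = x*[y*z]≡y*[x*z] (f zero) (powℚ x k) rest

prodP-if-* : ∀ {N d} (g : Fin N → Fin d → Bool) (x : ℚ) (f : Fin N → Fin d → ℚ) →
  prodP (λ j s → if g j s then x * f j s else f j s) ≡ powℚ x (countP g) * prodP f
prodP-if-* {zero}      g x f = sym (ℚP.*-identityˡ 1ℚ)
prodP-if-* {suc N} {d} g x f = begin
  prodP (λ j s → scaled j s)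
    ≡⟨ prodL-allFin-suc N (λ j → prodL (allFin d) (scaled j)) ⟩
  prodL (allFin d) (scaled zero) * prodP (λ j s → scaled (suc j) s)
    ≡⟨ cong₂ _*_ (prodL-if-* (g zero) x (f zero)) (prodP-if-* (g ∘ suc) x (f ∘ suc)) ⟩
  (powℚ x k₀ * prodL (allFin d) (f zero)) * (powℚ x k * prodP (f ∘ suc))
    ≡⟨ *-interchange (powℚ x k₀) (prodL (allFin d) (f zero)) (powℚ x k) (prodP (f ∘ suc)) ⟩
  (powℚ x k₀ * powℚ x k) * (prodL (allFin d) (f zero) * prodP (f ∘ suc))
    ≡⟨ cong₂ _*_ (sym (powℚ-+ x k₀ k)) (sym (prodL-allFin-suc N (λ j → prodL (allFin d) (f j)))) ⟩
  powℚ x (countP g) * prodP f ∎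
  where
  open ≡-Reasoning
  scaled : Fin (suc N) → Fin d → ℚ
  scaled j s = if g j s then x * f j s else f j s
  k₀ k : ℕ
  k₀ = countB (g zero)
  k = countP (g ∘ suc)

prodP-1 : ∀ {N d} → prodP {N} {d} (λ _ _ → 1ℚ) ≡ 1ℚ
prodP-1 {N} {d} = trans (prodL-cong (allFin N) (λ _ → prodL-1 (allFin d))) (prodL-1 (allFin N))

prodP-if-1 : ∀ {N d} (g : Fin N → Fin d → Bool) (x : ℚ) →
  prodP (λ j s → if g j s then x else 1ℚ) ≡ powℚ x (countP g)
prodP-if-1 {N} {d} g x = begin
  prodP (λ j s → if g j s then x else 1ℚ)          ≡⟨ prodP-cong (λ j s → x≡x*1 (g j s)) ⟩
  prodP (λ j s → if g j s then x * 1ℚ else 1ℚ)     ≡⟨ prodP-if-* g x (λ _ _ → 1ℚ) ⟩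
  powℚ x (countP g) * prodP {N} {d} (λ _ _ → 1ℚ)  ≡⟨ cong (powℚ x (countP g) *_) (prodP-1 {N} {d}) ⟩
  powℚ x (countP g) * 1ℚ                          ≡⟨ ℚP.*-identityʳ _ ⟩
  powℚ x (countP g)                               ∎
  where
  open ≡-Reasoning
  x≡x*1 : ∀ b → (if b then x else 1ℚ) ≡ (if b then x * 1ℚ else 1ℚ)
  x≡x*1 true  = sym (ℚP.*-identityʳ x)
  x≡x*1 false = refl

prodP-if-neg : ∀ {N d} (g : Fin N → Fin d → Bool) (f : Fin N → Fin d → ℚ) →
  prodP (λ j s → if g j s then - f j s else f j s) ≡ powℚ (- 1ℚ) (countP g) * prodP f
prodP-if-neg g f = trans (prodP-cong (λ j s → neg≡-1* (g j s) (f j s))) (prodP-if-* g (- 1ℚ) f)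
  where
  neg≡-1* : ∀ b y → (if b then - y else y) ≡ (if b then - 1ℚ * y else y)
  neg≡-1* true  y = trans (cong -_ (sym (ℚP.*-identityˡ y))) (ℚP.neg-distribˡ-* 1ℚ y)
  neg≡-1* false y = refl

isEvenℕ-2+ : ∀ k → isEvenℕ (2 ℕ.+ k) ≡ isEvenℕ k
isEvenℕ-2+ k = cong (ℕ._≡ᵇ 0) (trans (cong (ℕ._% 2) (ℕP.+-comm 2 k)) (ℕDivMod.[m+n]%n≡m%n k 2))

powℚ-neg1-odd : ∀ k → isEvenℕ k ≡ false → powℚ (- 1ℚ) k ≡ - 1ℚ
powℚ-neg1-odd (suc zero)    e = refl
powℚ-neg1-odd (suc (suc k)) e =
  cong (λ z → - 1ℚ * (- 1ℚ * z)) (powℚ-neg1-odd k (trans (sym (isEvenℕ-2+ k)) e))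

eqT-++ : ∀ {n a b} (u u′ : Tup n a) (v v′ : Tup n b) →
  eqT (u Vector.++ v) (u′ Vector.++ v′) ≡ eqT u u′ ∧ eqT v v′
eqT-++ {n} {a} {b} u u′ v v′ = Bool-ext
  (λ e → ∧-true⁺
    (eqT⁺ u u′ (λ i → trans (sym (VectorP.lookup-++ˡ u v i))
                      (trans (eqT⁻ _ _ e (i Fin.↑ˡ b)) (VectorP.lookup-++ˡ u′ v′ i))))
    (eqT⁺ v v′ (λ i → trans (sym (VectorP.lookup-++ʳ u v i))
                      (trans (eqT⁻ _ _ e (a Fin.↑ʳ i)) (VectorP.lookup-++ʳ u′ v′ i)))))
  (λ e → eqT⁺ _ _ (VectorP.++-cong u u′ (eqT⁻ u u′ (∧-true⁻ˡ e)) (eqT⁻ v v′ (∧-true⁻ʳ {eqT u u′} e))))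

sameEdge : ∀ {n q} → Tup n q → Tup n q → Tup n q → Tup n q → Bool
sameEdge a b a′ b′ = (eqT a a′ ∧ eqT b b′) ∨ (eqT a b′ ∧ eqT b a′)

sameEdge-refl : ∀ {n q} (a b : Tup n q) → sameEdge a b a b ≡ true
sameEdge-refl a b = ∨-true⁺ˡ (∧-true⁺ (eqT-refl a) (eqT-refl b))

sameEdge-comm : ∀ {n q} (a b a′ b′ : Tup n q) → sameEdge a b a′ b′ ≡ sameEdge a′ b′ a b
sameEdge-comm a b a′ b′ = cong₂ _∨_ (cong₂ _∧_ (eqT-comm a a′) (eqT-comm b b′))
  (trans (cong₂ _∧_ (eqT-comm a b′) (eqT-comm b a′)) (BoolP.∧-comm (eqT b′ a) (eqT a′ b)))

sameEdge-trans : ∀ {n q} (a b a′ b′ a″ b″ : Tup n q) →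
  sameEdge a b a′ b′ ≡ true → sameEdge a′ b′ a″ b″ ≡ true → sameEdge a b a″ b″ ≡ true
sameEdge-trans a b a′ b′ a″ b″ h₁ h₂ with ∨-true⁻ h₁ | ∨-true⁻ h₂
... | inj₁ x | inj₁ y = ∨-true⁺ˡ (∧-true⁺ (eqT-trans a a′ a″ (∧-true⁻ˡ x) (∧-true⁻ˡ y))
                                          (eqT-trans b b′ b″ (∧-true⁻ʳ {eqT a a′} x) (∧-true⁻ʳ {eqT a′ a″} y)))
... | inj₁ x | inj₂ y = ∨-true⁺ʳ (∧-true⁺ (eqT-trans a a′ b″ (∧-true⁻ˡ x) (∧-true⁻ˡ y))
                                          (eqT-trans b b′ a″ (∧-true⁻ʳ {eqT a a′} x) (∧-true⁻ʳ {eqT a′ b″} y)))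
... | inj₂ x | inj₁ y = ∨-true⁺ʳ (∧-true⁺ (eqT-trans a b′ b″ (∧-true⁻ˡ x) (∧-true⁻ʳ {eqT a′ a″} y))
                                          (eqT-trans b a′ a″ (∧-true⁻ʳ {eqT a b′} x) (∧-true⁻ˡ y)))
... | inj₂ x | inj₂ y = ∨-true⁺ˡ (∧-true⁺ (eqT-trans a b′ a″ (∧-true⁻ˡ x) (∧-true⁻ʳ {eqT a′ b″} y))
                                          (eqT-trans b a′ b″ (∧-true⁻ʳ {eqT a b′} x) (∧-true⁻ˡ y)))

sameEdge-determines : ∀ {n q} (U′ V₁ V₂ U W₁ W₂ : Tup n q) →
  sameEdge U′ V₁ U W₁ ≡ true → sameEdge U′ V₂ U W₂ ≡ true → eqT V₁ V₂ ≡ true → eqT W₁ W₂ ≡ true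
sameEdge-determines U′ V₁ V₂ U W₁ W₂ h₁ h₂ V₁≈V₂ with ∨-true⁻ h₁ | ∨-true⁻ h₂
... | inj₁ x | inj₁ y = eqT-trans W₁ V₁ W₂ (eqT-sym V₁ W₁ (∧-true⁻ʳ {eqT U′ U} x))
                          (eqT-trans V₁ V₂ W₂ V₁≈V₂ (∧-true⁻ʳ {eqT U′ U} y))
... | inj₂ x | inj₂ y = eqT-trans W₁ U′ W₂ (eqT-sym U′ W₁ (∧-true⁻ˡ x)) (∧-true⁻ˡ y)
... | inj₁ x | inj₂ y = eqT-trans W₁ V₁ W₂ (eqT-sym V₁ W₁ (∧-true⁻ʳ {eqT U′ U} x))
                          (eqT-trans V₁ V₂ W₂ V₁≈V₂ (eqT-trans V₂ U W₂ (∧-true⁻ʳ {eqT U′ W₂} y)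
                            (eqT-trans U U′ W₂ (eqT-sym U′ U (∧-true⁻ˡ x)) (∧-true⁻ˡ y))))
... | inj₂ x | inj₁ y = eqT-trans W₁ U′ W₂ (eqT-sym U′ W₁ (∧-true⁻ˡ x))
                          (eqT-trans U′ U W₂ (∧-true⁻ˡ y) (eqT-trans U V₁ W₂ (eqT-sym V₁ U (∧-true⁻ʳ {eqT U′ W₁} x))
                            (eqT-trans V₁ V₂ W₂ V₁≈V₂ (∧-true⁻ʳ {eqT U′ U} y))))

-- t is one of the two constraint tuples (U,V), (V,U) read by the entry S^Φ_{U,V}.
hits : ∀ {n m} → Tup n (m ℕ.+ m) → Tup n m → Tup n m → Bool
hits t a b = eqT t (a Vector.++ b) ∨ eqT t (b Vector.++ a)

hits-sameEdge : ∀ {n m} (t : Tup n (m ℕ.+ m)) (a b a′ b′ : Tup n m) →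
  hits t a b ≡ true → hits t a′ b′ ≡ true → sameEdge a b a′ b′ ≡ true
hits-sameEdge t a b a′ b′ h₁ h₂ with ∨-true⁻ h₁ | ∨-true⁻ h₂
... | inj₁ x | inj₁ y =
  ∨-true⁺ˡ (trans (sym (eqT-++ a a′ b b′)) (eqT-through t (a Vector.++ b) (a′ Vector.++ b′) x y))
... | inj₁ x | inj₂ y =
  ∨-true⁺ʳ (trans (sym (eqT-++ a b′ b a′)) (eqT-through t (a Vector.++ b) (b′ Vector.++ a′) x y))
... | inj₂ x | inj₁ y = ∨-true⁺ʳ (trans (BoolP.∧-comm (eqT a b′) (eqT b a′))
  (trans (sym (eqT-++ b a′ a b′)) (eqT-through t (b Vector.++ a) (a′ Vector.++ b′) x y)))
... | inj₂ x | inj₂ y = ∨-true⁺ˡ (trans (BoolP.∧-comm (eqT a a′) (eqT b b′))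
  (trans (sym (eqT-++ b b′ a a′)) (eqT-through t (b Vector.++ a) (b′ Vector.++ a′) x y)))

hits-concat : ∀ {n m} (a b a₀ b₀ : Tup n m) → hits (a Vector.++ b) a₀ b₀ ≡ sameEdge a₀ b₀ a b
hits-concat a b a₀ b₀ = cong₂ _∨_ (trans (eqT-++ a a₀ b b₀) (cong₂ _∧_ (eqT-comm a a₀) (eqT-comm b b₀)))
  (trans (eqT-++ a b₀ b a₀) (trans (BoolP.∧-comm (eqT a b₀) (eqT b a₀)) (cong₂ _∧_ (eqT-comm b a₀) (eqT-comm a b₀))))

hits-concat-swap : ∀ {n m} (a b a₀ b₀ : Tup n m) → hits (b Vector.++ a) a₀ b₀ ≡ sameEdge a₀ b₀ a b
hits-concat-swap a b a₀ b₀ = trans (hits-concat b a a₀ b₀)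
  (BoolP.∨-comm (eqT a₀ b ∧ eqT b₀ a) (eqT a₀ a ∧ eqT b₀ b)) 

-- The expectation of a single term

tuples-Distinct : ∀ n k → Distinct (tupleSetoid n k) (tuples n k)
tuples-Distinct n k =
  count≤1⇒Distinct (tupleSetoid n k) (tuples n k) (λ c → ℚP.≤-reflexive (count-tuples-eqT n k c))

tuples-complete : ∀ n k (t : Tup n k) → Any (λ u → eqT t u ≡ true) (tuples n k)
tuples-complete n k t = Any.map (λ {u} e → ≈-sym (tupleSetoid n k) u t e) (count≢0⇒Any (tuples n k) (λ u → eqT u t)
  (λ e → 1+p≢0 0ℚ ℚP.≤-refl (trans (ℚP.+-identityʳ 1ℚ) (trans (sym (count-tuples-eqT n k t)) e))))

hits-Respects : ∀ {n m} (a b : Tup n m) → Respects (tupleSetoid n (m ℕ.+ m)) (λ t → hits t a b)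
hits-Respects {n} {m} a b x y e =
  cong₂ _∨_ (≈-resp (tupleSetoid n (m ℕ.+ m)) x y _ e) (≈-resp (tupleSetoid n (m ℕ.+ m)) x y _ e)

isFirst : ∀ {N d} → Rel N d → Fin N → Fin d → Bool
isFirst R j s = not (anyP (λ j′ s′ → (pos j′ s′ ℕ.<ᵇ pos j s) ∧ R j′ s′ j s))

isFirst-false : ∀ {N d} (R : Rel N d) j s j′ s′ → R j s j′ s′ ≡ true → pos j s ℕ.< pos j′ s′ →
  isFirst R j′ s′ ≡ false
isFirst-false R j s j′ s′ r lt = cong not (anyP⁺ _ j s (∧-true⁺ (Equivalence.to BoolP.T-≡ (ℕP.<⇒<ᵇ lt)) r))

pos-injective : ∀ {N d} (j j′ : Fin N) (s s′ : Fin d) → pos j s ≡ pos j′ s′ → j ≡ j′ × s ≡ s′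
pos-injective j j′ s s′ e = FinP.combine-injective j s j′ s′ (FinP.toℕ-injective e)

val-flipIf-½ : ∀ c x y →
  ½ * (val (flipIf c x) + val (flipIf c y)) ≡ (if c then - (½ * (val x + val y)) else ½ * (val x + val y))
val-flipIf-½ true  x y = trans
  (cong (½ *_) (trans (cong₂ _+_ (val-flipSign x) (val-flipSign y)) (sym (ℚP.neg-distrib-+ (val x) (val y)))))
  (sym (ℚP.neg-distribʳ-* ½ (val x + val y)))
val-flipIf-½ false x y = refl

∣½*[x+y]∣≤ : ∀ x y → ∣ ½ * (x + y) ∣ ≤ ½ * (∣ x ∣ + ∣ y ∣)
∣½*[x+y]∣≤ x y =
  ℚP.≤-trans (ℚP.≤-reflexive (ℚP.∣p*q∣≡∣p∣*∣q∣ ½ (x + y))) (*-monoˡ-≤-0≤ ½ 0≤½ (ℚP.∣p+q∣≤∣p∣+∣q∣ x y))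

module SingleTerm {n m N d : ℕ} (U V : Fin N → Fin d → Tup n m) where
  T : BoolSetoid (Tup n (m ℕ.+ m))
  T = tupleSetoid n (m ℕ.+ m)

  UV VU : Fin N → Fin d → Tup n (m ℕ.+ m)
  UV j s = U j s Vector.++ V j s
  VU j s = V j s Vector.++ U j s

  edges : Rel N d
  edges j s j′ s′ = sameEdge (U j s) (V j s) (U j′ s′) (V j′ s′)

  entry : Fin N → Fin d → Instance n m → ℚ
  entry j s ω = SΦ ω (U j s) (V j s)

  term : Instance n m → ℚ
  term ω = prodP (λ j s → entry j s ω)

  leader : Fin N → Fin d → Bool
  leader = isFirst edges

  support : Fin N → Fin d → Tup n (m ℕ.+ m) → Bool
  support j s t = leader j s ∧ hits t (U j s) (V j s)

  support-Respects : ∀ j s → Respects T (support j s)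
  support-Respects j s x y e = cong (leader j s ∧_) (hits-Respects (U j s) (V j s) x y e)

  -- Only block leaders have non-empty support, and distinct blocks have distinct edges.
  support-disjoint : ∀ j s j′ s′ → ¬ (j ≡ j′ × s ≡ s′) → ∀ t →
    support j s t ≡ true → support j′ s′ t ≡ true → ⊥
  support-disjoint j s j′ s′ ne t h₁ h₂ with ℕP.<-cmp (pos j s) (pos j′ s′)
  ... | tri< lt _ _ = false≢true (trans (sym (isFirst-false edges j s j′ s′ same lt)) (∧-true⁻ˡ h₂))
    where
    same : sameEdge (U j s) (V j s) (U j′ s′) (V j′ s′) ≡ true
    same = hits-sameEdge t (U j s) (V j s) (U j′ s′) (V j′ s′)
             (∧-true⁻ʳ {leader j s} h₁) (∧-true⁻ʳ {leader j′ s′} h₂)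
  ... | tri≈ _ eq _ = ne (pos-injective j j′ s s′ eq)
  ... | tri> _ _ gt = false≢true (trans (sym (isFirst-false edges j′ s′ j s same gt)) (∧-true⁻ˡ h₁))
    where
    same : sameEdge (U j′ s′) (V j′ s′) (U j s) (V j s) ≡ true
    same = hits-sameEdge t (U j′ s′) (V j′ s′) (U j s) (V j s)
             (∧-true⁻ʳ {leader j′ s′} h₂) (∧-true⁻ʳ {leader j s} h₁)

  -- Since |S^Φ_{U,V}| ≤ 1, each block is bounded by the absolute value of its first entry.
  majorant : Fin N → Fin d → Instance n m → ℚ
  majorant j s ω = if leader j s then ½ * (∣ val (ω (UV j s)) ∣ + ∣ val (ω (VU j s)) ∣) else 1ℚ

  ∣entry∣≤majorant : ∀ j s ω → ∣ entry j s ω ∣ ≤ majorant j s ω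
  ∣entry∣≤majorant j s ω with leader j s
  ... | true  = ∣½*[x+y]∣≤ (val (ω (UV j s))) (val (ω (VU j s)))
  ... | false = ℚP.≤-trans (∣½*[x+y]∣≤ (val (ω (UV j s))) (val (ω (VU j s))))
                  (*-monoˡ-≤-0≤ ½ 0≤½ (ℚP.+-mono-≤ (∣val∣≤1 (ω (UV j s))) (∣val∣≤1 (ω (VU j s)))))

  term≤prodP-majorant : ∀ ω → term ω ≤ prodP (λ j s → majorant j s ω)
  term≤prodP-majorant ω = ℚP.≤-trans (p≤∣p∣ (term ω)) (∣prodP∣≤ (λ j s → ∣entry∣≤majorant j s ω))

  term-Extensional : ∀ p → ProductMeasure.Extensional T p term
  term-Extensional p ω ω′ h =
    prodP-cong (λ j s → cong (½ *_) (cong₂ _+_ (cong val (h (UV j s))) (cong val (h (VU j s)))))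

  module _ (p : ℚ) where
    open ProductMeasure T p

    L : List (Tup n (m ℕ.+ m))
    L = tuples n (m ℕ.+ m)

    majorant-DependsOnly : ∀ j s → DependsOnly (support j s) (majorant j s)
    majorant-DependsOnly j s ω ω′ h with leader j s
    ... | true  = cong (½ *_) (cong₂ _+_
                    (cong (∣_∣ ∘ val) (h (UV j s) (∨-true⁺ˡ (eqT-refl (UV j s)))))
                    (cong (∣_∣ ∘ val) (h (VU j s) (∨-true⁺ʳ {eqT (VU j s) (UV j s)} (eqT-refl (VU j s))))))
    ... | false = refl

    𝔼-∣val∣ : ∀ t → 𝔼ᴸ L (λ ω → ∣ val (ω t) ∣) ≡ p
    𝔼-∣val∣ t = trans (𝔼ᴸ-coordinate L (tuples-Distinct n (m ℕ.+ m)) t (tuples-complete n (m ℕ.+ m) t) (∣_∣ ∘ val))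
                      (sumL-prob-∣val∣ p)

    𝔼-if-½∣val∣ : ∀ b t t′ →
      𝔼ᴸ L (λ ω → if b then ½ * (∣ val (ω t) ∣ + ∣ val (ω t′) ∣) else 1ℚ) ≡ (if b then p else 1ℚ)
    𝔼-if-½∣val∣ true  t t′ = begin
      𝔼ᴸ L (λ ω → ½ * (∣ val (ω t) ∣ + ∣ val (ω t′) ∣))               ≡⟨ 𝔼ᴸ-*ˡ L ½ _ ⟩
      ½ * 𝔼ᴸ L (λ ω → ∣ val (ω t) ∣ + ∣ val (ω t′) ∣)                 ≡⟨ cong (½ *_) (𝔼ᴸ-+ L _ _) ⟩
      ½ * (𝔼ᴸ L (λ ω → ∣ val (ω t) ∣) + 𝔼ᴸ L (λ ω → ∣ val (ω t′) ∣))
        ≡⟨ cong (½ *_) (cong₂ _+_ (𝔼-∣val∣ t) (𝔼-∣val∣ t′)) ⟩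
      ½ * (p + p)                                                    ≡⟨ ½*[p+p]≡p p ⟩
      p                                                              ∎
      where open ≡-Reasoning
    𝔼-if-½∣val∣ false t t′ = 𝔼ᴸ-const L (tuples-Distinct n (m ℕ.+ m)) 1ℚ

    𝔼-prodP-majorant : 𝔼ᴸ L (λ ω → prodP (λ j s → majorant j s ω)) ≡ powℚ p (numBlocks edges)
    𝔼-prodP-majorant = begin
      𝔼ᴸ L (λ ω → prodP (λ j s → majorant j s ω))
        ≡⟨ 𝔼ᴸ-prodL-independent L distinct (allFin N) row-support (λ j ω → prodL (allFin d) (λ s → majorant j s ω))
             (λ j x y e → cong BoolList.or (ListP.map-cong (λ s → support-Respects j s x y e) (allFin d)))
             (λ j → DependsOnly-prodL (allFin d) (support j) (majorant j) (majorant-DependsOnly j))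
             (AllPairsP.tabulate⁺ {f = id} rows-disjoint) ⟩
      prodL (allFin N) (λ j → 𝔼ᴸ L (λ ω → prodL (allFin d) (λ s → majorant j s ω)))
        ≡⟨ prodL-cong (allFin N) (λ j → 𝔼ᴸ-prodL-independent L distinct (allFin d) (support j) (majorant j)
             (support-Respects j) (majorant-DependsOnly j) (AllPairsP.tabulate⁺ {f = id} (columns-disjoint j))) ⟩
      prodP (λ j s → 𝔼ᴸ L (majorant j s))
        ≡⟨ prodP-cong (λ j s → 𝔼-if-½∣val∣ (leader j s) (UV j s) (VU j s)) ⟩
      prodP (λ j s → if leader j s then p else 1ℚ)
        ≡⟨ prodP-if-1 leader p ⟩
      powℚ p (numBlocks edges) ∎
      where
      open ≡-Reasoning
      distinct : Distinct T L
      distinct = tuples-Distinct n (m ℕ.+ m)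
      row-support : Fin N → Tup n (m ℕ.+ m) → Bool
      row-support j t = BoolList.any (λ s → support j s t) (allFin d)
      rows-disjoint : ∀ {i j : Fin N} → i ≢ j → ∀ t → row-support i t ≡ true → row-support j t ≡ true → ⊥
      rows-disjoint {i} {j} i≢j t h₁ h₂
        with Any.satisfied (any-true⁻ _ (allFin d) h₁) | Any.satisfied (any-true⁻ _ (allFin d) h₂)
      ... | s , e₁ | s′ , e₂ = support-disjoint i s j s′ (i≢j ∘ proj₁) t e₁ e₂
      columns-disjoint : ∀ j {s s′ : Fin d} → s ≢ s′ → ∀ t → support j s t ≡ true → support j s′ t ≡ true → ⊥
      columns-disjoint j s≢s′ = support-disjoint j _ j _ (s≢s′ ∘ proj₂)

    𝔼-term≤ : 0ℚ ≤ p → p ≤ 1ℚ → 𝔼ᴸ L term ≤ powℚ p (numBlocks edges)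
    𝔼-term≤ 0≤p p≤1 = ℚP.≤-trans (𝔼ᴸ-mono 0≤p p≤1 L term≤prodP-majorant) (ℚP.≤-reflexive 𝔼-prodP-majorant)

    -- Flipping the signs of the two constraint tuples of edge (j₀, s₀) negates exactly the entries of its block.
    module _ (j₀ : Fin N) (s₀ : Fin d) (odd : isEvenℕ (countP (edges j₀ s₀)) ≡ false) where
      flipped : Tup n (m ℕ.+ m) → Bool
      flipped t = hits t (U j₀ s₀) (V j₀ s₀)

      entry-flip : ∀ j s ω →
        entry j s (flipWhere flipped ω) ≡ (if edges j₀ s₀ j s then - entry j s ω else entry j s ω)
      entry-flip j s ω = trans
        (cong₂ (λ c c′ → ½ * (val (flipIf c (ω (UV j s))) + val (flipIf c′ (ω (VU j s)))))
               (hits-concat (U j s) (V j s) (U j₀ s₀) (V j₀ s₀))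
               (hits-concat-swap (U j s) (V j s) (U j₀ s₀) (V j₀ s₀)))
        (val-flipIf-½ (edges j₀ s₀ j s) (ω (UV j s)) (ω (VU j s)))

      term-flip : ∀ ω → term (flipWhere flipped ω) ≡ - term ω
      term-flip ω = begin
        term (flipWhere flipped ω)
          ≡⟨ prodP-cong (λ j s → entry-flip j s ω) ⟩
        prodP (λ j s → if edges j₀ s₀ j s then - entry j s ω else entry j s ω)
          ≡⟨ prodP-if-neg (edges j₀ s₀) (λ j s → entry j s ω) ⟩
        powℚ (- 1ℚ) (countP (edges j₀ s₀)) * term ω
          ≡⟨ cong (_* term ω) (powℚ-neg1-odd (countP (edges j₀ s₀)) odd) ⟩
        - 1ℚ * term ω
          ≡⟨ sym (ℚP.neg-distribˡ-* 1ℚ (term ω)) ⟩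
        - (1ℚ * term ω)
          ≡⟨ cong -_ (ℚP.*-identityˡ (term ω)) ⟩
        - term ω ∎
        where open ≡-Reasoning

      𝔼-term-odd : 𝔼ᴸ L term ≡ 0ℚ
      𝔼-term-odd = p≡-p⇒p≡0 (𝔼ᴸ L term) (begin
        𝔼ᴸ L term                          ≡⟨ sym (𝔼ᴸ-flipWhere L (tuples-Distinct n (m ℕ.+ m)) flipped
                                                 (hits-Respects (U j₀ s₀) (V j₀ s₀)) term (term-Extensional p)) ⟩
        𝔼ᴸ L (term ∘ flipWhere flipped)    ≡⟨ 𝔼ᴸ-cong L term-flip ⟩
        𝔼ᴸ L (λ ω → - term ω)              ≡⟨ 𝔼ᴸ-neg L term ⟩
        - 𝔼ᴸ L term                        ∎)
        where open ≡-Reasoning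

SameRel : ∀ {N d} → Rel N d → Rel N d → Set
SameRel P Q = ∀ j s j′ s′ → P j s j′ s′ ≡ Q j s j′ s′

relSetoid : ∀ N d → BoolSetoid (Rel N d)
relSetoid N d = pointwiseSetoid N (pointwiseSetoid d (pointwiseSetoid N (pointwiseSetoid d iffSetoid)))

samePartition⁻ : ∀ {N d} (P Q : Rel N d) → samePartition P Q ≡ true → SameRel P Q
samePartition⁻ P Q e j s j′ s′ = ⇔ᵇ-true⁻ _ _ (allP⁻ _ (allP⁻ _ e j s) j′ s′)

samePartition-cong : ∀ {N d} {R R′ : Rel N d} (Q : Rel N d) → SameRel R R′ → samePartition R Q ≡ samePartition R′ Q
samePartition-cong Q h = allP-cong (λ j s → allP-cong (λ j′ s′ → cong (_⇔ᵇ Q j s j′ s′) (h j s j′ s′)))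

isEquivalence-cong : ∀ {N d} {P Q : Rel N d} → SameRel P Q → isEquivalence P ≡ isEquivalence Q
isEquivalence-cong h = cong₂ _∧_ (allP-cong (λ j s → h j s j s))
  (cong₂ _∧_ (allP-cong (λ j s → allP-cong (λ j′ s′ → cong₂ _⇒ᵇ_ (h j s j′ s′) (h j′ s′ j s))))
             (allP-cong (λ j s → allP-cong (λ j′ s′ → allP-cong (λ j″ s″ →
                cong₂ _⇒ᵇ_ (cong₂ _∧_ (h j s j′ s′) (h j′ s′ j″ s″)) (h j s j″ s″))))))

isEvenPartition-cong : ∀ {N d} {P Q : Rel N d} → SameRel P Q → isEvenPartition P ≡ isEvenPartition Q
isEvenPartition-cong h = allP-cong (λ j s → cong isEvenℕ (countP-cong (h j s)))

numBlocks-cong : ∀ {N d} {P Q : Rel N d} → SameRel P Q → numBlocks P ≡ numBlocks Q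
numBlocks-cong h = countP-cong (λ j s → cong not (anyP-cong (λ j′ s′ → cong (_ ∧_) (h j′ s′ j s))))

sameEdge-isEquivalence : ∀ {n m N d} (U V : Fin N → Fin d → Tup n m) → isEquivalence (SingleTerm.edges U V) ≡ true
sameEdge-isEquivalence U V = ∧-true⁺ (allP⁺ _ (λ j s → sameEdge-refl (U j s) (V j s)))
  (∧-true⁺ (allP⁺ _ (λ j s → allP⁺ _ (λ j′ s′ →
              ⇒ᵇ-true⁺ _ _ (trans (sameEdge-comm (U j′ s′) (V j′ s′) (U j s) (V j s))))))
           (allP⁺ _ (λ j s → allP⁺ _ (λ j′ s′ → allP⁺ _ (λ j″ s″ → ⇒ᵇ-true⁺ _ _ (λ e →
              sameEdge-trans (U j s) (V j s) (U j′ s′) (V j′ s′) (U j″ s″) (V j″ s″)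
                (∧-true⁻ˡ e) (∧-true⁻ʳ {sameEdge (U j s) (V j s) (U j′ s′) (V j′ s′)} e)))))))

count-allRels-≈ : ∀ N d (R : Rel N d) → count (allRels N d) (_≈[ relSetoid N d ] R) ≡ 1ℚ
count-allRels-≈ N d =
  count-pointwise-≈ (pointwiseSetoid d (pointwiseSetoid N (pointwiseSetoid d iffSetoid))) N _
    (count-pointwise-≈ (pointwiseSetoid N (pointwiseSetoid d iffSetoid)) d _
      (count-pointwise-≈ (pointwiseSetoid d iffSetoid) N _
        (count-pointwise-≈ iffSetoid d _ (λ { true → refl ; false → refl }))))

evenWeight : ∀ {N d} → ℚ → Rel N d → ℚ
evenWeight {N} {d} p R = sumL (evenPartitions N d) (λ Q → 𝟙 (samePartition R Q) * powℚ p (numBlocks Q))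

evenWeight-nonNeg : ∀ {N d} p → 0ℚ ≤ p → (R : Rel N d) → 0ℚ ≤ evenWeight p R
evenWeight-nonNeg {N} {d} p 0≤p R =
  sumL-nonNeg (evenPartitions N d) (λ Q → 0≤* (𝟙-nonNeg (samePartition R Q)) (powℚ-nonNeg p 0≤p (numBlocks Q)))

evenWeight-even : ∀ {N d} p (R : Rel N d) → isEquivalence R ≡ true → isEvenPartition R ≡ true →
  evenWeight p R ≡ powℚ p (numBlocks R)
evenWeight-even {N} {d} p R equiv even = begin
  evenWeight p R
    ≡⟨ sumL-cong (evenPartitions N d) (λ Q → cong (λ b → 𝟙 b * powℚ p (numBlocks Q)) (samePartition-comm R Q)) ⟩
  sumL (evenPartitions N d) (λ Q → 𝟙 (Q ≈ R) * powℚ p (numBlocks Q))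
    ≡⟨ sumL-𝟙≈-* (relSetoid N d) (evenPartitions N d) R (powℚ p ∘ numBlocks)
         (λ Q Q′ e → cong (powℚ p) (numBlocks-cong (samePartition⁻ Q Q′ e))) ⟩
  count (evenPartitions N d) (_≈ R) * powℚ p (numBlocks R)
    ≡⟨ cong (_* powℚ p (numBlocks R)) count-R ⟩
  1ℚ * powℚ p (numBlocks R)
    ≡⟨ ℚP.*-identityˡ _ ⟩
  powℚ p (numBlocks R) ∎
  where
  open ≡-Reasoning
  _≈_ : Rel N d → Rel N d → Bool
  _≈_ = BoolSetoid._≈_ (relSetoid N d)
  samePartition-comm : ∀ P Q → samePartition P Q ≡ samePartition Q P
  samePartition-comm P Q = allP-cong (λ j s → allP-cong (λ j′ s′ → ⇔ᵇ-comm (P j s j′ s′) (Q j s j′ s′)))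
  respects : (P : Rel N d → Bool) → (∀ {Q Q′} → SameRel Q Q′ → P Q ≡ P Q′) → Respects (relSetoid N d) P
  respects P P-cong Q Q′ e = P-cong (samePartition⁻ Q Q′ e)
  count-R : count (evenPartitions N d) (_≈ R) ≡ 1ℚ
  count-R = begin
    count (evenPartitions N d) (_≈ R)
      ≡⟨ count-filter-≈ (relSetoid N d) isEvenPartition (respects isEvenPartition isEvenPartition-cong)
           (partitions N d) R ⟩
    𝟙 (isEvenPartition R) * count (partitions N d) (_≈ R)
      ≡⟨ cong (𝟙 (isEvenPartition R) *_) (count-filter-≈ (relSetoid N d) isEquivalence
           (respects isEquivalence isEquivalence-cong) (allRels N d) R) ⟩
    𝟙 (isEvenPartition R) * (𝟙 (isEquivalence R) * count (allRels N d) (_≈ R))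
      ≡⟨ cong₂ (λ a b → 𝟙 a * (𝟙 b * count (allRels N d) (_≈ R))) even equiv ⟩
    1ℚ * (1ℚ * count (allRels N d) (_≈ R))
      ≡⟨ trans (ℚP.*-identityˡ _) (trans (ℚP.*-identityˡ _) (count-allRels-≈ N d R)) ⟩
    1ℚ ∎

-- Traces of matrix powers as sums over closed walks

-- Structurally recursive, unlike [next], which is defined with _%_.
cyclicSuc : ∀ {M} → Fin (suc M) → Fin (suc M)
cyclicSuc {zero}  zero    = zero
cyclicSuc {suc M} zero    = suc zero
cyclicSuc {suc M} (suc j) = Fin.punchIn (suc zero) (cyclicSuc j)

toℕ-cyclicSuc-< : ∀ {M} (j : Fin (suc M)) → toℕ j ℕ.< M → toℕ (cyclicSuc j) ≡ suc (toℕ j)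
toℕ-cyclicSuc-< {suc M} zero    lt = refl
toℕ-cyclicSuc-< {suc M} (suc j) lt with cyclicSuc j | toℕ-cyclicSuc-< j (ℕP.≤-pred lt)
... | suc k | e = cong suc e

cyclicSuc-last : ∀ {M} (j : Fin (suc M)) → toℕ j ≡ M → cyclicSuc j ≡ zero
cyclicSuc-last {zero}  zero    e = refl
cyclicSuc-last {suc M} (suc j) e rewrite cyclicSuc-last j (ℕP.suc-injective e) = refl

next≡cyclicSuc : ∀ {M} (j : Fin (suc M)) → next j ≡ cyclicSuc j
next≡cyclicSuc {M} j = FinP.toℕ-injective (trans (FinP.toℕ-fromℕ< (ℕDivMod.m%n<n (suc (toℕ j)) (suc M))) toℕ-next)
  where
  toℕ-next : suc (toℕ j) ℕ.% suc M ≡ toℕ (cyclicSuc j)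
  toℕ-next with ℕP.<-cmp (toℕ j) M
  ... | tri< lt _ _ = trans (ℕDivMod.m<n⇒m%n≡m (ℕ.s≤s lt)) (sym (toℕ-cyclicSuc-< j lt))
  ... | tri≈ _ e _  = trans (cong (λ z → suc z ℕ.% suc M) e)
                        (trans (ℕDivMod.n%n≡0 (suc M)) (cong toℕ (sym (cyclicSuc-last j e))))
  ... | tri> _ _ gt = ⊥-elim (ℕP.<⇒≱ gt (ℕP.≤-pred (FinP.toℕ<n j)))

prodL-cyclicSuc : ∀ M (f : Fin (suc M) → ℚ) → prodL (allFin (suc M)) (f ∘ cyclicSuc) ≡ prodL (allFin (suc M)) f
prodL-cyclicSuc zero    f = refl
prodL-cyclicSuc (suc M) f = begin
  prodL (allFin (suc (suc M))) (f ∘ cyclicSuc)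
    ≡⟨ prodL-allFin-suc (suc M) (f ∘ cyclicSuc) ⟩
  f (suc zero) * prodL (allFin (suc M)) (f′ ∘ cyclicSuc)
    ≡⟨ cong (f (suc zero) *_) (trans (prodL-cyclicSuc M f′) (prodL-allFin-suc M f′)) ⟩
  f (suc zero) * (f zero * prodL (allFin M) (λ j → f (suc (suc j))))
    ≡⟨ x*[y*z]≡y*[x*z] (f (suc zero)) (f zero) _ ⟩
  f zero * (f (suc zero) * prodL (allFin M) (λ j → f (suc (suc j))))
    ≡⟨ cong (f zero *_) (sym (prodL-allFin-suc M (f ∘ suc))) ⟩
  f zero * prodL (allFin (suc M)) (f ∘ suc)
    ≡⟨ sym (prodL-allFin-suc (suc M) f) ⟩
  prodL (allFin (suc (suc M))) f ∎
  where
  open ≡-Reasoning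
  f′ : Fin (suc M) → ℚ
  f′ = f ∘ Fin.punchIn (suc zero)

prodL-next : ∀ N (f : Fin N → ℚ) → prodL (allFin N) (f ∘ next) ≡ prodL (allFin N) f
prodL-next zero    f = refl
prodL-next (suc M) f = trans (prodL-cong (allFin (suc M)) (cong f ∘ next≡cyclicSuc)) (prodL-cyclicSuc M f)

idMat≡𝟙 : ∀ {n q} (I J : Tup n q) → idMat I J ≡ 𝟙 (eqT I J)
idMat≡𝟙 I J with eqT I J
... | true  = refl
... | false = refl

module ClosedWalks {n q : ℕ} (A : Mat n q)
  (A-resp : ∀ I I′ J J′ → eqT I I′ ≡ true → eqT J J′ ≡ true → A I J ≡ A I′ J′) where

  T : List (Tup n q)
  T = tuples n q

  pathWeight : (M : ℕ) → Tup n q → (Fin M → Tup n q) → Tup n q → ℚ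
  pathWeight zero    X g Y = A X Y
  pathWeight (suc M) X g Y = A X (g zero) * pathWeight M (g zero) (g ∘ suc) Y

  powMat-pathWeight : ∀ M X Y → powMat A (suc M) X Y ≡ sumL (allFuns M T) (λ g → pathWeight M X g Y)
  powMat-pathWeight zero X Y = begin
    sumL T (λ K → A X K * idMat K Y)
      ≡⟨ sumL-cong T (λ K → trans (cong (A X K *_) (idMat≡𝟙 K Y)) (ℚP.*-comm (A X K) _)) ⟩
    sumL T (λ K → 𝟙 (eqT K Y) * A X K)
      ≡⟨ sumL-𝟙≈-* (tupleSetoid n q) T Y (A X) (λ K K′ e → A-resp X X K K′ (eqT-refl X) e) ⟩
    count T (λ K → eqT K Y) * A X Y
      ≡⟨ cong (_* A X Y) (count-tuples-eqT n q Y) ⟩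
    1ℚ * A X Y
      ≡⟨ trans (ℚP.*-identityˡ (A X Y)) (sym (ℚP.+-identityʳ (A X Y))) ⟩
    A X Y + 0ℚ ∎
    where open ≡-Reasoning
  powMat-pathWeight (suc M) X Y = begin
    sumL T (λ K → A X K * powMat A (suc M) K Y)
      ≡⟨ sumL-cong T (λ K → trans (cong (A X K *_) (powMat-pathWeight M K Y))
                                  (sym (sumL-*ˡ (allFuns M T) (A X K) (λ g → pathWeight M K g Y)))) ⟩
    sumL T (λ K → sumL (allFuns M T) (λ g → A X K * pathWeight M K g Y))
      ≡⟨ sym (sumL-allFuns-suc M T (λ g → pathWeight (suc M) X g Y)) ⟩
    sumL (allFuns (suc M) T) (λ g → pathWeight (suc M) X g Y) ∎
    where open ≡-Reasoning

  stepEnd : (M : ℕ) → (Fin M → Tup n q) → Tup n q → Fin (suc M) → Tup n q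
  stepEnd zero    g Y zero    = Y
  stepEnd (suc M) g Y zero    = g zero
  stepEnd (suc M) g Y (suc j) = stepEnd M (g ∘ suc) Y j

  pathWeight≡prodL : ∀ M X g Y →
    pathWeight M X g Y ≡ prodL (allFin (suc M)) (λ j → A ((X Vector.∷ g) j) (stepEnd M g Y j))
  pathWeight≡prodL zero    X g Y = sym (ℚP.*-identityʳ (A X Y))
  pathWeight≡prodL (suc M) X g Y = trans
    (cong (A X (g zero) *_) (trans (pathWeight≡prodL M (g zero) (g ∘ suc) Y) (prodL-cong (allFin (suc M)) head-tail)))
    (sym (prodL-allFin-suc (suc M) (λ j → A ((X Vector.∷ g) j) (stepEnd (suc M) g Y j))))
    where
    head-tail : ∀ j → A ((g zero Vector.∷ (g ∘ suc)) j) (stepEnd M (g ∘ suc) Y j)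
                    ≡ A (g j) (stepEnd M (g ∘ suc) Y j)
    head-tail zero    = refl
    head-tail (suc j) = refl

  stepEnd-closed : ∀ M (g : Fin M → Tup n q) X j → stepEnd M g X j ≡ (X Vector.∷ g) (cyclicSuc j)
  stepEnd-closed zero    g X zero    = refl
  stepEnd-closed (suc M) g X zero    = refl
  stepEnd-closed (suc M) g X (suc j) = trans (stepEnd-closed M (g ∘ suc) X j) (shift (cyclicSuc j))
    where
    shift : ∀ k → (X Vector.∷ (g ∘ suc)) k ≡ (X Vector.∷ g) (Fin.punchIn (suc zero) k)
    shift zero    = refl
    shift (suc k) = refl

  cycleWeight : ∀ {N} → (Fin N → Tup n q) → ℚ
  cycleWeight {N} Is = prodL (allFin N) (λ j → A (Is j) (Is (next j)))

  pathWeight-closed : ∀ M X g → pathWeight M X g X ≡ cycleWeight (X Vector.∷ g)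
  pathWeight-closed M X g = trans (pathWeight≡prodL M X g X) (prodL-cong (allFin (suc M)) (λ j →
    cong (A ((X Vector.∷ g) j)) (trans (stepEnd-closed M g X j) (cong (X Vector.∷ g) (sym (next≡cyclicSuc j))))))

  trace-powMat : ∀ M → trace (powMat A (suc M)) ≡ sumL (allFuns (suc M) T) cycleWeight
  trace-powMat M = begin
    sumL T (λ X → powMat A (suc M) X X)
      ≡⟨ sumL-cong T (λ X → trans (powMat-pathWeight M X X) (sumL-cong (allFuns M T) (pathWeight-closed M X))) ⟩
    sumL T (λ X → sumL (allFuns M T) (λ g → cycleWeight (X Vector.∷ g)))
      ≡⟨ sym (sumL-allFuns-suc M T cycleWeight) ⟩
    sumL (allFuns (suc M) T) cycleWeight ∎
    where open ≡-Reasoning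

fromℕ≡mkℚ : ∀ k → fromℕ k ≡ ℚ.mkℚ (ℤ.+ k) 0 (Coprimality.sym (Coprimality.1-coprimeTo k))
fromℕ≡mkℚ k = ℚP.normalize-coprime (Coprimality.sym (Coprimality.1-coprimeTo k))

fromℕ-suc : ∀ k → fromℕ (suc k) ≡ 1ℚ + fromℕ k
fromℕ-suc k rewrite fromℕ≡mkℚ k =
  sym (ℚP./-cong {p₁ = ℤ.+ 1 ℤ.* ℤ.+ 1 ℤ.+ ℤ.+ k ℤ.* ℤ.+ 1} {q₁ = 1} {p₂ = ℤ.+ suc k} {q₂ = 1}
                 (cong (λ z → ℤ.+ 1 ℤ.+ z) (ℤP.*-identityʳ (ℤ.+ k))) refl)

fromℕ-+ : ∀ a b → fromℕ (a ℕ.+ b) ≡ fromℕ a + fromℕ b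
fromℕ-+ zero    b = sym (ℚP.+-identityˡ (fromℕ b))
fromℕ-+ (suc a) b = trans (fromℕ-suc (a ℕ.+ b)) (trans (cong (1ℚ +_) (fromℕ-+ a b))
  (trans (sym (ℚP.+-assoc 1ℚ (fromℕ a) (fromℕ b))) (cong (_+ fromℕ b) (sym (fromℕ-suc a)))))

fromℕ-* : ∀ a b → fromℕ (a ℕ.* b) ≡ fromℕ a * fromℕ b
fromℕ-* zero    b = sym (ℚP.*-zeroˡ (fromℕ b))
fromℕ-* (suc a) b = begin
  fromℕ (b ℕ.+ a ℕ.* b)          ≡⟨ fromℕ-+ b (a ℕ.* b) ⟩
  fromℕ b + fromℕ (a ℕ.* b)      ≡⟨ cong₂ _+_ (sym (ℚP.*-identityˡ (fromℕ b))) (fromℕ-* a b) ⟩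
  1ℚ * fromℕ b + fromℕ a * fromℕ b ≡⟨ sym (ℚP.*-distribʳ-+ (fromℕ b) 1ℚ (fromℕ a)) ⟩
  (1ℚ + fromℕ a) * fromℕ b       ≡⟨ cong (_* fromℕ b) (sym (fromℕ-suc a)) ⟩
  fromℕ (suc a) * fromℕ b        ∎
  where open ≡-Reasoning

fromℕ-nonNeg : ∀ a → 0ℚ ≤ fromℕ a
fromℕ-nonNeg a = ℚP.nonNegative⁻¹ (fromℕ a) {{ℚP.normalize-nonNeg a 1}}

fromℕ-mono : ∀ {a b} → a ℕ.≤ b → fromℕ a ≤ fromℕ b
fromℕ-mono {zero}  {b}     h = fromℕ-nonNeg b
fromℕ-mono {suc a} {suc b} (ℕ.s≤s h) = begin
  fromℕ (suc a)   ≡⟨ fromℕ-suc a ⟩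
  1ℚ + fromℕ a    ≤⟨ ℚP.+-monoʳ-≤ 1ℚ (fromℕ-mono h) ⟩
  1ℚ + fromℕ b    ≡⟨ sym (fromℕ-suc b) ⟩
  fromℕ (suc b)   ∎
  where open ℚP.≤-Reasoning

fromℕ-^ : ∀ a k → fromℕ (a ℕ.^ k) ≡ powℚ (fromℕ a) k
fromℕ-^ a zero    = refl
fromℕ-^ a (suc k) = trans (fromℕ-* a (a ℕ.^ k)) (cong (fromℕ a *_) (fromℕ-^ a k))

fromℕ-product : {A : Set} (xs : List A) (f : A → ℕ) → fromℕ (ℕList.product (map f xs)) ≡ prodL xs (fromℕ ∘ f)
fromℕ-product []       f = refl
fromℕ-product (x ∷ xs) f = trans (fromℕ-* (f x) _) (cong (fromℕ (f x) *_) (fromℕ-product xs f))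

1≤fromℕ-! : ∀ k → 1ℚ ≤ fromℕ (k !)
1≤fromℕ-! k = fromℕ-mono {1} {k !} (ℕP.1≤n! k)

count≡fromℕ-countB : ∀ {q} (P : Fin q → Bool) → count (allFin q) P ≡ fromℕ (countB P)
count≡fromℕ-countB {zero}  P = refl
count≡fromℕ-countB {suc q} P = trans (sumL-allFin-suc q (𝟙 ∘ P)) (step (P zero) (count≡fromℕ-countB (P ∘ suc)))
  where
  step : ∀ b {x c} → x ≡ fromℕ c → 𝟙 b + x ≡ fromℕ (if b then suc c else c)
  step true  {x} {c} e = trans (cong (1ℚ +_) e) (sym (fromℕ-suc c))
  step false {x}     e = trans (ℚP.+-identityˡ x) e

inv!*fromℕ-! : ∀ q → inv! q * fromℕ (q !) ≡ 1ℚ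
inv!*fromℕ-! q = inverse (q !) {{q ℕP.!≢0}}
  where
  inverse : ∀ k .{{_ : ℕ.NonZero k}} → (ℤ.+ 1 ℚ./ k) * fromℕ k ≡ 1ℚ
  inverse (suc k) rewrite fromℕ≡mkℚ (suc k)
                        | ℚP.normalize-coprime {1} {k} (Coprimality.1-coprimeTo (suc k)) =
    ℚP.*-inverseˡ (ℚ.mkℚ (ℤ.+ suc k) 0 (Coprimality.sym (Coprimality.1-coprimeTo (suc k))))

inv!-nonNeg : ∀ q → 0ℚ ≤ inv! q
inv!-nonNeg q = nonNeg (q !) {{q ℕP.!≢0}}
  where
  nonNeg : ∀ k .{{_ : ℕ.NonZero k}} → 0ℚ ≤ (ℤ.+ 1 ℚ./ k)
  nonNeg k = ℚP.nonNegative⁻¹ _ {{ℚP.normalize-nonNeg 1 k}}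

injectiveᵇ : ∀ {a q} → (Fin a → Fin q) → Bool
injectiveᵇ f = allB (λ i → allB (λ j → not (does (f i ≟ f j)) ∨ does (i ≟ j)))

injectiveᵇ⁻ : ∀ {a q} (f : Fin a → Fin q) → injectiveᵇ f ≡ true → ∀ i j → f i ≡ f j → i ≡ j
injectiveᵇ⁻ f e i j fi≡fj = dec-true⁻ (i ≟ j) (at-ij (allB⁻ _ (allB⁻ _ e i) j))
  where
  at-ij : not (does (f i ≟ f j)) ∨ does (i ≟ j) ≡ true → does (i ≟ j) ≡ true
  at-ij h rewrite dec-true (f i ≟ f j) fi≡fj = h

injectiveᵇ⁺ : ∀ {a q} (f : Fin a → Fin q) → (∀ i j → f i ≡ f j → i ≡ j) → injectiveᵇ f ≡ true
injectiveᵇ⁺ f inj = allB⁺ _ (λ i → allB⁺ _ (λ j → at-ij i j))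
  where
  at-ij : ∀ i j → not (does (f i ≟ f j)) ∨ does (i ≟ j) ≡ true
  at-ij i j with does (f i ≟ f j) in e
  ... | true  = dec-true (i ≟ j) (inj i j (dec-true⁻ (f i ≟ f j) e))
  ... | false = refl

injectiveᵇ-Respects : ∀ a q → Respects (tupleSetoid q a) (injectiveᵇ {a} {q})
injectiveᵇ-Respects a q f g e =
  Bool-ext (λ inj-f → injectiveᵇ⁺ g (λ i j gi≡gj →
             injectiveᵇ⁻ f inj-f i j (trans (f≗g i) (trans gi≡gj (sym (f≗g j))))))
           (λ inj-g → injectiveᵇ⁺ f (λ i j fi≡fj →
             injectiveᵇ⁻ g inj-g i j (trans (sym (f≗g i)) (trans fi≡fj (f≗g j)))))
  where
  f≗g : ∀ i → f i ≡ g i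
  f≗g = eqT⁻ f g e

injectiveᵇ-∘ : ∀ {q} (π c : Fin q → Fin q) → isInjective π ≡ true → isInjective (π ∘ c) ≡ isInjective c
injectiveᵇ-∘ π c π-inj = Bool-ext
  (λ e → injectiveᵇ⁺ c (λ i j z → injectiveᵇ⁻ (π ∘ c) e i j (cong π z)))
  (λ e → injectiveᵇ⁺ (π ∘ c) (λ i j z → injectiveᵇ⁻ c e i j (injectiveᵇ⁻ π π-inj _ _ z)))

filterᵇ-true : {A : Set} (P : A → Bool) (xs : List A) → All (λ x → P x ≡ true) (filterᵇ P xs)
filterᵇ-true P []       = []
filterᵇ-true P (x ∷ xs) with P x in e
... | true  = e ∷ filterᵇ-true P xs
... | false = filterᵇ-true P xs

allFuns-All : {C : Set} (P : C → Set) (a : ℕ) (bs : List C) → All P bs → All (λ f → ∀ x → P (f x)) (allFuns a bs)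
allFuns-All P zero    bs h = (λ ()) ∷ []
allFuns-All P (suc a) bs h = AllP.concat⁺ (AllP.map⁺ (All.map (λ {b} Pb →
  AllP.map⁺ (All.map (λ {f} Pf → λ { zero → Pb ; (suc x) → Pf x }) (allFuns-All P a bs h))) h))

perms-injective : ∀ q → All (λ σ → isInjective σ ≡ true) (perms q)
perms-injective q = filterᵇ-true isInjective (allFuns q (allFin q))

injective⇒surjective : ∀ {q} (τ : Fin q → Fin q) → (∀ i j → τ i ≡ τ j → i ≡ j) → ∀ y → Σ (Fin q) λ x → τ x ≡ y
injective⇒surjective {q} τ inj y with FinP.any? (λ x → τ x ≟ y)
... | yes hit = hit
... | no miss = ⊥-elim (pigeonhole q τ inj y miss)
  where
  pigeonhole : ∀ q (τ : Fin q → Fin q) → (∀ i j → τ i ≡ τ j → i ≡ j) → (y : Fin q) →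
    ¬ (Σ (Fin q) λ x → τ x ≡ y) → ⊥
  pigeonhole (suc q′) τ inj y miss = ℕP.<-irrefl refl (FinP.injective⇒≤ {f = τ′} τ′-inj)
    where
    τ′ : Fin (suc q′) → Fin q′
    τ′ x = Fin.punchOut {i = y} {j = τ x} (λ e → miss (x , sym e))
    τ′-inj : ∀ {x x′} → τ′ x ≡ τ′ x′ → x ≡ x′
    τ′-inj {x} {x′} e = inj x x′ (FinP.punchOut-injective (λ e → miss (x , sym e)) (λ e → miss (x′ , sym e)) e)

module Inverse {q : ℕ} (τ : Fin q → Fin q) (τ-inj : isInjective τ ≡ true) where
  inv : Fin q → Fin q
  inv y = proj₁ (injective⇒surjective τ (injectiveᵇ⁻ τ τ-inj) y)

  inverseʳ : ∀ y → τ (inv y) ≡ y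
  inverseʳ y = proj₂ (injective⇒surjective τ (injectiveᵇ⁻ τ τ-inj) y)

  inverseˡ : ∀ x → inv (τ x) ≡ x
  inverseˡ x = injectiveᵇ⁻ τ τ-inj _ _ (inverseʳ (τ x))

  eqT-inv-∘ : (σ c : Fin q → Fin q) → eqT (inv ∘ σ) c ≡ eqT σ (τ ∘ c)
  eqT-inv-∘ σ c = Bool-ext
    (λ e → eqT⁺ _ _ (λ t → trans (sym (inverseʳ (σ t))) (cong τ (eqT⁻ _ _ e t))))
    (λ e → eqT⁺ _ _ (λ t → trans (cong inv (eqT⁻ _ _ e t)) (inverseˡ (c t))))

  eqT-act : ∀ {n} (u c : Tup n q) → eqT (act τ u) c ≡ eqT u (act inv c)
  eqT-act u c = Bool-ext
    (λ e → eqT⁺ _ _ (λ s → trans (cong u (sym (inverseʳ s))) (eqT⁻ _ _ e (inv s))))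
    (λ e → eqT⁺ _ _ (λ t → trans (eqT⁻ _ _ e (τ t)) (cong c (inverseˡ t))))

count-perms-eqT : ∀ q (τ : Fin q → Fin q) → count (perms q) (λ σ → eqT σ τ) ≡ 𝟙 (isInjective τ)
count-perms-eqT q τ = begin
  count (perms q) (λ σ → eqT σ τ)
    ≡⟨ count-filter-≈ (tupleSetoid q q) isInjective (injectiveᵇ-Respects q q) (tuples q q) τ ⟩
  𝟙 (isInjective τ) * count (tuples q q) (λ σ → eqT σ τ)
    ≡⟨ cong (𝟙 (isInjective τ) *_) (count-tuples-eqT q q τ) ⟩
  𝟙 (isInjective τ) * 1ℚ
    ≡⟨ ℚP.*-identityʳ _ ⟩
  𝟙 (isInjective τ) ∎
  where open ≡-Reasoning

-- Injective placements and the histogram bound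

countB-remove : ∀ {q} (P : Fin q → Bool) (b : Fin q) →
  let rest = countB (λ y → P y ∧ not (does (y ≟ b))) in countB P ≡ (if P b then suc rest else rest)
countB-remove {suc q} P zero with P zero
... | true  = cong suc (countB-cong (λ y → sym (BoolP.∧-identityʳ (P (suc y)))))
... | false = countB-cong (λ y → sym (BoolP.∧-identityʳ (P (suc y))))
countB-remove {suc q} P (suc b) with P zero | countB-remove (P ∘ suc) b
... | true  | ih with P (suc b)
...   | true  = cong suc ih
...   | false = cong suc ih
countB-remove {suc q} P (suc b) | false | ih with P (suc b)
...   | true  = ih
...   | false = ih

prodL-scale-at : ∀ {n} (c : Fin n) (h h′ : Fin n → ℚ) (x : ℚ) → (∀ i → i ≢ c → h i ≡ h′ i) → h c ≡ x * h′ c →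
  prodL (allFin n) h ≡ x * prodL (allFin n) h′
prodL-scale-at {suc n} zero h h′ x others at-c = begin
  prodL (allFin (suc n)) h                     ≡⟨ prodL-allFin-suc n h ⟩
  h zero * prodL (allFin n) (h ∘ suc)
    ≡⟨ cong₂ _*_ at-c (prodL-cong (allFin n) (λ i → others (suc i) (λ ()))) ⟩
  x * h′ zero * prodL (allFin n) (h′ ∘ suc)    ≡⟨ ℚP.*-assoc x (h′ zero) _ ⟩
  x * (h′ zero * prodL (allFin n) (h′ ∘ suc))  ≡⟨ cong (x *_) (sym (prodL-allFin-suc n h′)) ⟩
  x * prodL (allFin (suc n)) h′                ∎
  where open ≡-Reasoning
prodL-scale-at {suc n} (suc c) h h′ x others at-c = begin
  prodL (allFin (suc n)) h                      ≡⟨ prodL-allFin-suc n h ⟩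
  h zero * prodL (allFin n) (h ∘ suc)           ≡⟨ cong₂ _*_ (others zero (λ ()))
       (prodL-scale-at c (h ∘ suc) (h′ ∘ suc) x (λ i i≢c → others (suc i) (i≢c ∘ FinP.suc-injective)) at-c) ⟩
  h′ zero * (x * prodL (allFin n) (h′ ∘ suc))   ≡⟨ x*[y*z]≡y*[x*z] (h′ zero) x _ ⟩
  x * (h′ zero * prodL (allFin n) (h′ ∘ suc))   ≡⟨ cong (x *_) (sym (prodL-allFin-suc n h′)) ⟩
  x * prodL (allFin (suc n)) h′                 ∎
  where open ≡-Reasoning

module Placements {n q : ℕ} (I : Fin q → Fin n) where
  fits : (Fin q → Bool) → Fin n → Fin q → Bool
  fits Av c b = Av b ∧ does (I b ≟ c)

  multiplicity : (Fin q → Bool) → Fin n → ℕ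
  multiplicity Av c = countB (fits Av c)

  histFactᴬ : (Fin q → Bool) → ℚ
  histFactᴬ Av = prodL (allFin n) (λ i → fromℕ (multiplicity Av i !))

  histFactᴬ-pred : Fin n → (Fin q → Bool) → ℚ
  histFactᴬ-pred c Av =
    prodL (allFin n) (λ i → fromℕ ((if does (i ≟ c) then ℕ.pred (multiplicity Av i) else multiplicity Av i) !))

  isPlacement : ∀ {a} → (Fin q → Bool) → (Fin a → Fin n) → (Fin a → Fin q) → Bool
  isPlacement Av J f = injectiveᵇ f ∧ allB (λ x → fits Av (J x) (f x))

  placements : ∀ a → (Fin q → Bool) → (Fin a → Fin n) → ℚ
  placements a Av J = count (allFuns a (allFin q)) (isPlacement Av J)

  remove : (Fin q → Bool) → Fin q → Fin q → Bool
  remove Av b y = Av y ∧ not (does (y ≟ b))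

  1≤histFactᴬ : ∀ Av → 1ℚ ≤ histFactᴬ Av
  1≤histFactᴬ Av = 1≤prodL (allFin n) (λ i → 1≤fromℕ-! (multiplicity Av i))

  isPlacement-∷ : ∀ {a} Av (J : Fin (suc a) → Fin n) b g → isPlacement Av J (b Vector.∷ g) ≡ true →
    fits Av (J zero) b ≡ true × isPlacement (remove Av b) (J ∘ suc) g ≡ true
  isPlacement-∷ Av J b g e = ∧-true⁻ˡ fits-all , ∧-true⁺ g-inj (allB⁺ _ tail-fits)
    where
    inj : ∀ i j → (b Vector.∷ g) i ≡ (b Vector.∷ g) j → i ≡ j
    inj = injectiveᵇ⁻ (b Vector.∷ g) (∧-true⁻ˡ e)
    g-inj : injectiveᵇ g ≡ true
    g-inj = injectiveᵇ⁺ g (λ i j z → FinP.suc-injective (inj (suc i) (suc j) z))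
    fits-all : (fits Av (J zero) b ∧ allB (λ x → fits Av (J (suc x)) (g x))) ≡ true
    fits-all = ∧-true⁻ʳ {injectiveᵇ (b Vector.∷ g)} e
    tail-fits : ∀ x → fits (remove Av b) (J (suc x)) (g x) ≡ true
    tail-fits x = ∧-true⁺
      (∧-true⁺ (∧-true⁻ˡ fits-x) (cong not (dec-false (g x ≟ b) (λ z → suc≢zero (inj (suc x) zero z)))))
      (∧-true⁻ʳ {Av (g x)} fits-x)
      where
      fits-x : fits Av (J (suc x)) (g x) ≡ true
      fits-x = allB⁻ _ (∧-true⁻ʳ {fits Av (J zero) b} fits-all) x
      suc≢zero : suc x ≢ zero
      suc≢zero ()

  𝟙-isPlacement-∷≤ : ∀ {a} Av (J : Fin (suc a) → Fin n) b g →
    𝟙 (isPlacement Av J (b Vector.∷ g)) ≤ 𝟙 (fits Av (J zero) b) * 𝟙 (isPlacement (remove Av b) (J ∘ suc) g)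
  𝟙-isPlacement-∷≤ Av J b g with isPlacement Av J (b Vector.∷ g) in e
  ... | true  = ℚP.≤-reflexive (sym (cong₂ _*_ (cong 𝟙 (proj₁ (isPlacement-∷ Av J b g e)))
                                               (cong 𝟙 (proj₂ (isPlacement-∷ Av J b g e)))))
  ... | false = 0≤* (𝟙-nonNeg (fits Av (J zero) b)) (𝟙-nonNeg (isPlacement (remove Av b) (J ∘ suc) g))

  multiplicity-remove : ∀ Av b → Av b ≡ true → ∀ i → let rest = multiplicity (remove Av b) i in
    multiplicity Av i ≡ (if does (I b ≟ i) then suc rest else rest)
  multiplicity-remove Av b Avb i = trans (countB-remove (fits Av i) b)
    (trans (cong (λ z → if z ∧ does (I b ≟ i) then suc (countB rest) else countB rest) Avb)
           (cong (λ z → if does (I b ≟ i) then suc z else z)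
                 (countB-cong (λ y → reorder (Av y) (does (I y ≟ i)) (not (does (y ≟ b)))))))
    where
    rest : Fin q → Bool
    rest y = fits Av i y ∧ not (does (y ≟ b))
    reorder : ∀ a c e → (a ∧ c) ∧ e ≡ (a ∧ e) ∧ c
    reorder true  c e = BoolP.∧-comm c e
    reorder false c e = refl

  histFactᴬ-remove : ∀ Av b → Av b ≡ true → histFactᴬ (remove Av b) ≡ histFactᴬ-pred (I b) Av
  histFactᴬ-remove Av b Avb = prodL-cong (allFin n) (λ i → cong (λ z → fromℕ (z !)) (at i))
    where
    at : ∀ i → multiplicity (remove Av b) i
             ≡ (if does (i ≟ I b) then ℕ.pred (multiplicity Av i) else multiplicity Av i)
    at i rewrite ≟-comm i (I b) | multiplicity-remove Av b Avb i with does (I b ≟ i)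
    ... | true  = refl
    ... | false = refl

  𝟙-fits*histFactᴬ-remove : ∀ Av c b →
    𝟙 (fits Av c b) * histFactᴬ (remove Av b) ≡ 𝟙 (fits Av c b) * histFactᴬ-pred c Av
  𝟙-fits*histFactᴬ-remove Av c b with fits Av c b in e
  ... | true  = cong (1ℚ *_) (trans (histFactᴬ-remove Av b (∧-true⁻ˡ e))
                                    (cong (λ z → histFactᴬ-pred z Av) (dec-true⁻ (I b ≟ c) (∧-true⁻ʳ {Av b} e))))
  ... | false = trans (ℚP.*-zeroˡ (histFactᴬ (remove Av b))) (sym (ℚP.*-zeroˡ (histFactᴬ-pred c Av)))

  multiplicity*histFactᴬ-pred≤ : ∀ c Av → fromℕ (multiplicity Av c) * histFactᴬ-pred c Av ≤ histFactᴬ Av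
  multiplicity*histFactᴬ-pred≤ c Av with multiplicity Av c in e
  ... | zero  = ℚP.≤-trans (ℚP.≤-reflexive (ℚP.*-zeroˡ (histFactᴬ-pred c Av))) (ℚP.≤-trans 0≤1 (1≤histFactᴬ Av))
  ... | suc k = ℚP.≤-reflexive (sym (prodL-scale-at c _ _ (fromℕ (suc k)) others at-c))
    where
    others : ∀ i → i ≢ c → fromℕ (multiplicity Av i !) ≡
      fromℕ ((if does (i ≟ c) then ℕ.pred (multiplicity Av i) else multiplicity Av i) !)
    others i i≢c rewrite dec-false (i ≟ c) i≢c = refl
    at-c : fromℕ (multiplicity Av c !) ≡
      fromℕ (suc k) * fromℕ ((if does (c ≟ c) then ℕ.pred (multiplicity Av c) else multiplicity Av c) !)
    at-c rewrite dec-true (c ≟ c) refl | e = fromℕ-* (suc k) (k !)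

  -- Choose f 0 among the multiplicity Av (J 0) available positions carrying the value J 0, then recurse.
  placements≤histFactᴬ : ∀ a Av J → placements a Av J ≤ histFactᴬ Av
  placements≤histFactᴬ zero    Av J = ℚP.≤-trans (ℚP.≤-trans (ℚP.≤-reflexive (ℚP.+-identityʳ _))
    (𝟙≤1 (isPlacement Av J (λ ())))) (1≤histFactᴬ Av)
  placements≤histFactᴬ (suc a) Av J = begin
    placements (suc a) Av J
      ≡⟨ sumL-allFuns-suc a (allFin q) (𝟙 ∘ isPlacement Av J) ⟩
    sumL (allFin q) (λ b → sumL (allFuns a (allFin q)) (λ g → 𝟙 (isPlacement Av J (b Vector.∷ g))))
      ≤⟨ sumL-mono (allFin q) (λ b → sumL-mono (allFuns a (allFin q)) (𝟙-isPlacement-∷≤ Av J b)) ⟩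
    sumL (allFin q) (λ b → sumL (allFuns a (allFin q)) (λ g →
      𝟙 (fits₀ b) * 𝟙 (isPlacement (remove Av b) (J ∘ suc) g)))
      ≡⟨ sumL-cong (allFin q) (λ b → sumL-*ˡ (allFuns a (allFin q)) (𝟙 (fits₀ b)) _) ⟩
    sumL (allFin q) (λ b → 𝟙 (fits₀ b) * placements a (remove Av b) (J ∘ suc))
      ≤⟨ sumL-mono (allFin q) (λ b → *-monoˡ-≤-0≤ (𝟙 (fits₀ b)) (𝟙-nonNeg (fits₀ b))
           (placements≤histFactᴬ a (remove Av b) (J ∘ suc))) ⟩
    sumL (allFin q) (λ b → 𝟙 (fits₀ b) * histFactᴬ (remove Av b))
      ≡⟨ sumL-cong (allFin q) (𝟙-fits*histFactᴬ-remove Av (J zero)) ⟩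
    sumL (allFin q) (λ b → 𝟙 (fits₀ b) * histFactᴬ-pred (J zero) Av)
      ≡⟨ sumL-*ʳ (allFin q) (histFactᴬ-pred (J zero) Av) (𝟙 ∘ fits₀) ⟩
    count (allFin q) fits₀ * histFactᴬ-pred (J zero) Av
      ≡⟨ cong (_* histFactᴬ-pred (J zero) Av) (count≡fromℕ-countB fits₀) ⟩
    fromℕ (multiplicity Av (J zero)) * histFactᴬ-pred (J zero) Av
      ≤⟨ multiplicity*histFactᴬ-pred≤ (J zero) Av ⟩
    histFactᴬ Av ∎
    where
    open ℚP.≤-Reasoning
    fits₀ : Fin q → Bool
    fits₀ = fits Av (J zero)

sumL-perms-1≤! : ∀ q → sumL (perms q) (λ _ → 1ℚ) ≤ fromℕ (q !)
sumL-perms-1≤! q = begin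
  sumL (perms q) (λ _ → 1ℚ)
    ≡⟨ sumL-filter isInjective (tuples q q) (λ _ → 1ℚ) ⟩
  sumL (tuples q q) (λ σ → if isInjective σ then 1ℚ else 0ℚ)
    ≡⟨ sumL-cong (tuples q q) as-placement ⟩
  placements q (λ _ → true) (λ _ → zero)
    ≤⟨ placements≤histFactᴬ q (λ _ → true) (λ _ → zero) ⟩
  histFactᴬ (λ _ → true)
    ≡⟨ ℚP.*-identityʳ _ ⟩
  fromℕ (countB {q} (λ _ → true) !)
    ≡⟨ cong (λ z → fromℕ (z !)) (countB-true q) ⟩
  fromℕ (q !) ∎
  where
  open ℚP.≤-Reasoning
  open Placements {1} {q} (λ _ → zero)
  as-placement : ∀ σ → (if isInjective σ then 1ℚ else 0ℚ) ≡ 𝟙 (isPlacement (λ _ → true) (λ _ → zero) σ)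
  as-placement σ rewrite allB⁺ {q} (λ _ → true) (λ _ → refl) with isInjective σ
  ... | true  = refl
  ... | false = refl

inImage : ∀ {n q a} → (Fin q → Fin n) → (Fin a → Fin n) → Bool
inImage I J = allB (λ x → anyB (λ y → does (I y ≟ J x)))

-- The permutations τ with τ(I) = J are exactly the placements of J into I.
count-perms-act≤histFact : ∀ {n} q (I J : Fin q → Fin n) →
  count (perms q) (λ τ → eqT (act τ I) J) ≤ 𝟙 (inImage I J) * fromℕ (histFact I)
count-perms-act≤histFact {n} q I J = begin
  count (perms q) (λ τ → eqT (act τ I) J)
    ≡⟨ count-filter isInjective (λ τ → eqT (act τ I) J) (tuples q q) ⟩
  count (tuples q q) (λ τ → isInjective τ ∧ eqT (act τ I) J)
    ≡⟨ sumL-cong (tuples q q) as-placement ⟩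
  sumL (tuples q q) (λ τ → 𝟙 (inImage I J) * 𝟙 (isPlacement (λ _ → true) J τ))
    ≡⟨ sumL-*ˡ (tuples q q) (𝟙 (inImage I J)) (λ τ → 𝟙 (isPlacement (λ _ → true) J τ)) ⟩
  𝟙 (inImage I J) * placements q (λ _ → true) J
    ≤⟨ *-monoˡ-≤-0≤ (𝟙 (inImage I J)) (𝟙-nonNeg (inImage I J)) (placements≤histFactᴬ q (λ _ → true) J) ⟩
  𝟙 (inImage I J) * histFactᴬ (λ _ → true)
    ≡⟨ cong (𝟙 (inImage I J) *_) (sym (fromℕ-product (allFin n) (λ i → countB (λ t → does (I t ≟ i)) !))) ⟩
  𝟙 (inImage I J) * fromℕ (histFact I) ∎
  where
  open ℚP.≤-Reasoning
  open Placements {n} {q} I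
  in-image : ∀ τ → eqT (act τ I) J ≡ true → inImage I J ≡ true
  in-image τ e = allB⁺ _ (λ x → anyB⁺ _ (τ x) (dec-true (I (τ x) ≟ J x) (eqT⁻ (act τ I) J e x)))
  as-placement : ∀ τ → 𝟙 (isInjective τ ∧ eqT (act τ I) J) ≡ 𝟙 (inImage I J) * 𝟙 (isPlacement (λ _ → true) J τ)
  as-placement τ = trans (cong 𝟙 (absorb (isInjective τ) (eqT (act τ I) J) (inImage I J) (in-image τ)))
    (trans (𝟙-∧ (inImage I J) _) (cong (λ z → 𝟙 (inImage I J) * 𝟙 (isInjective τ ∧ z)) (eqT≡allB (act τ I) J)))
    where
    absorb : ∀ a e c → (e ≡ true → c ≡ true) → (a ∧ e) ≡ c ∧ (a ∧ e)
    absorb a true  c h rewrite h refl = refl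
    absorb a false c h = trans (BoolP.∧-zeroʳ a) (sym (trans (cong (c ∧_) (BoolP.∧-zeroʳ a)) (BoolP.∧-zeroʳ c)))

-- Removing the left permutations

tupleFamilies : ∀ n N q → List (Fin N → Tup n q)
tupleFamilies n N q = allFuns N (tuples n q)

permFamilies : ∀ N q → List (Fin N → Fin q → Fin q)
permFamilies N q = allFuns N (perms q)

idPerms : ∀ {N q} → Fin N → Fin q → Fin q
idPerms _ t = t

hasPartition : ∀ {n N d m} → Rel N d → (Fin N → Tup n (d ℕ.* m)) →
  (πs σs : Fin N → Fin (d ℕ.* m) → Fin (d ℕ.* m)) → Bool
hasPartition Q Is πs σs = samePartition (Par Is πs σs) Q

leftHalf : ∀ {n N d m} → (Fin N → Tup n (d ℕ.* m)) → (Fin N → Fin (d ℕ.* m) → Fin (d ℕ.* m)) →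
  Fin N → Fin d → Tup n m
leftHalf Is πs j s = block s (act (πs j) (Is j))

rightHalf : ∀ {n N d m} → (Fin N → Tup n (d ℕ.* m)) → (Fin N → Fin (d ℕ.* m) → Fin (d ℕ.* m)) →
  Fin N → Fin d → Tup n m
rightHalf Is σs j s = block s (act (σs j) (Is (next j)))

edges-cong : ∀ {n m N d} {U U′ V V′ : Fin N → Fin d → Tup n m} →
  (∀ j s t → U j s t ≡ U′ j s t) → (∀ j s t → V j s t ≡ V′ j s t) →
  SameRel (SingleTerm.edges U V) (SingleTerm.edges U′ V′)
edges-cong hU hV j s j′ s′ = cong₂ _∨_
  (cong₂ _∧_ (eqT-ext (hU j s) (hU j′ s′)) (eqT-ext (hV j s) (hV j′ s′)))
  (cong₂ _∧_ (eqT-ext (hU j s) (hV j′ s′)) (eqT-ext (hV j s) (hU j′ s′)))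

module RemoveLeftPermutations {n N d m : ℕ} (Q : Rel N d) where
  q : ℕ
  q = d ℕ.* m

  Is-space : List (Fin N → Tup n q)
  Is-space = tupleFamilies n N q

  σs-space : List (Fin N → Fin q → Fin q)
  σs-space = permFamilies N q

  IsSetoid : BoolSetoid (Fin N → Tup n q)
  IsSetoid = pointwiseSetoid N (tupleSetoid n q)

  σsSetoid : BoolSetoid (Fin N → Fin q → Fin q)
  σsSetoid = pointwiseSetoid N (tupleSetoid q q)

  matches : (Fin N → Tup n q) → (Fin N → Fin q → Fin q) → (Fin N → Fin q → Fin q) → ℚ
  matches Is πs σs = 𝟙 (hasPartition {n} {N} {d} {m} Q Is πs σs)

  matches-cong : ∀ (Is Is′ : Fin N → Tup n q) (πs πs′ σs σs′ : Fin N → Fin q → Fin q) →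
    (∀ j s t → leftHalf {m = m} Is πs j s t ≡ leftHalf Is′ πs′ j s t) →
    (∀ j s t → rightHalf {m = m} Is σs j s t ≡ rightHalf Is′ σs′ j s t) →
    matches Is πs σs ≡ matches Is′ πs′ σs′
  matches-cong _ _ _ _ _ _ hU hV = cong 𝟙 (samePartition-cong Q (edges-cong hU hV))

  -- Substituting I_j ↦ π_j(I_j) and σ_j ↦ π_{j+1}⁻¹ ∘ σ_j turns (I, π, σ) into (π(I), id, π⁻¹σ).
  module _ (πs : Fin N → Fin q → Fin q) (πs-inj : ∀ j → isInjective (πs j) ≡ true) where
    ρ : Fin N → Fin q → Fin q
    ρ j = Inverse.inv (πs (next j)) (πs-inj (next j))

    φI : (Fin N → Tup n q) → Fin N → Tup n q
    φI Is j = act (πs j) (Is j)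

    φσ : (Fin N → Fin q → Fin q) → Fin N → Fin q → Fin q
    φσ σs j t = ρ j (σs j t)

    matches-φ : ∀ Is σs → matches Is πs σs ≡ matches (φI Is) idPerms (φσ σs)
    matches-φ Is σs = matches-cong Is (φI Is) πs idPerms σs (φσ σs) (λ j s t → refl)
      (λ j s t → cong (Is (next j)) (sym (Inverse.inverseʳ (πs (next j)) (πs-inj (next j)) (σs j (combine s t)))))

    count-φσ : ∀ c → count σs-space (λ σs → φσ σs ≈[ σsSetoid ] c)
                   ≡ count σs-space (_≈[ σsSetoid ] c)
    count-φσ c = trans (count-allFuns N (perms q) (λ j τ → eqT (ρ j ∘ τ) (c j)))
      (trans (prodL-cong (allFin N) per-coordinate) (sym (count-allFuns N (perms q) (λ j τ → eqT τ (c j)))))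
      where
      per-coordinate : ∀ j → count (perms q) (λ τ → eqT (ρ j ∘ τ) (c j)) ≡ count (perms q) (λ τ → eqT τ (c j))
      per-coordinate j = begin
        count (perms q) (λ τ → eqT (ρ j ∘ τ) (c j))   ≡⟨ sumL-cong (perms q) (λ τ → cong 𝟙 (eqT-inv-∘ τ (c j))) ⟩
        count (perms q) (λ τ → eqT τ (π ∘ c j))       ≡⟨ count-perms-eqT q (π ∘ c j) ⟩
        𝟙 (isInjective (π ∘ c j))                      ≡⟨ cong 𝟙 (injectiveᵇ-∘ π (c j) (πs-inj (next j))) ⟩
        𝟙 (isInjective (c j))                          ≡⟨ sym (count-perms-eqT q (c j)) ⟩
        count (perms q) (λ τ → eqT τ (c j))           ∎
        where
        open ≡-Reasoning
        π : Fin q → Fin q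
        π = πs (next j)
        open Inverse π (πs-inj (next j))

    count-φI : ∀ c → count Is-space (λ Is → φI Is ≈[ IsSetoid ] c)
                   ≡ count Is-space (_≈[ IsSetoid ] c)
    count-φI c = trans (count-allFuns N (tuples n q) (λ j u → eqT (act (πs j) u) (c j)))
      (trans (prodL-cong (allFin N) per-coordinate) (sym (count-allFuns N (tuples n q) (λ j u → eqT u (c j)))))
      where
      per-coordinate : ∀ j →
        count (tuples n q) (λ u → eqT (act (πs j) u) (c j)) ≡ count (tuples n q) (λ u → eqT u (c j))
      per-coordinate j = begin
        count (tuples n q) (λ u → eqT (act (πs j) u) (c j))
          ≡⟨ sumL-cong (tuples n q) (λ u → cong 𝟙 (eqT-act u (c j))) ⟩
        count (tuples n q) (λ u → eqT u (act inv (c j)))      ≡⟨ count-tuples-eqT n q (act inv (c j)) ⟩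
        1ℚ                                                     ≡⟨ sym (count-tuples-eqT n q (c j)) ⟩
        count (tuples n q) (λ u → eqT u (c j))                ∎
        where
        open ≡-Reasoning
        open Inverse (πs j) (πs-inj j)

    matches-Respects-σs : ∀ Is → Respects σsSetoid (matches Is idPerms)
    matches-Respects-σs Is σs σs′ e = matches-cong Is Is idPerms idPerms σs σs′ (λ j s t → refl)
      (λ j s t → cong (Is (next j)) (eqT⁻ (σs j) (σs′ j) (allB⁻ _ e j) (combine s t)))

    sumL-matches-Respects-Is : Respects IsSetoid (λ Is → sumL σs-space (matches Is idPerms))
    sumL-matches-Respects-Is Is Is′ e = sumL-cong σs-space (λ σs → matches-cong Is Is′ idPerms idPerms σs σs
      (λ j s t → eqT⁻ (Is j) (Is′ j) (allB⁻ _ e j) (combine s t))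
      (λ j s t → eqT⁻ (Is (next j)) (Is′ (next j)) (allB⁻ _ e (next j)) (σs j (combine s t))))

    sumL-matches-remove-πs : sumL Is-space (λ Is → sumL σs-space (matches Is πs))
                          ≡ sumL Is-space (λ Is → sumL σs-space (matches Is idPerms))
    sumL-matches-remove-πs = begin
      sumL Is-space (λ Is → sumL σs-space (matches Is πs))
        ≡⟨ sumL-cong Is-space (λ Is → sumL-cong σs-space (matches-φ Is)) ⟩
      sumL Is-space (λ Is → sumL σs-space (λ σs → matches (φI Is) idPerms (φσ σs)))
        ≡⟨ sumL-cong Is-space (λ Is → sumL-reindex σsSetoid σs-space φσ count-φσ
             (matches (φI Is) idPerms) (matches-Respects-σs (φI Is))) ⟩
      sumL Is-space (λ Is → sumL σs-space (matches (φI Is) idPerms))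
        ≡⟨ sumL-reindex IsSetoid Is-space φI count-φI
             (λ Is → sumL σs-space (matches Is idPerms)) sumL-matches-Respects-Is ⟩
      sumL Is-space (λ Is → sumL σs-space (matches Is idPerms)) ∎
      where open ≡-Reasoning

module _ {A C : Set} (S : BoolSetoid A) (SC : BoolSetoid C) where
  private
    count≤1-unique : (xs : List A) → (∀ a → count xs (_≈[ S ] a) ≤ 1ℚ) →
      (R : A → Bool) → (∀ x y → R x ≡ true → R y ≡ true → (y ≈[ S ] x) ≡ true) → count xs R ≤ 1ℚ
    count≤1-unique xs xs≤1 R R-unique with count xs R ℚP.≟ 0ℚ
    ... | yes e = ℚP.≤-trans (ℚP.≤-reflexive e) 0≤1
    ... | no ne with Any.satisfied (count≢0⇒Any xs R ne)
    ... | x₀ , Rx₀ = ℚP.≤-trans (sumL-mono xs R≤≈x₀) (xs≤1 x₀)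
      where
      R≤≈x₀ : ∀ y → 𝟙 (R y) ≤ 𝟙 (y ≈[ S ] x₀)
      R≤≈x₀ y with R y in e
      ... | true  = ℚP.≤-reflexive (cong 𝟙 (sym (R-unique x₀ y Rx₀ e)))
      ... | false = 𝟙-nonNeg (y ≈[ S ] x₀)

  count≤-encoding : (xs : List A) (cs : List C) → (∀ a → count xs (_≈[ S ] a) ≤ 1ℚ) →
    (P : A → Bool) (enc : A → C) →
    (∀ x → P x ≡ true → 1ℚ ≤ count cs (_≈[ SC ] enc x)) →
    (∀ x y → P x ≡ true → P y ≡ true → (enc x ≈[ SC ] enc y) ≡ true → (x ≈[ S ] y) ≡ true) →
    count xs P ≤ sumL cs (λ _ → 1ℚ)
  count≤-encoding xs cs xs≤1 P enc enc-in enc-inj = begin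
    count xs P
      ≤⟨ sumL-mono xs P≤codes ⟩
    sumL xs (λ x → sumL cs (λ c → 𝟙 (P x ∧ (c ≈[ SC ] enc x))))
      ≡⟨ sumL-swap xs cs (λ x c → 𝟙 (P x ∧ (c ≈[ SC ] enc x))) ⟩
    sumL cs (λ c → count xs (λ x → P x ∧ (c ≈[ SC ] enc x)))
      ≤⟨ sumL-mono cs (λ c → count≤1-unique xs xs≤1 (λ x → P x ∧ (c ≈[ SC ] enc x)) (λ x y hx hy →
           enc-inj y x (∧-true⁻ˡ hy) (∧-true⁻ˡ hx)
             (≈-trans SC (enc y) c (enc x) (≈-sym SC c (enc y) (∧-true⁻ʳ {P y} hy)) (∧-true⁻ʳ {P x} hx)))) ⟩
    sumL cs (λ _ → 1ℚ) ∎
    where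
    open ℚP.≤-Reasoning
    P≤codes : ∀ x → 𝟙 (P x) ≤ sumL cs (λ c → 𝟙 (P x ∧ (c ≈[ SC ] enc x)))
    P≤codes x with P x in e
    ... | true  = enc-in x e
    ... | false = ℚP.≤-reflexive (sym (sumL-0 cs))

𝟙-anyB≤count : ∀ {q} (f : Fin q → Bool) → 𝟙 (anyB f) ≤ count (allFin q) f
𝟙-anyB≤count {zero}  f = ℚP.≤-refl
𝟙-anyB≤count {suc q} f = ℚP.≤-trans (step (f zero) (anyB (f ∘ suc)) (𝟙-anyB≤count (f ∘ suc)))
                                    (ℚP.≤-reflexive (sym (sumL-allFin-suc q (𝟙 ∘ f))))
  where
  step : ∀ a b {s} → 𝟙 b ≤ s → 𝟙 (a ∨ b) ≤ 𝟙 a + s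
  step true  b {s} h =
    ℚP.≤-trans (ℚP.≤-reflexive (sym (ℚP.+-identityʳ 1ℚ))) (ℚP.+-monoʳ-≤ 1ℚ (ℚP.≤-trans (𝟙-nonNeg b) h))
  step false b     h = ℚP.≤-trans h (ℚP.≤-reflexive (sym (ℚP.+-identityˡ _)))

count-image≤ : ∀ {n q} (I : Fin q → Fin n) → count (allFin n) (λ v → anyB (λ y → does (I y ≟ v))) ≤ fromℕ q
count-image≤ {n} {q} I = begin
  count (allFin n) (λ v → anyB (λ y → does (I y ≟ v)))
    ≤⟨ sumL-mono (allFin n) (λ v → 𝟙-anyB≤count (λ y → does (I y ≟ v))) ⟩
  sumL (allFin n) (λ v → count (allFin q) (λ y → does (I y ≟ v)))
    ≡⟨ sumL-swap (allFin n) (allFin q) (λ v y → 𝟙 (does (I y ≟ v))) ⟩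
  sumL (allFin q) (λ y → count (allFin n) (λ v → does (I y ≟ v)))
    ≡⟨ sumL-cong (allFin q) (λ y →
         trans (sumL-cong (allFin n) (λ v → cong 𝟙 (≟-comm (I y) v))) (count-allFin-≟ n (I y))) ⟩
  count (allFin q) (λ _ → true)
    ≡⟨ count≡fromℕ-countB {q} (λ _ → true) ⟩
  fromℕ (countB {q} (λ _ → true))
    ≡⟨ cong fromℕ (countB-true q) ⟩
  fromℕ q ∎
  where open ℚP.≤-Reasoning

-- Counting the right permutations for fixed I

-- J = σ(I_{j+1}) is encoded by its blocks at the first element of every block of Q; the other
-- blocks are then determined, because each is paired in Q with an earlier one.
module TargetCodes {n N d m : ℕ} (I : Fin N → Tup n (d ℕ.* m)) (Q : Rel N d) where
  q : ℕ
  q = d ℕ.* m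

  Targets : Set
  Targets = Fin N → Tup n q

  targetSetoid : BoolSetoid Targets
  targetSetoid = pointwiseSetoid N (tupleSetoid n q)

  partitionOf : Targets → Rel N d
  partitionOf J = SingleTerm.edges (λ j s → block {n} {d} {m} s (I j)) (λ j s → block s (J j))

  hasQ : Targets → Bool
  hasQ J = samePartition (partitionOf J) Q

  leader : Fin N → Fin d → Bool
  leader = isFirst Q

  inImages : Targets → Bool
  inImages J = allB (λ j → inImage (I (next j)) (J j))

  admissible : Targets → Bool
  admissible J = hasQ J ∧ inImages J

  Code : Set
  Code = Fin N → Fin d → Fin m → Fin n

  codeSetoid : BoolSetoid Code
  codeSetoid = pointwiseSetoid N (pointwiseSetoid d (pointwiseSetoid m (finSetoid n)))

  allowed : Fin N → Fin d → Fin m → Fin n → Bool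
  allowed j s t v = if leader j s then anyB (λ y → does (I (next j) y ≟ v)) else does (v ≟ I j (combine s t))

  isCode : Code → Bool
  isCode c = allB (λ j → allB (λ s → allB (λ t → allowed j s t (c j s t))))

  allCodes : List Code
  allCodes = allFuns N (allFuns d (allFuns m (allFin n)))

  codes : List Code
  codes = filterᵇ isCode allCodes

  encode : Targets → Code
  encode J j s t = if leader j s then J j (combine s t) else I j (combine s t)

  choices : Fin N → Fin d → ℚ
  choices j s = prodL (allFin m) (λ t → count (allFin n) (allowed j s t))

  count-isCode : count allCodes isCode ≡ prodP choices
  count-isCode =
    trans (count-allFuns N (allFuns d (allFuns m (allFin n))) (λ j f → allB (λ s → allB (λ t → allowed j s t (f s t)))))
      (prodL-cong (allFin N) (λ j →
        trans (count-allFuns d (allFuns m (allFin n)) (λ s g → allB (λ t → allowed j s t (g t))))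
              (prodL-cong (allFin d) (λ s → count-allFuns m (allFin n) (allowed j s)))))

  choices-nonNeg : ∀ j s → 0ℚ ≤ choices j s
  choices-nonNeg j s = prodL-nonNeg (allFin m) (λ t → count-nonNeg (allFin n) (allowed j s t))

  choices≤ : ∀ j s → choices j s ≤ (if leader j s then fromℕ (q ℕ.^ m) else 1ℚ)
  choices≤ j s with leader j s
  ... | true  = ℚP.≤-trans
    (prodL-mono (allFin m) (λ t → count-nonNeg (allFin n) (λ v → anyB (λ y → does (I (next j) y ≟ v))))
                           (λ t → count-image≤ (I (next j))))
    (ℚP.≤-reflexive (trans (prodL-const (allFin m) (fromℕ q))
      (trans (cong (powℚ (fromℕ q)) (ListP.length-tabulate {n = m} id)) (sym (fromℕ-^ q m)))))
  ... | false = ℚP.≤-reflexive (trans (prodL-cong (allFin m) (λ t → count-allFin-≟ n (I j (combine s t))))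
                                      (prodL-1 (allFin m)))

  sumL-codes≤ : sumL codes (λ _ → 1ℚ) ≤ powℚ (fromℕ (q ℕ.^ m)) (numBlocks Q)
  sumL-codes≤ = begin
    sumL codes (λ _ → 1ℚ)
      ≡⟨ trans (sumL-filter isCode allCodes (λ _ → 1ℚ)) (sumL-cong allCodes (λ c → if-1-0 (isCode c))) ⟩
    count allCodes isCode
      ≡⟨ count-isCode ⟩
    prodP choices
      ≤⟨ prodL-mono (allFin N) (λ j → prodL-nonNeg (allFin d) (choices-nonNeg j))
           (λ j → prodL-mono (allFin d) (choices-nonNeg j) (choices≤ j)) ⟩
    prodP (λ j s → if leader j s then fromℕ (q ℕ.^ m) else 1ℚ)
      ≡⟨ prodP-if-1 leader (fromℕ (q ℕ.^ m)) ⟩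
    powℚ (fromℕ (q ℕ.^ m)) (numBlocks Q) ∎
    where
    open ℚP.≤-Reasoning
    if-1-0 : ∀ b → (if b then 1ℚ else 0ℚ) ≡ 𝟙 b
    if-1-0 true  = refl
    if-1-0 false = refl

  count-codes-≈ : ∀ c → count codes (_≈[ codeSetoid ] c) ≡ 𝟙 (isCode c)
  count-codes-≈ c = begin
    count codes (_≈[ codeSetoid ] c)
      ≡⟨ count-filter-≈ codeSetoid isCode isCode-Respects allCodes c ⟩
    𝟙 (isCode c) * count allCodes (_≈[ codeSetoid ] c)
      ≡⟨ cong (𝟙 (isCode c) *_) (count-pointwise-≈ (pointwiseSetoid d (pointwiseSetoid m (finSetoid n))) N _
           (count-pointwise-≈ (pointwiseSetoid m (finSetoid n)) d _
             (count-pointwise-≈ (finSetoid n) m _ (count-allFin-≟ n))) c) ⟩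
    𝟙 (isCode c) * 1ℚ
      ≡⟨ ℚP.*-identityʳ _ ⟩
    𝟙 (isCode c) ∎
    where
    open ≡-Reasoning
    isCode-Respects : Respects codeSetoid isCode
    isCode-Respects c c′ e = allB-cong (λ j → allB-cong (λ s → allB-cong (λ t →
      cong (allowed j s t) (dec-true⁻ (c j s t ≟ c′ j s t) (allB⁻ _ (allB⁻ _ (allB⁻ _ e j) s) t)))))

  encode-isCode : ∀ J → inImages J ≡ true → isCode (encode J) ≡ true
  encode-isCode J J-in = allB⁺ _ (λ j → allB⁺ _ (λ s → allB⁺ _ (λ t → at j s t (leader j s))))
    where
    at : ∀ j s t b → let v = if b then J j (combine s t) else I j (combine s t) in
      (if b then anyB (λ y → does (I (next j) y ≟ v)) else does (v ≟ I j (combine s t))) ≡ true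
    at j s t true  = allB⁻ _ (allB⁻ _ J-in j) (combine s t)
    at j s t false = dec-true (I j (combine s t) ≟ I j (combine s t)) refl

  module _ (J J′ : Targets) (adm : admissible J ≡ true) (adm′ : admissible J′ ≡ true)
           (same-code : (encode J ≈[ codeSetoid ] encode J′) ≡ true) where
    private
      same-J : SameRel (partitionOf J) Q
      same-J = samePartition⁻ (partitionOf J) Q (∧-true⁻ˡ adm)

      same-J′ : SameRel (partitionOf J′) Q
      same-J′ = samePartition⁻ (partitionOf J′) Q (∧-true⁻ˡ adm′)

      leader-agrees : ∀ j s → leader j s ≡ true → ∀ t → J j (combine s t) ≡ J′ j (combine s t)
      leader-agrees j s lead t = at (leader j s) lead
        (dec-true⁻ (encode J j s t ≟ encode J′ j s t) (allB⁻ _ (allB⁻ _ (allB⁻ _ same-code j) s) t))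
        where
        at : ∀ b → b ≡ true →
          (if b then J j (combine s t) else I j (combine s t)) ≡ (if b then J′ j (combine s t) else I j (combine s t)) →
          J j (combine s t) ≡ J′ j (combine s t)
        at true _ e = e

    blocks-agree : ∀ k j s → pos j s ℕ.< k → eqT (block {n} {d} {m} s (J j)) (block s (J′ j)) ≡ true
    blocks-agree (suc k) j s lt with leader j s in lead
    ... | true  = eqT⁺ _ _ (leader-agrees j s lead)
    ... | false with anyP⁻ _ (trans (sym (BoolP.not-involutive _)) (cong not lead))
    ... | j′ , s′ , earlier = sameEdge-determines
           (block s′ (I j′)) (block s′ (J j′)) (block s′ (J′ j′)) (block s (I j)) (block s (J j)) (block s (J′ j))
           (trans (same-J j′ s′ j s) (∧-true⁻ʳ {pos j′ s′ ℕ.<ᵇ pos j s} earlier))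
           (trans (same-J′ j′ s′ j s) (∧-true⁻ʳ {pos j′ s′ ℕ.<ᵇ pos j s} earlier))
           (blocks-agree k j′ s′ (ℕP.<-≤-trans j′s′<js (ℕP.≤-pred lt)))
      where
      j′s′<js : pos j′ s′ ℕ.< pos j s
      j′s′<js = ℕP.<ᵇ⇒< _ _ (Equivalence.from BoolP.T-≡ (∧-true⁻ˡ earlier))

    encode-injective : (J ≈[ targetSetoid ] J′) ≡ true
    encode-injective = allB⁺ _ (λ j → eqT⁺ _ _ (λ x → begin
      J j x                          ≡⟨ cong (J j) (sym (FinP.combine-remQuot {d} m x)) ⟩
      J j (combine (s-of x) (t-of x))  ≡⟨ eqT⁻ _ _ (blocks-agree (suc (pos j (s-of x))) j (s-of x) (ℕP.n<1+n _)) (t-of x) ⟩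
      J′ j (combine (s-of x) (t-of x)) ≡⟨ cong (J′ j) (FinP.combine-remQuot {d} m x) ⟩
      J′ j x                         ∎))
      where
      open ≡-Reasoning
      s-of : Fin q → Fin d
      s-of x = proj₁ (Fin.remQuot {d} m x)
      t-of : Fin q → Fin m
      t-of x = proj₂ (Fin.remQuot {d} m x)

  count-admissible≤ : count (tupleFamilies n N q) admissible ≤ powℚ (fromℕ (q ℕ.^ m)) (numBlocks Q)
  count-admissible≤ = ℚP.≤-trans
    (count≤-encoding targetSetoid codeSetoid (tupleFamilies n N q) codes
      (λ J → ℚP.≤-reflexive (count-pointwise-≈ (tupleSetoid n q) N (tuples n q) (count-tuples-eqT n q) J))
      admissible encode
      (λ J adm → ℚP.≤-reflexive (sym (trans (count-codes-≈ (encode J))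
                                             (cong 𝟙 (encode-isCode J (∧-true⁻ʳ {hasQ J} adm))))))
      encode-injective)
    sumL-codes≤

module RightPermutationCount {n N d m : ℕ} (I : Fin N → Tup n (d ℕ.* m)) (Q : Rel N d) where
  open TargetCodes {n} {N} {d} {m} I Q

  σs-space : List (Fin N → Fin q → Fin q)
  σs-space = permFamilies N q

  matchesᵇ : (Fin N → Fin q → Fin q) → Bool
  matchesᵇ = hasPartition {n} {N} {d} {m} Q I idPerms

  targets : (Fin N → Fin q → Fin q) → Targets
  targets σs j = act (σs j) (I (next j))

  hasQ-Respects : Respects targetSetoid hasQ
  hasQ-Respects J J′ e = samePartition-cong Q (edges-cong (λ j s t → refl)
    (λ j s t → eqT⁻ (J j) (J′ j) (allB⁻ _ e j) (combine s t)))

  𝟙-matches : ∀ σs →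
    𝟙 (matchesᵇ σs) ≡ sumL (tupleFamilies n N q) (λ J → 𝟙 (J ≈[ targetSetoid ] targets σs) * 𝟙 (hasQ J))
  𝟙-matches σs = sym (begin
    sumL (tupleFamilies n N q) (λ J → 𝟙 (J ≈[ targetSetoid ] targets σs) * 𝟙 (hasQ J))
      ≡⟨ sumL-𝟙≈-* targetSetoid (tupleFamilies n N q) (targets σs) (𝟙 ∘ hasQ)
           (λ J J′ e → cong 𝟙 (hasQ-Respects J J′ e)) ⟩
    count (tupleFamilies n N q) (_≈[ targetSetoid ] targets σs) * 𝟙 (matchesᵇ σs)
      ≡⟨ cong (_* 𝟙 (matchesᵇ σs))
           (count-pointwise-≈ (tupleSetoid n q) N (tuples n q) (count-tuples-eqT n q) (targets σs)) ⟩
    1ℚ * 𝟙 (matchesᵇ σs)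
      ≡⟨ ℚP.*-identityˡ _ ⟩
    𝟙 (matchesᵇ σs) ∎)
    where open ≡-Reasoning

  histFacts : ℚ
  histFacts = prodL (allFin N) (λ j → fromℕ (histFact (I (next j))))

  histFacts-nonNeg : 0ℚ ≤ histFacts
  histFacts-nonNeg = prodL-nonNeg (allFin N) (λ j → fromℕ-nonNeg (histFact (I (next j))))

  count-σs-targets≤ : ∀ J → count σs-space (λ σs → J ≈[ targetSetoid ] targets σs) ≤ 𝟙 (inImages J) * histFacts
  count-σs-targets≤ J = begin
    count σs-space (λ σs → J ≈[ targetSetoid ] targets σs)
      ≡⟨ count-allFuns N (perms q) (λ j τ → eqT (J j) (act τ (I (next j)))) ⟩
    prodL (allFin N) (λ j → count (perms q) (λ τ → eqT (J j) (act τ (I (next j)))))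
      ≤⟨ prodL-mono (allFin N) (λ j → count-nonNeg (perms q) (λ τ → eqT (J j) (act τ (I (next j))))) per-coordinate ⟩
    prodL (allFin N) (λ j → 𝟙 (inImage (I (next j)) (J j)) * fromℕ (histFact (I (next j))))
      ≡⟨ prodL-* (allFin N) (λ j → 𝟙 (inImage (I (next j)) (J j))) (λ j → fromℕ (histFact (I (next j)))) ⟩
    prodL (allFin N) (λ j → 𝟙 (inImage (I (next j)) (J j))) * histFacts
      ≡⟨ cong (_* histFacts) (sym (𝟙-allB (λ j → inImage (I (next j)) (J j)))) ⟩
    𝟙 (inImages J) * histFacts ∎
    where
    open ℚP.≤-Reasoning
    per-coordinate : ∀ j → count (perms q) (λ τ → eqT (J j) (act τ (I (next j))))
                         ≤ 𝟙 (inImage (I (next j)) (J j)) * fromℕ (histFact (I (next j)))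
    per-coordinate j = ℚP.≤-trans
      (ℚP.≤-reflexive (sumL-cong (perms q) (λ τ → cong 𝟙 (eqT-comm (J j) (act τ (I (next j)))))))
      (count-perms-act≤histFact q (I (next j)) (J j))

  count-matching≤ : count σs-space matchesᵇ ≤
    powℚ (fromℕ (q ℕ.^ m)) (numBlocks Q) * prodL (allFin N) (λ j → fromℕ (histFact (I j)))
  count-matching≤ = begin
    count σs-space matchesᵇ
      ≡⟨ sumL-cong σs-space 𝟙-matches ⟩
    sumL σs-space (λ σs → sumL Js (λ J → 𝟙 (J ≈[ targetSetoid ] targets σs) * 𝟙 (hasQ J)))
      ≡⟨ sumL-swap σs-space Js (λ σs J → 𝟙 (J ≈[ targetSetoid ] targets σs) * 𝟙 (hasQ J)) ⟩
    sumL Js (λ J → sumL σs-space (λ σs → 𝟙 (J ≈[ targetSetoid ] targets σs) * 𝟙 (hasQ J)))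
      ≡⟨ sumL-cong Js (λ J → sumL-*ʳ σs-space (𝟙 (hasQ J)) (λ σs → 𝟙 (J ≈[ targetSetoid ] targets σs))) ⟩
    sumL Js (λ J → count σs-space (λ σs → J ≈[ targetSetoid ] targets σs) * 𝟙 (hasQ J))
      ≤⟨ sumL-mono Js (λ J → *-monoʳ-≤-0≤ (𝟙 (hasQ J)) (𝟙-nonNeg (hasQ J)) (count-σs-targets≤ J)) ⟩
    sumL Js (λ J → 𝟙 (inImages J) * histFacts * 𝟙 (hasQ J))
      ≡⟨ sumL-cong Js (λ J → trans (ℚP.*-comm (𝟙 (inImages J) * histFacts) (𝟙 (hasQ J)))
           (trans (sym (ℚP.*-assoc (𝟙 (hasQ J)) (𝟙 (inImages J)) histFacts))
                  (cong (_* histFacts) (sym (𝟙-∧ (hasQ J) (inImages J)))))) ⟩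
    sumL Js (λ J → 𝟙 (admissible J) * histFacts)
      ≡⟨ sumL-*ʳ Js histFacts (𝟙 ∘ admissible) ⟩
    count Js admissible * histFacts
      ≤⟨ *-monoʳ-≤-0≤ histFacts histFacts-nonNeg count-admissible≤ ⟩
    powℚ (fromℕ (q ℕ.^ m)) (numBlocks Q) * histFacts
      ≡⟨ cong (powℚ (fromℕ (q ℕ.^ m)) (numBlocks Q) *_) (prodL-next N (λ j → fromℕ (histFact (I j)))) ⟩
    powℚ (fromℕ (q ℕ.^ m)) (numBlocks Q) * prodL (allFin N) (λ j → fromℕ (histFact (I j))) ∎
    where
    open ℚP.≤-Reasoning
    Js : List Targets
    Js = tupleFamilies n N q

  count-matching≤-valid : count σs-space matchesᵇ ≤ 𝟙 (isValid {n} {N} {d} {m} Q I) *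
    (powℚ (fromℕ (q ℕ.^ m)) (numBlocks Q) * prodL (allFin N) (λ j → fromℕ (histFact (I j))))
  count-matching≤-valid = ℚP.≤-trans (ℚP.≤-reflexive (count≡𝟙any*count matchesᵇ σs-space))
    (*-monoˡ-≤-0≤ (𝟙 (BoolList.any matchesᵇ σs-space)) (𝟙-nonNeg (BoolList.any matchesᵇ σs-space)) count-matching≤)

-- Assembling the bound

SΦ-Respects : ∀ {n m} (ω : Instance n m) → Respects (tupleSetoid n (m ℕ.+ m)) ω →
  ∀ U U′ V V′ → eqT U U′ ≡ true → eqT V V′ ≡ true → SΦ {n} {m} ω U V ≡ SΦ ω U′ V′
SΦ-Respects ω ω-resp U U′ V V′ U≈U′ V≈V′ = cong (½ *_) (cong₂ _+_
  (cong val (ω-resp (U Vector.++ V) (U′ Vector.++ V′) (trans (eqT-++ U U′ V V′) (∧-true⁺ U≈U′ V≈V′))))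
  (cong val (ω-resp (V Vector.++ U) (V′ Vector.++ U′) (trans (eqT-++ V V′ U U′) (∧-true⁺ V≈V′ U≈U′)))))

RΦd-Respects : ∀ {n m} d (ω : Instance n m) → Respects (tupleSetoid n (m ℕ.+ m)) ω →
  ∀ I I′ J J′ → eqT I I′ ≡ true → eqT J J′ ≡ true → RΦd d ω I J ≡ RΦd d ω I′ J′
RΦd-Respects {n} {m} d ω ω-resp I I′ J J′ I≈I′ J≈J′ =
  cong (inv! (d ℕ.* m) * inv! (d ℕ.* m) *_) (sumL-cong (perms (d ℕ.* m)) (λ π →
    sumL-cong (perms (d ℕ.* m)) (λ σ → prodL-cong (allFin d) (λ s →
      SΦ-Respects {n} {m} ω ω-resp (block s (act π I)) (block s (act π I′)) (block s (act σ J)) (block s (act σ J′))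
        (blocks π I I′ s I≈I′) (blocks σ J J′ s J≈J′)))))
  where
  blocks : ∀ π (I I′ : Tup n (d ℕ.* m)) s → eqT I I′ ≡ true →
    eqT (block {n} {d} {m} s (act π I)) (block s (act π I′)) ≡ true
  blocks π I I′ s e = eqT⁺ _ _ (λ t → eqT⁻ I I′ e (π (combine s t)))

module Assembly (m d n M : ℕ) (p : ℚ) where
  N q : ℕ
  N = suc M
  q = d ℕ.* m

  c K : ℚ
  c = inv! q
  K = powℚ (c * c) N

  open ProductMeasure (tupleSetoid n (m ℕ.+ m)) p

  L : List (Tup n (m ℕ.+ m))
  L = tuples n (m ℕ.+ m)

  Is-space : List (Fin N → Tup n q)
  Is-space = tupleFamilies n N q

  σs-space : List (Fin N → Fin q → Fin q)
  σs-space = permFamilies N q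

  R : Instance n m → Mat n q
  R ω = RΦd {n} {m} d ω

  term : (Fin N → Tup n q) → (πs σs : Fin N → Fin q → Fin q) → Instance n m → ℚ
  term Is πs σs = SingleTerm.term (leftHalf {n} {N} {d} {m} Is πs) (rightHalf Is σs)

  expectedTerms : ℚ
  expectedTerms = sumL Is-space (λ Is → sumL σs-space (λ πs → sumL σs-space (λ σs → 𝔼ᴸ L (term Is πs σs))))

  prodL-R-expansion : ∀ ω Is → prodL (allFin N) (λ j → R ω (Is j) (Is (next j))) ≡
    K * sumL σs-space (λ πs → sumL σs-space (λ σs → term Is πs σs ω))
  prodL-R-expansion ω Is = trans (prodL-* (allFin N) (λ _ → c * c) sums)
    (cong₂ _*_ (trans (prodL-const (allFin N) (c * c)) (cong (powℚ (c * c)) (ListP.length-tabulate {n = N} id)))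
      (trans (prodL-sumL N (perms q) (λ j π → sumL (perms q) (λ σ → entry j π σ)))
        (sumL-cong σs-space (λ πs → prodL-sumL N (perms q) (λ j σ → entry j (πs j) σ)))))
    where
    entry : Fin N → (π σ : Fin q → Fin q) → ℚ
    entry j π σ = SΦd d ω (act π (Is j)) (act σ (Is (next j)))
    sums : Fin N → ℚ
    sums j = sumL (perms q) (λ π → sumL (perms q) (entry j π))

  𝔼-trace-expansion : 𝔼 n m p (λ ω → trace (powMat (R ω) N)) ≡ K * expectedTerms
  𝔼-trace-expansion = begin
    𝔼ᴸ L (λ ω → trace (powMat (R ω) N))
      ≡⟨ 𝔼ᴸ-cong-Respects L (λ ω ω-resp → trans (ClosedWalks.trace-powMat (R ω) (RΦd-Respects d ω ω-resp) M)
           (sumL-cong Is-space (prodL-R-expansion ω))) ⟩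
    𝔼ᴸ L (λ ω → sumL Is-space (λ Is → K * terms Is ω))
      ≡⟨ 𝔼ᴸ-sumL L Is-space (λ Is ω → K * terms Is ω) ⟩
    sumL Is-space (λ Is → 𝔼ᴸ L (λ ω → K * terms Is ω))
      ≡⟨ sumL-cong Is-space (λ Is → trans (𝔼ᴸ-*ˡ L K (terms Is)) (cong (K *_)
           (trans (𝔼ᴸ-sumL L σs-space (λ πs ω → sumL σs-space (λ σs → term Is πs σs ω)))
                  (sumL-cong σs-space (λ πs → 𝔼ᴸ-sumL L σs-space (term Is πs)))))) ⟩
    sumL Is-space (λ Is → K * sumL σs-space (λ πs → sumL σs-space (λ σs → 𝔼ᴸ L (term Is πs σs))))
      ≡⟨ sumL-*ˡ Is-space K _ ⟩
    K * expectedTerms ∎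
    where
    open ≡-Reasoning
    terms : (Fin N → Tup n q) → Instance n m → ℚ
    terms Is ω = sumL σs-space (λ πs → sumL σs-space (λ σs → term Is πs σs ω))

  𝔼-term≤evenWeight : 0ℚ ≤ p → p ≤ 1ℚ → ∀ Is πs σs →
    𝔼ᴸ L (term Is πs σs) ≤ evenWeight p (Par {n} {N} {d} {m} Is πs σs)
  𝔼-term≤evenWeight 0≤p p≤1 Is πs σs with isEvenPartition (Par {n} {N} {d} {m} Is πs σs) in even
  ... | true  = ℚP.≤-trans (SingleTerm.𝔼-term≤ U V p 0≤p p≤1)
                  (ℚP.≤-reflexive (sym (evenWeight-even p (Par {n} {N} {d} {m} Is πs σs)
                                                        (sameEdge-isEquivalence U V) even)))
    where
    U V : Fin N → Fin d → Tup n m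
    U = leftHalf Is πs
    V = rightHalf Is σs
  ... | false with allP-false⁻ (λ j s → isEvenℕ (countP (Par {n} {N} {d} {m} Is πs σs j s))) even
  ... | j₀ , s₀ , odd = ℚP.≤-trans (ℚP.≤-reflexive (SingleTerm.𝔼-term-odd U V p j₀ s₀ odd))
                          (evenWeight-nonNeg p 0≤p (Par {n} {N} {d} {m} Is πs σs))
    where
    U V : Fin N → Fin d → Tup n m
    U = leftHalf Is πs
    V = rightHalf Is σs

  matching : (Fin N → Fin q → Fin q) → Rel N d → ℚ
  matching πs Q = sumL Is-space (λ Is → sumL σs-space (RemoveLeftPermutations.matches {n} {N} {d} {m} Q Is πs))

  histWeight : Rel N d → ℚ
  histWeight Q = sumL (validTuples n N d m Q) (λ Is → prodL (allFin N) (λ j → fromℕ (histFact (Is j))))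

  rhs : ℚ
  rhs = sumL (evenPartitions N d) (λ Q → powℚ (p * fromℕ (q ℕ.^ m)) (numBlocks Q) * histWeight Q)

  sumL-evenWeight : ∀ πs → sumL Is-space (λ Is → sumL σs-space (λ σs → evenWeight p (Par {n} {N} {d} {m} Is πs σs)))
                         ≡ sumL (evenPartitions N d) (λ Q → powℚ p (numBlocks Q) * matching πs Q)
  sumL-evenWeight πs = begin
    sumL Is-space (λ Is → sumL σs-space (λ σs → sumL evens (λ Q → 𝟙 (has Q Is σs) * w Q)))
      ≡⟨ sumL-cong Is-space (λ Is → sumL-swap σs-space evens (λ σs Q → 𝟙 (has Q Is σs) * w Q)) ⟩
    sumL Is-space (λ Is → sumL evens (λ Q → sumL σs-space (λ σs → 𝟙 (has Q Is σs) * w Q)))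
      ≡⟨ sumL-swap Is-space evens (λ Is Q → sumL σs-space (λ σs → 𝟙 (has Q Is σs) * w Q)) ⟩
    sumL evens (λ Q → sumL Is-space (λ Is → sumL σs-space (λ σs → 𝟙 (has Q Is σs) * w Q)))
      ≡⟨ sumL-cong evens (λ Q → trans (sumL-cong Is-space (λ Is → sumL-*ʳ σs-space (w Q) (λ σs → 𝟙 (has Q Is σs))))
           (trans (sumL-*ʳ Is-space (w Q) (λ Is → sumL σs-space (λ σs → 𝟙 (has Q Is σs))))
                  (ℚP.*-comm (matching πs Q) (w Q)))) ⟩
    sumL evens (λ Q → w Q * matching πs Q) ∎
    where
    open ≡-Reasoning
    evens : List (Rel N d)
    evens = evenPartitions N d
    w : Rel N d → ℚ
    w Q = powℚ p (numBlocks Q)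
    has : Rel N d → (Fin N → Tup n q) → (Fin N → Fin q → Fin q) → Bool
    has Q Is σs = hasPartition {n} {N} {d} {m} Q Is πs σs

  matching≤ : ∀ πs → (∀ j → isInjective (πs j) ≡ true) → ∀ Q →
    matching πs Q ≤ powℚ (fromℕ (q ℕ.^ m)) (numBlocks Q) * histWeight Q
  matching≤ πs πs-inj Q = begin
    matching πs Q
      ≡⟨ RemoveLeftPermutations.sumL-matches-remove-πs Q πs πs-inj ⟩
    matching idPerms Q
      ≤⟨ sumL-mono Is-space (λ Is → RightPermutationCount.count-matching≤-valid Is Q) ⟩
    sumL Is-space (λ Is → 𝟙 (valid Is) * (X * H Is))
      ≡⟨ sumL-cong Is-space (λ Is → x*[y*z]≡y*[x*z] (𝟙 (valid Is)) X (H Is)) ⟩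
    sumL Is-space (λ Is → X * (𝟙 (valid Is) * H Is))
      ≡⟨ sumL-*ˡ Is-space X (λ Is → 𝟙 (valid Is) * H Is) ⟩
    X * sumL Is-space (λ Is → 𝟙 (valid Is) * H Is)
      ≡⟨ cong (X *_) (sym (trans (sumL-filter valid Is-space H)
                                 (sumL-cong Is-space (λ Is → if-then-else-0 (valid Is) (H Is))))) ⟩
    X * histWeight Q ∎
    where
    open ℚP.≤-Reasoning
    X : ℚ
    X = powℚ (fromℕ (q ℕ.^ m)) (numBlocks Q)
    valid : (Fin N → Tup n q) → Bool
    valid = isValid {n} {N} {d} {m} Q
    H : (Fin N → Tup n q) → ℚ
    H Is = prodL (allFin N) (λ j → fromℕ (histFact (Is j)))

  sumL-matching≤rhs : 0ℚ ≤ p → ∀ πs → (∀ j → isInjective (πs j) ≡ true) →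
    sumL (evenPartitions N d) (λ Q → powℚ p (numBlocks Q) * matching πs Q) ≤ rhs
  sumL-matching≤rhs 0≤p πs πs-inj = sumL-mono (evenPartitions N d) (λ Q → ℚP.≤-trans
    (*-monoˡ-≤-0≤ (powℚ p (numBlocks Q)) (powℚ-nonNeg p 0≤p (numBlocks Q)) (matching≤ πs πs-inj Q))
    (ℚP.≤-reflexive (trans (sym (ℚP.*-assoc (powℚ p (numBlocks Q)) _ (histWeight Q)))
                           (cong (_* histWeight Q) (sym (powℚ-* p (fromℕ (q ℕ.^ m)) (numBlocks Q)))))))

  expectedTerms≤ : 0ℚ ≤ p → p ≤ 1ℚ → expectedTerms ≤ sumL σs-space (λ _ → rhs)
  expectedTerms≤ 0≤p p≤1 = begin
    expectedTerms
      ≤⟨ sumL-mono Is-space (λ Is → sumL-mono σs-space (λ πs →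
           sumL-mono σs-space (𝔼-term≤evenWeight 0≤p p≤1 Is πs))) ⟩
    sumL Is-space (λ Is → sumL σs-space (λ πs → weights Is πs))
      ≡⟨ trans (sumL-swap Is-space σs-space weights) (sumL-cong σs-space sumL-evenWeight) ⟩
    sumL σs-space (λ πs → sumL (evenPartitions N d) (λ Q → powℚ p (numBlocks Q) * matching πs Q))
      ≤⟨ sumL-mono-All σs-space (All.map (λ {πs} → sumL-matching≤rhs 0≤p πs)
           (allFuns-All (λ σ → isInjective σ ≡ true) N (perms q) (perms-injective q))) ⟩
    sumL σs-space (λ _ → rhs) ∎
    where
    open ℚP.≤-Reasoning
    weights : (Fin N → Tup n q) → (Fin N → Fin q → Fin q) → ℚ
    weights Is πs = sumL σs-space (λ σs → evenWeight p (Par {n} {N} {d} {m} Is πs σs))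

  rhs-nonNeg : 0ℚ ≤ p → 0ℚ ≤ rhs
  rhs-nonNeg 0≤p = sumL-nonNeg (evenPartitions N d) (λ Q →
    0≤* (powℚ-nonNeg _ (0≤* 0≤p (fromℕ-nonNeg (q ℕ.^ m))) (numBlocks Q))
        (sumL-nonNeg (validTuples n N d m Q) (λ Is → prodL-nonNeg (allFin N) (λ j → fromℕ-nonNeg (histFact (Is j))))))

  sumL-σs-space-1≤ : sumL σs-space (λ _ → 1ℚ) ≤ powℚ (fromℕ (q !)) N
  sumL-σs-space-1≤ = begin
    sumL σs-space (λ _ → 1ℚ)
      ≡⟨ sym (trans (prodL-sumL N (perms q) (λ _ _ → 1ℚ)) (sumL-cong σs-space (λ _ → prodL-1 (allFin N)))) ⟩
    prodL (allFin N) (λ _ → sumL (perms q) (λ _ → 1ℚ))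
      ≤⟨ prodL-mono (allFin N) (λ _ → sumL-nonNeg (perms q) (λ _ → 0≤1)) (λ _ → sumL-perms-1≤! q) ⟩
    prodL (allFin N) (λ _ → fromℕ (q !))
      ≡⟨ trans (prodL-const (allFin N) (fromℕ (q !))) (cong (powℚ (fromℕ (q !))) (ListP.length-tabulate {n = N} id)) ⟩
    powℚ (fromℕ (q !)) N ∎
    where open ℚP.≤-Reasoning

  K*[q!]^N : K * powℚ (fromℕ (q !)) N ≡ powℚ c N
  K*[q!]^N = begin
    powℚ (c * c) N * powℚ (fromℕ (q !)) N        ≡⟨ cong (_* powℚ (fromℕ (q !)) N) (powℚ-* c c N) ⟩
    powℚ c N * powℚ c N * powℚ (fromℕ (q !)) N   ≡⟨ ℚP.*-assoc (powℚ c N) (powℚ c N) _ ⟩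
    powℚ c N * (powℚ c N * powℚ (fromℕ (q !)) N) ≡⟨ cong (powℚ c N *_) (sym (powℚ-* c (fromℕ (q !)) N)) ⟩
    powℚ c N * powℚ (c * fromℕ (q !)) N          ≡⟨ cong (λ z → powℚ c N * powℚ z N) (inv!*fromℕ-! q) ⟩
    powℚ c N * powℚ 1ℚ N                         ≡⟨ cong (powℚ c N *_) (powℚ-1 N) ⟩
    powℚ c N * 1ℚ                                ≡⟨ ℚP.*-identityʳ _ ⟩
    powℚ c N                                     ∎
    where open ≡-Reasoning

  K-nonNeg : 0ℚ ≤ K
  K-nonNeg = powℚ-nonNeg _ (0≤* (inv!-nonNeg q) (inv!-nonNeg q)) N

  K*sumL-σs-space-rhs≤ : 0ℚ ≤ p → K * sumL σs-space (λ _ → rhs) ≤ powℚ c N * rhs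
  K*sumL-σs-space-rhs≤ 0≤p = begin
    K * sumL σs-space (λ _ → rhs)      ≡⟨ cong (K *_) (trans (sumL-cong σs-space (λ _ → sym (ℚP.*-identityˡ rhs)))
                                                            (sumL-*ʳ σs-space rhs (λ _ → 1ℚ))) ⟩
    K * (sumL σs-space (λ _ → 1ℚ) * rhs)
      ≤⟨ *-monoˡ-≤-0≤ K K-nonNeg (*-monoʳ-≤-0≤ rhs (rhs-nonNeg 0≤p) sumL-σs-space-1≤) ⟩
    K * (powℚ (fromℕ (q !)) N * rhs)   ≡⟨ trans (sym (ℚP.*-assoc K _ rhs)) (cong (_* rhs) K*[q!]^N) ⟩
    powℚ c N * rhs                     ∎
    where open ℚP.≤-Reasoning

theorem1 : (m d ℓ n : ℕ) → m ≥ 1 → d ≥ 1 → ℓ ≥ 1 →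
    (p : ℚ) → 0ℚ ≤ p → p ≤ 1ℚ →
    𝔼 n m p (λ ω → trace (powMat (RΦd {n} {m} d ω) (2 ℕ.* ℓ)))
      ≤ powℚ (inv! (d ℕ.* m)) (2 ℕ.* ℓ) *
        sumL (evenPartitions (2 ℕ.* ℓ) d) (λ Q →
          powℚ (p * fromℕ ((d ℕ.* m) ℕ.^ m)) (numBlocks Q) *
          sumL (validTuples n (2 ℕ.* ℓ) d m Q) (λ Is →
            prodL (Data.List.allFin (2 ℕ.* ℓ)) (λ j → fromℕ (histFact (Is j)))))
theorem1 m d zero    n _ _ () p 0≤p p≤1
theorem1 m d (suc ℓ) n _ _ _  p 0≤p p≤1 = begin
  𝔼 n m p (λ ω → trace (powMat (R ω) N))  ≡⟨ 𝔼-trace-expansion ⟩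
  K * expectedTerms                        ≤⟨ *-monoˡ-≤-0≤ K K-nonNeg (expectedTerms≤ 0≤p p≤1) ⟩
  K * sumL σs-space (λ _ → rhs)            ≤⟨ K*sumL-σs-space-rhs≤ 0≤p ⟩
  powℚ c N * rhs                           ∎
  where
  open ℚP.≤-Reasoning
  -- 2 * suc ℓ normalises to suc (ℓ + suc (ℓ + 0))
  open Assembly m d n (ℓ ℕ.+ suc (ℓ ℕ.+ 0)) p
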